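{- Let $\tau$ be a set. There is a fully faithful functor from the category of $\mathcal{W}_\tau$-algebras (operad functors $H:\mathcal{W}_\tau\to\mathbf{Set}$, with natural transformations as morphisms) to the category of strict symmetric monoidal categories whose objects are the $\tau$-typed finite sets, with identity-on-objects symmetric monoidal functors as morphisms. On objects it sends $H$ to the symmetric monoidal category $\mathcal{C}$ with $\mathcal{C}(\mathbf{t}_-,\mathbf{t}_+)=H(\mathbf{t}_-,\mathbf{t}_+)$, identity on $A$ the image of $H(\mathsf{unit}_A):1\to H(A,A)$, composition $H(\mathsf{seq}_{(A,B,C)}):H(A,B)\times H(B,C)\to H(A,C)$, and monoidal product of morphisms $H(\mathsf{para}):H(A,B)\times H(A',B')\to H(A\oplus A',B\oplus B')$.
   Context: Fix a set $\tau$ of types. A $\tau$-typed finite set is a finite set $X$ with a map $X\to\tau$; $\mathbf{Bij}_\tau$ is the category of $\tau$-typed finite sets and type-preserving bijections, and $\oplus$ denotes disjoint union of typed sets. $\mathbf{Set}$ is regarded as an operad via its cartesian monoidal structure. The operad $\mathcal{W}_\tau$ of acyclic wiring diagrams is defined as follows. Objects ("boxes"): pairs $\mathbf{t}=(\mathbf{t}_-,\mathbf{t}_+)$ of $\tau$-typed finite sets (inputs and outputs). Morphisms ("wiring diagrams") $\Phi:\mathbf{t}^1,\dots,\mathbf{t}^n\to\mathbf{v}$: isomorphism classes of spans in $\mathbf{Bij}_\tau$ $$\mathbf{v}_-\oplus\mathbf{t}_+\xleftarrow{\Phi_{\mathrm{src}}}\omega\xrightarrow{\Phi_{\mathrm{tgt}}}\mathbf{t}_-\oplus\mathbf{v}_+,$$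 where $\mathbf{t}_\pm=\bigoplus_{i=1}^n\mathbf{t}^i_\pm$; elements of $\omega$ are wires. They satisfy the progress condition: setting $\mathbf{t}^i\prec\mathbf{t}^j$ whenever some wire $A$ has $\Phi_{\mathrm{src}}(A)\in\mathbf{t}^i_+$ and $\Phi_{\mathrm{tgt}}(A)\in\mathbf{t}^j_-$, the result must be a partial order on the inner boxes (no directed cycles). Identity on $\mathbf{t}$: the identity span on $\mathbf{t}_-\oplus\mathbf{t}_+$. Partial composition: given $\Psi:\mathbf{s}^1,\dots,\mathbf{s}^m\to\mathbf{t}^i$ and $\Phi:\mathbf{t}^1,\dots,\mathbf{t}^n\to\mathbf{v}$, the composite $\Psi\,;_i\,\Phi:\mathbf{t}^1,\dots,\mathbf{t}^{i-1},\mathbf{s}^1,\dots,\mathbf{s}^m,\mathbf{t}^{i+1},\dots,\mathbf{t}^n\to\mathbf{v}$ has, with $\mathbf{u}_-=\mathbf{v}_-\oplus\bigoplus_{j\ne i}\mathbf{t}^j_+$, $\mathbf{u}_+=\bigoplus_{j\neq i}\mathbf{t}^j_-\oplus\mathbf{v}_+$, $\mathbf{s}_\pm=\bigoplus_k\mathbf{s}^k_\pm$, the following wires (obtained by fusing wires through the ports of $\mathbf{t}^i$): (i) from $\mathbf{u}_-$ to $\mathbf{s}_-$: a $\Phi$-wire from $\mathbf{u}_-$ to $p\in\mathbf{t}^i_-$ followed by the $\Psi$-wire from $p$ to $\mathbf{s}_-$; (ii) from $\mathbf{u}_-$ to $\mathbf{u}_+$: the $\Phi$-wires between them, and chains $\Phi$-wire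 $\mathbf{u}_-\to p\in\mathbf{t}^i_-$, $\Psi$-wire $p\to q\in\mathbf{t}^i_+$, $\Phi$-wire $q\to\mathbf{u}_+$; (iii) from $\mathbf{s}_+$ to $\mathbf{s}_-$: the $\Psi$-wires between them; (iv) from $\mathbf{s}_+$ to $\mathbf{u}_+$: a $\Psi$-wire $\mathbf{s}_+\to q\in\mathbf{t}^i_+$ followed by the $\Phi$-wire $q\to\mathbf{u}_+$. Special diagrams: $\mathsf{unit}_A:()\to(A,A)$ is the $0$-ary diagram connecting each input of the outer box identically to the corresponding output; $\mathsf{seq}_{(A,B,C)}:(A,B),(B,C)\to(A,C)$ connects outer inputs $A$ to the first box's inputs, the first box's outputs $B$ to the second box's inputs $B$, and the second box's outputs to the outer outputs $C$, all identically; $\mathsf{para}:(A,B),(A',B')\to(A\oplus A',B\oplus B')$ connects outer inputs $A,A'$ identically to the inputs of the first and second box, and their outputs $B,B'$ identically to the outer outputs. -}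

module Defs where

open import Level using (Level)
open import Data.Nat using (ℕ; zero; suc)
open import Data.Fin using (Fin; zero; suc)
open import Data.Empty using (⊥; ⊥-elim)
open import Data.Unit using (⊤; tt)
open import Data.Sum using (_⊎_; inj₁; inj₂; [_,_])
import Data.Sum as Sum
open import Data.Product using (Σ; _×_; _,_; proj₁; proj₂)
open import Data.List using (List; []; _∷_; _++_; length; lookup)
open import Data.List.Properties using (++-assoc; ++-identityʳ)
open import Data.List.Relation.Unary.All using (All; []; _∷_)
import Data.List.Relation.Unary.All as All
open import Data.List.Relation.Unary.All.Properties using (++⁺)
open import Relation.Binary.PropositionalEquality
  using (_≡_; refl; sym; trans; cong; cong₂; subst; subst₂)
open import Relation.Binary.Construct.Closure.Transitive using (TransClosure) renaming ([_] to ⟦_⟧; _∷_ to _◂_)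
open import Relation.Nullary using (¬_)

module WiringDiagrams (τ : Set) where

  -- A τ-typed finite set is represented by a list X : List τ: its
  -- elements ("ports") are the positions Fin (length X), and the typing
  -- map is  lookup X.  Disjoint union ⊕ of typed sets is  _++_  (which is
  -- strictly associative and unital up to ≡, as needed for a *strict*
  -- monoidal category on these objects).

  TSet : Set
  TSet = List τ

  Port : TSet → Set
  Port X = Fin (length X)

  ty : (X : TSet) → Port X → τ
  ty X = lookup X

  inl : ∀ X Y → Port X → Port (X ++ Y)
  inl (x ∷ X) Y zero    = zero
  inl (x ∷ X) Y (suc p) = suc (inl X Y p)

  inr : ∀ X Y → Port Y → Port (X ++ Y)
  inr []      Y q = q
  inr (x ∷ X) Y q = suc (inr X Y q)

  join : ∀ X Y → Port X ⊎ Port Y → Port (X ++ Y)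
  join X Y = [ inl X Y , inr X Y ]

  split : ∀ X Y → Port (X ++ Y) → Port X ⊎ Port Y
  split []      Y q       = inj₂ q
  split (x ∷ X) Y zero    = inj₁ zero
  split (x ∷ X) Y (suc p) = Sum.map suc (λ q → q) (split X Y p)

  split-join : ∀ X Y (z : Port X ⊎ Port Y) → split X Y (join X Y z) ≡ z
  split-join (x ∷ X) Y (inj₁ zero)    = refl
  split-join (x ∷ X) Y (inj₁ (suc p)) rewrite split-join X Y (inj₁ p) = refl
  split-join []      Y (inj₂ q)       = refl
  split-join (x ∷ X) Y (inj₂ q)       rewrite split-join X Y (inj₂ q) = refl

  join-split : ∀ X Y (q : Port (X ++ Y)) → join X Y (split X Y q) ≡ q
  join-split []      Y q       = refl
  join-split (x ∷ X) Y zero    = refl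
  join-split (x ∷ X) Y (suc p) with split X Y p | join-split X Y p
  ... | inj₁ a | e = cong suc e
  ... | inj₂ b | e = cong suc e

  join-ty : ∀ X Y (z : Port X ⊎ Port Y) → ty (X ++ Y) (join X Y z) ≡ [ ty X , ty Y ] z
  join-ty (x ∷ X) Y (inj₁ zero)    = refl
  join-ty (x ∷ X) Y (inj₁ (suc p)) = join-ty X Y (inj₁ p)
  join-ty []      Y (inj₂ q)       = refl
  join-ty (x ∷ X) Y (inj₂ q)       = join-ty X Y (inj₂ q)

  record TBij {A B : Set} (tA : A → τ) (tB : B → τ) : Set where
    field
      to      : A → B
      from    : B → A
      from-to : ∀ a → from (to a) ≡ a
      to-from : ∀ b → to (from b) ≡ b
      typed   : ∀ a → tB (to a) ≡ tA a

  Box : Set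
  Box = TSet × TSet

  -- Disjoint union of the ports (selected by f = proj₁ or proj₂) of a
  -- list of inner boxes; e.g.  Ports proj₁ ts = t₋ = ⊕ᵢ tⁱ₋ .
  Ports : (Box → TSet) → List Box → Set
  Ports f []       = ⊥
  Ports f (b ∷ bs) = Port (f b) ⊎ Ports f bs

  portsTy : ∀ f bs → Ports f bs → τ
  portsTy f (b ∷ bs) (inj₁ p) = ty (f b) p
  portsTy f (b ∷ bs) (inj₂ q) = portsTy f bs q

  boxOf : ∀ f bs → Ports f bs → Fin (length bs)
  boxOf f (b ∷ bs) (inj₁ p) = zero
  boxOf f (b ∷ bs) (inj₂ q) = suc (boxOf f bs q)

  pL : ∀ f xs ys → Ports f xs → Ports f (xs ++ ys)
  pL f (x ∷ xs) ys (inj₁ p) = inj₁ p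
  pL f (x ∷ xs) ys (inj₂ q) = inj₂ (pL f xs ys q)

  pR : ∀ f xs ys → Ports f ys → Ports f (xs ++ ys)
  pR f []       ys q = q
  pR f (x ∷ xs) ys q = inj₂ (pR f xs ys q)

  swapP : ∀ f pre a b post → Ports f (pre ++ a ∷ b ∷ post) → Ports f (pre ++ b ∷ a ∷ post)
  swapP f []        a b post (inj₁ p)          = inj₂ (inj₁ p)
  swapP f []        a b post (inj₂ (inj₁ q))   = inj₁ q
  swapP f []        a b post (inj₂ (inj₂ r))   = inj₂ (inj₂ r)
  swapP f (c ∷ pre) a b post (inj₁ p)          = inj₁ p
  swapP f (c ∷ pre) a b post (inj₂ r)          = inj₂ (swapP f pre a b post r)

  InP OutP : List Box → Set
  InP  = Ports proj₁
  OutP = Ports proj₂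

  Src : List Box → Box → Set
  Src ts v = Port (proj₁ v) ⊎ OutP ts

  Tgt : List Box → Box → Set
  Tgt ts v = InP ts ⊎ Port (proj₂ v)

  srcTy : ∀ ts v → Src ts v → τ
  srcTy ts v = [ ty (proj₁ v) , portsTy proj₂ ts ]

  tgtTy : ∀ ts v → Tgt ts v → τ
  tgtTy ts v = [ portsTy proj₁ ts , ty (proj₂ v) ]

  -- Wiring diagrams  Φ : t¹ … tⁿ → v  (representatives of the
  -- isomorphism classes of spans  v₋ ⊕ t₊ ← ω → t₋ ⊕ v₊  in Bij_τ).

  -- tⁱ ≺ tʲ (one step): some wire goes from tⁱ₊ to tʲ₋
  StepOf : ∀ ts v {ω : Set} → (ω → Src ts v) → (ω → Tgt ts v) →
           Fin (length ts) → Fin (length ts) → Set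
  StepOf ts v {ω} s t i j =
    Σ ω λ w → Σ (OutP ts) λ p → Σ (InP ts) λ q →
      (s w ≡ inj₂ p) × (t w ≡ inj₁ q) ×
      (boxOf proj₂ ts p ≡ i) × (boxOf proj₁ ts q ≡ j)

  record WD (ts : List Box) (v : Box) : Set₁ where
    field
      ω    : Set
      wty  : ω → τ
      src  : TBij wty (srcTy ts v)
      tgt  : TBij wty (tgtTy ts v)

    field
      progress : ∀ i → ¬ TransClosure (StepOf ts v (TBij.to src) (TBij.to tgt)) i i

    wiring : Src ts v → Tgt ts v
    wiring x = TBij.to tgt (TBij.from src x)

  open WD public

  _≈W_ : ∀ {ts v} → WD ts v → WD ts v → Set
  Φ ≈W Φ' = Σ (TBij (wty Φ) (wty Φ')) λ θ →
              (∀ w → TBij.to (src Φ') (TBij.to θ w) ≡ TBij.to (src Φ) w) ×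
              (∀ w → TBij.to (tgt Φ') (TBij.to θ w) ≡ TBij.to (tgt Φ) w)

  -- Partial composition  Ψ ;ᵢ Φ , with  ts = pre ++ t ∷ post  (so i is the
  -- position of t) and  Ψ : ss → t .  The composite has inner boxes
  -- pre ++ ss ++ post.  `Fused x y` says that the fused wires (i)–(iv)
  -- connect the composite's source port x to its target port y.

  module Comp (pre ss post : List Box) (t v : Box) where

    U₋ : Set
    U₋ = Port (proj₁ v) ⊎ (OutP pre ⊎ OutP post)

    U₊ : Set
    U₊ = (InP pre ⊎ InP post) ⊎ Port (proj₂ v)

    uΦ : U₋ → Src (pre ++ t ∷ post) v
    uΦ (inj₁ a)          = inj₁ a
    uΦ (inj₂ (inj₁ p))   = inj₂ (pL proj₂ pre (t ∷ post) p)
    uΦ (inj₂ (inj₂ r))   = inj₂ (pR proj₂ pre (t ∷ post) (inj₂ r))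

    uΧ : U₋ → Src (pre ++ ss ++ post) v
    uΧ (inj₁ a)          = inj₁ a
    uΧ (inj₂ (inj₁ p))   = inj₂ (pL proj₂ pre (ss ++ post) p)
    uΧ (inj₂ (inj₂ r))   = inj₂ (pR proj₂ pre (ss ++ post) (pR proj₂ ss post r))

    wΦ : U₊ → Tgt (pre ++ t ∷ post) v
    wΦ (inj₁ (inj₁ p))   = inj₁ (pL proj₁ pre (t ∷ post) p)
    wΦ (inj₁ (inj₂ r))   = inj₁ (pR proj₁ pre (t ∷ post) (inj₂ r))
    wΦ (inj₂ b)          = inj₂ b

    wΧ : U₊ → Tgt (pre ++ ss ++ post) v
    wΧ (inj₁ (inj₁ p))   = inj₁ (pL proj₁ pre (ss ++ post) p)
    wΧ (inj₁ (inj₂ r))   = inj₁ (pR proj₁ pre (ss ++ post) (pR proj₁ ss post r))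
    wΧ (inj₂ b)          = inj₂ b

    tiΦ : Port (proj₁ t) → Tgt (pre ++ t ∷ post) v
    tiΦ p = inj₁ (pR proj₁ pre (t ∷ post) (inj₁ p))

    toΦ : Port (proj₂ t) → Src (pre ++ t ∷ post) v
    toΦ q = inj₂ (pR proj₂ pre (t ∷ post) (inj₁ q))

    sΧ : InP ss → Tgt (pre ++ ss ++ post) v
    sΧ s = inj₁ (pR proj₁ pre (ss ++ post) (pL proj₁ ss post s))

    rΧ : OutP ss → Src (pre ++ ss ++ post) v
    rΧ r = inj₂ (pR proj₂ pre (ss ++ post) (pL proj₂ ss post r))

    data Fused (Φ : WD (pre ++ t ∷ post) v) (Ψ : WD ss t) :
               Src (pre ++ ss ++ post) v → Tgt (pre ++ ss ++ post) v → Set where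
      fi   : ∀ u p s → wiring Φ (uΦ u) ≡ tiΦ p → wiring Ψ (inj₁ p) ≡ inj₁ s →
             Fused Φ Ψ (uΧ u) (sΧ s)
      fii  : ∀ u w → wiring Φ (uΦ u) ≡ wΦ w → Fused Φ Ψ (uΧ u) (wΧ w)
      fii' : ∀ u p q w → wiring Φ (uΦ u) ≡ tiΦ p → wiring Ψ (inj₁ p) ≡ inj₂ q →
             wiring Φ (toΦ q) ≡ wΦ w → Fused Φ Ψ (uΧ u) (wΧ w)
      fiii : ∀ r s → wiring Ψ (inj₂ r) ≡ inj₁ s → Fused Φ Ψ (rΧ r) (sΧ s)
      fiv  : ∀ r q w → wiring Ψ (inj₂ r) ≡ inj₂ q → wiring Φ (toΦ q) ≡ wΦ w →
             Fused Φ Ψ (rΧ r) (wΧ w)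

    IsComposite : WD (pre ++ t ∷ post) v → WD ss t → WD (pre ++ ss ++ post) v → Set
    IsComposite Φ Ψ Χ = ∀ x → Fused Φ Ψ x (wiring Χ x)

  -- Symmetric-group action (generated by adjacent transpositions):
  -- Φ' is Φ with the inner boxes a , b (adjacent, after pre) exchanged.
  IsSwapped : ∀ pre a b post {v} → WD (pre ++ a ∷ b ∷ post) v → WD (pre ++ b ∷ a ∷ post) v → Set
  IsSwapped pre a b post Φ Φ' =
    ∀ x → wiring Φ' (Sum.map (λ y → y) (swapP proj₂ pre a b post) x)
          ≡ Sum.map (swapP proj₁ pre a b post) (λ y → y) (wiring Φ x)

  private
    noStep : ∀ ts v {ω : Set} (s : ω → Src ts v) (t : ω → Tgt ts v) →
             (∀ w p q → s w ≡ inj₂ p → t w ≡ inj₁ q → ⊥) →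
             ∀ i → ¬ TransClosure (StepOf ts v s t) i i
    noStep ts v s t h i ⟦ (w , p , q , e1 , e2 , _) ⟧     = h w p q e1 e2
    noStep ts v s t h i ((w , p , q , e1 , e2 , _) ◂ _)   = h w p q e1 e2

  idW : (t : Box) → WD (t ∷ []) t
  idW (tm , tp) = record
    { ω   = Port tm ⊎ Port tp
    ; wty = [ ty tm , ty tp ]
    ; src = record
        { to      = Sum.map (λ a → a) inj₁
        ; from    = λ { (inj₁ a) → inj₁ a ; (inj₂ (inj₁ b)) → inj₂ b }
        ; from-to = λ { (inj₁ a) → refl ; (inj₂ b) → refl }
        ; to-from = λ { (inj₁ a) → refl ; (inj₂ (inj₁ b)) → refl }
        ; typed   = λ { (inj₁ a) → refl ; (inj₂ b) → refl } }
    ; tgt = record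
        { to      = Sum.map inj₁ (λ b → b)
        ; from    = λ { (inj₁ (inj₁ a)) → inj₁ a ; (inj₂ b) → inj₂ b }
        ; from-to = λ { (inj₁ a) → refl ; (inj₂ b) → refl }
        ; to-from = λ { (inj₁ (inj₁ a)) → refl ; (inj₂ b) → refl }
        ; typed   = λ { (inj₁ a) → refl ; (inj₂ b) → refl } }
    ; progress = noStep ((tm , tp) ∷ []) (tm , tp) (Sum.map (λ a → a) inj₁) (Sum.map inj₁ (λ b → b)) h }
    where
      h : ∀ w p q → Sum.map (λ a → a) inj₁ w ≡ inj₂ p → Sum.map inj₁ (λ b → b) w ≡ inj₁ q → ⊥
      h (inj₂ b) p q e1 ()

  unitW : (A : TSet) → WD [] (A , A)
  unitW A = record
    { ω   = Port A
    ; wty = ty A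
    ; src = record { to = inj₁ ; from = λ { (inj₁ a) → a }
                   ; from-to = λ a → refl ; to-from = λ { (inj₁ a) → refl }
                   ; typed = λ a → refl }
    ; tgt = record { to = inj₂ ; from = λ { (inj₂ a) → a }
                   ; from-to = λ a → refl ; to-from = λ { (inj₂ a) → refl }
                   ; typed = λ a → refl }
    ; progress = λ () }

  module _ (A B C : TSet) where
    private
      SB : List Box
      SB = (A , B) ∷ (B , C) ∷ []
      Wseq : Set
      Wseq = Port A ⊎ (Port B ⊎ Port C)
      sTo : Wseq → Src SB (A , C)
      sTo (inj₁ a)        = inj₁ a
      sTo (inj₂ (inj₁ b)) = inj₂ (inj₁ b)
      sTo (inj₂ (inj₂ c)) = inj₂ (inj₂ (inj₁ c))
      tTo : Wseq → Tgt SB (A , C)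
      tTo (inj₁ a)        = inj₁ (inj₁ a)
      tTo (inj₂ (inj₁ b)) = inj₁ (inj₂ (inj₁ b))
      tTo (inj₂ (inj₂ c)) = inj₂ c
      stepInfo : ∀ {i j} → StepOf SB (A , C) sTo tTo i j → (i ≡ zero) × (j ≡ suc zero)
      stepInfo (inj₂ (inj₁ b) , inj₁ .b , inj₂ (inj₁ .b) , refl , refl , refl , refl) = refl , refl
      startsAt0 : ∀ {i j} → TransClosure (StepOf SB (A , C) sTo tTo) i j → i ≡ zero
      startsAt0 ⟦ s ⟧   = proj₁ (stepInfo s)
      startsAt0 (s ◂ _) = proj₁ (stepInfo s)
      acyc : ∀ i → ¬ TransClosure (StepOf SB (A , C) sTo tTo) i i
      acyc i ⟦ s ⟧ with stepInfo s
      ... | refl , ()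
      acyc i (s ◂ c) with stepInfo s | startsAt0 c
      ... | refl , refl | ()

    seqW : WD ((A , B) ∷ (B , C) ∷ []) (A , C)
    seqW = record
      { ω   = Wseq
      ; wty = [ ty A , [ ty B , ty C ] ]
      ; src = record
          { to      = sTo
          ; from    = λ { (inj₁ a) → inj₁ a ; (inj₂ (inj₁ b)) → inj₂ (inj₁ b)
                        ; (inj₂ (inj₂ (inj₁ c))) → inj₂ (inj₂ c) }
          ; from-to = λ { (inj₁ a) → refl ; (inj₂ (inj₁ b)) → refl ; (inj₂ (inj₂ c)) → refl }
          ; to-from = λ { (inj₁ a) → refl ; (inj₂ (inj₁ b)) → refl ; (inj₂ (inj₂ (inj₁ c))) → refl }
          ; typed   = λ { (inj₁ a) → refl ; (inj₂ (inj₁ b)) → refl ; (inj₂ (inj₂ c)) → refl } }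
      ; tgt = record
          { to      = tTo
          ; from    = λ { (inj₁ (inj₁ a)) → inj₁ a ; (inj₁ (inj₂ (inj₁ b))) → inj₂ (inj₁ b)
                        ; (inj₂ c) → inj₂ (inj₂ c) }
          ; from-to = λ { (inj₁ a) → refl ; (inj₂ (inj₁ b)) → refl ; (inj₂ (inj₂ c)) → refl }
          ; to-from = λ { (inj₁ (inj₁ a)) → refl ; (inj₁ (inj₂ (inj₁ b))) → refl ; (inj₂ c) → refl }
          ; typed   = λ { (inj₁ a) → refl ; (inj₂ (inj₁ b)) → refl ; (inj₂ (inj₂ c)) → refl } }
      ; progress = acyc }

  module _ (A B A' B' : TSet) where
    private
      PB : List Box
      PB = (A , B) ∷ (A' , B') ∷ []
      PV : Box
      PV = (A ++ A' , B ++ B')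
      Wpara : Set
      Wpara = (Port A ⊎ Port A') ⊎ (Port B ⊎ Port B')
      sTo : Wpara → Src PB PV
      sTo (inj₁ x)         = inj₁ (join A A' x)
      sTo (inj₂ (inj₁ b))  = inj₂ (inj₁ b)
      sTo (inj₂ (inj₂ b')) = inj₂ (inj₂ (inj₁ b'))
      tTo : Wpara → Tgt PB PV
      tTo (inj₁ (inj₁ a))  = inj₁ (inj₁ a)
      tTo (inj₁ (inj₂ a')) = inj₁ (inj₂ (inj₁ a'))
      tTo (inj₂ y)         = inj₂ (join B B' y)
      h : ∀ w p q → sTo w ≡ inj₂ p → tTo w ≡ inj₁ q → ⊥
      h (inj₂ (inj₁ b)) p q e1 ()
      h (inj₂ (inj₂ b)) p q e1 ()

    paraW : WD ((A , B) ∷ (A' , B') ∷ []) (A ++ A' , B ++ B')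
    paraW = record
      { ω   = Wpara
      ; wty = [ [ ty A , ty A' ] , [ ty B , ty B' ] ]
      ; src = record
          { to      = sTo
          ; from    = λ { (inj₁ y) → inj₁ (split A A' y) ; (inj₂ (inj₁ b)) → inj₂ (inj₁ b)
                        ; (inj₂ (inj₂ (inj₁ b'))) → inj₂ (inj₂ b') }
          ; from-to = λ { (inj₁ x) → cong inj₁ (split-join A A' x) ; (inj₂ (inj₁ b)) → refl
                        ; (inj₂ (inj₂ b')) → refl }
          ; to-from = λ { (inj₁ y) → cong inj₁ (join-split A A' y) ; (inj₂ (inj₁ b)) → refl
                        ; (inj₂ (inj₂ (inj₁ b'))) → refl }
          ; typed   = λ { (inj₁ x) → join-ty A A' x ; (inj₂ (inj₁ b)) → refl
                        ; (inj₂ (inj₂ b')) → refl } }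
      ; tgt = record
          { to      = tTo
          ; from    = λ { (inj₁ (inj₁ a)) → inj₁ (inj₁ a) ; (inj₁ (inj₂ (inj₁ a'))) → inj₁ (inj₂ a')
                        ; (inj₂ y) → inj₂ (split B B' y) }
          ; from-to = λ { (inj₁ (inj₁ a)) → refl ; (inj₁ (inj₂ a')) → refl
                        ; (inj₂ y) → cong inj₂ (split-join B B' y) }
          ; to-from = λ { (inj₁ (inj₁ a)) → refl ; (inj₁ (inj₂ (inj₁ a'))) → refl
                        ; (inj₂ y) → cong inj₂ (join-split B B' y) }
          ; typed   = λ { (inj₁ (inj₁ a)) → refl ; (inj₁ (inj₂ a')) → refl
                        ; (inj₂ y) → join-ty B B' y } }
      ; progress = noStep PB PV sTo tTo h }

  -- W_τ-algebras: operad functors  H : W_τ → Set  (Set with its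
  -- cartesian structure), i.e. symmetric-operad maps, with their
  -- natural transformations.

  record Algebra : Set₁ where
    field
      obj      : Box → Set
      act      : ∀ {ts v} → WD ts v → All obj ts → obj v
      -- well defined on isomorphism classes of spans
      act-resp : ∀ {ts v} {Φ Φ' : WD ts v} → Φ ≈W Φ' → ∀ xs → act Φ xs ≡ act Φ' xs
      act-id   : ∀ t (x : obj t) → act (idW t) (x ∷ []) ≡ x
      act-comp : ∀ pre ss post {t v} (Φ : WD (pre ++ t ∷ post) v) (Ψ : WD ss t)
                   (Χ : WD (pre ++ ss ++ post) v) →
                   Comp.IsComposite pre ss post t v Φ Ψ Χ →
                   ∀ (xs : All obj pre) (ys : All obj ss) (zs : All obj post) →
                   act Χ (++⁺ xs (++⁺ ys zs)) ≡ act Φ (++⁺ xs (act Ψ ys ∷ zs))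
      act-swap : ∀ pre a b post {v} (Φ : WD (pre ++ a ∷ b ∷ post) v)
                   (Φ' : WD (pre ++ b ∷ a ∷ post) v) → IsSwapped pre a b post Φ Φ' →
                   ∀ (xs : All obj pre) (x : obj a) (y : obj b) (zs : All obj post) →
                   act Φ' (++⁺ xs (y ∷ x ∷ zs)) ≡ act Φ (++⁺ xs (x ∷ y ∷ zs))

  open Algebra public

  record AlgHom (H K : Algebra) : Set₁ where
    field
      comp    : ∀ {t} → obj H t → obj K t
      natural : ∀ {ts v} (Φ : WD ts v) (xs : All (obj H) ts) →
                comp (act H Φ xs) ≡ act K Φ (All.map comp xs)

  open AlgHom public

  _≈A_ : ∀ {H K} → AlgHom H K → AlgHom H K → Set
  _≈A_ {H} α β = ∀ t (x : obj H t) → comp α x ≡ comp β x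

  private
    map-id : ∀ {P : Box → Set} {ts} (xs : All P ts) → All.map (λ x → x) xs ≡ xs
    map-id []       = refl
    map-id (x ∷ xs) = cong (x ∷_) (map-id xs)

    map-∘ : ∀ {P Q R : Box → Set} {ts} (f : ∀ {t} → P t → Q t) (g : ∀ {t} → Q t → R t)
            (xs : All P ts) → All.map (λ x → g (f x)) xs ≡ All.map g (All.map f xs)
    map-∘ f g []       = refl
    map-∘ f g (x ∷ xs) = cong (_ ∷_) (map-∘ f g xs)

  idA : (H : Algebra) → AlgHom H H
  idA H = record { comp = λ x → x ; natural = λ Φ xs → cong (act H Φ) (sym (map-id xs)) }

  _∘A_ : ∀ {H K L} → AlgHom K L → AlgHom H K → AlgHom H L
  _∘A_ {H} {K} {L} β α = record
    { comp    = λ x → comp β (comp α x)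
    ; natural = λ Φ xs → trans (cong (comp β) (natural α Φ xs))
                          (trans (natural β Φ (All.map (comp α) xs))
                                 (cong (act L Φ) (sym (map-∘ (comp α) (comp β) xs)))) }

  record IsStrictSMC (Hom : TSet → TSet → Set)
                     (idC : ∀ A → Hom A A)
                     (_⨾_ : ∀ {A B C} → Hom A B → Hom B C → Hom A C)
                     (_⊗_ : ∀ {A B A' B'} → Hom A B → Hom A' B' → Hom (A ++ A') (B ++ B'))
                     (σ   : ∀ A B → Hom (A ++ B) (B ++ A)) : Set where
    field
      ⨾-idˡ   : ∀ {A B} (f : Hom A B) → idC A ⨾ f ≡ f
      ⨾-idʳ   : ∀ {A B} (f : Hom A B) → f ⨾ idC B ≡ f
      ⨾-assoc : ∀ {A B C D} (f : Hom A B) (g : Hom B C) (h : Hom C D) →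
                (f ⨾ g) ⨾ h ≡ f ⨾ (g ⨾ h)
      ⊗-id    : ∀ A B → idC A ⊗ idC B ≡ idC (A ++ B)
      ⊗-⨾     : ∀ {A B C A' B' C'} (f : Hom A B) (g : Hom B C) (f' : Hom A' B') (g' : Hom B' C') →
                (f ⨾ g) ⊗ (f' ⨾ g') ≡ (f ⊗ f') ⨾ (g ⊗ g')
      ⊗-unitˡ : ∀ {A B} (f : Hom A B) → idC [] ⊗ f ≡ f
      ⊗-unitʳ : ∀ {A B} (f : Hom A B) →
                subst₂ Hom (++-identityʳ A) (++-identityʳ B) (f ⊗ idC []) ≡ f
      ⊗-assoc : ∀ {A B A' B' A'' B''} (f : Hom A B) (g : Hom A' B') (h : Hom A'' B'') →
                subst₂ Hom (++-assoc A A' A'') (++-assoc B B' B'') ((f ⊗ g) ⊗ h) ≡ f ⊗ (g ⊗ h)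
      σ-natural : ∀ {A B A' B'} (f : Hom A B) (g : Hom A' B') →
                  (f ⊗ g) ⨾ σ B B' ≡ σ A A' ⨾ (g ⊗ f)
      σ-inv     : ∀ A B → σ A B ⨾ σ B A ≡ idC (A ++ B)
      σ-hexagon : ∀ A B C →
                  σ A (B ++ C) ≡
                  subst₂ Hom (++-assoc A B C) (sym (++-assoc B C A))
                    ((σ A B ⊗ idC C) ⨾
                     subst (λ X → Hom X (B ++ (C ++ A))) (sym (++-assoc B A C)) (idC B ⊗ σ A C))

  record StrictSMC : Set₁ where
    field
      Hom   : TSet → TSet → Set
      idC   : ∀ A → Hom A A
      _⨾_   : ∀ {A B C} → Hom A B → Hom B C → Hom A C
      _⊗_   : ∀ {A B A' B'} → Hom A B → Hom A' B' → Hom (A ++ A') (B ++ B')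
      σ     : ∀ A B → Hom (A ++ B) (B ++ A)
      isSMC : IsStrictSMC Hom idC _⨾_ _⊗_ σ

  record SMFun (C D : StrictSMC) : Set where
    private
      module C = StrictSMC C
      module D = StrictSMC D
    field
      fun  : ∀ {A B} → C.Hom A B → D.Hom A B
      fun-id : ∀ A → fun (C.idC A) ≡ D.idC A
      fun-⨾  : ∀ {A B C'} (f : C.Hom A B) (g : C.Hom B C') → fun (f C.⨾ g) ≡ fun f D.⨾ fun g
      fun-⊗  : ∀ {A B A' B'} (f : C.Hom A B) (g : C.Hom A' B') → fun (f C.⊗ g) ≡ fun f D.⊗ fun g
      fun-σ  : ∀ A B → fun (C.σ A B) ≡ D.σ A B

  open SMFun public

  _≈S_ : ∀ {C D} → SMFun C D → SMFun C D → Set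
  _≈S_ {C} F G = ∀ {A B} (f : StrictSMC.Hom C A B) → fun F f ≡ fun G f

  module _ (H : Algebra) where
    HomOf : TSet → TSet → Set
    HomOf A B = obj H (A , B)

    idOf : ∀ A → HomOf A A
    idOf A = act H (unitW A) []

    seqOf : ∀ {A B C} → HomOf A B → HomOf B C → HomOf A C
    seqOf {A} {B} {C} f g = act H (seqW A B C) (f ∷ g ∷ [])

    paraOf : ∀ {A B A' B'} → HomOf A B → HomOf A' B' → HomOf (A ++ A') (B ++ B')
    paraOf {A} {B} {A'} {B'} f g = act H (paraW A B A' B') (f ∷ g ∷ [])

  mkSMC : (H : Algebra) (σ : ∀ A B → HomOf H (A ++ B) (B ++ A)) →
          IsStrictSMC (HomOf H) (idOf H) (seqOf H) (paraOf H) σ → StrictSMC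
  mkSMC H σ laws = record
    { Hom = HomOf H ; idC = idOf H ; _⨾_ = seqOf H ; _⊗_ = paraOf H ; σ = σ ; isSMC = laws }

  record FullyFaithfulFunctor (F₀ : Algebra → StrictSMC) : Set₁ where
    field
      F₁      : ∀ {H K} → AlgHom H K → SMFun (F₀ H) (F₀ K)
      F₁-resp : ∀ {H K} {α β : AlgHom H K} → α ≈A β → F₁ α ≈S F₁ β
      F₁-id   : ∀ H {A B} (f : StrictSMC.Hom (F₀ H) A B) → fun (F₁ (idA H)) f ≡ f
      F₁-∘    : ∀ {H K L} (α : AlgHom H K) (β : AlgHom K L) {A B}
                (f : StrictSMC.Hom (F₀ H) A B) →
                fun (F₁ (β ∘A α)) f ≡ fun (F₁ β) (fun (F₁ α) f)
      faithful : ∀ {H K} {α β : AlgHom H K} → F₁ α ≈S F₁ β → α ≈A β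
      full     : ∀ {H K} (G : SMFun (F₀ H) (F₀ K)) → Σ (AlgHom H K) λ α → F₁ α ≈S G

  record Theorem5p2 : Set₁ where
    field
      symmetryOf : (H : Algebra) → ∀ A B → HomOf H (A ++ B) (B ++ A)
      smcLaws    : (H : Algebra) →
                   IsStrictSMC (HomOf H) (idOf H) (seqOf H) (paraOf H) (symmetryOf H)
      functor    : FullyFaithfulFunctor (λ H → mkSMC H (symmetryOf H) (smcLaws H))

{-# OPTIONS --safe #-}
-- The action of a W_τ-algebra H depends only on wirings: diagrams with the same wiring
-- bijection act alike, and every partial composite can be realised as an explicit diagram
-- obtained by fusing wires, to which act-comp applies.  Each law of a strict symmetric
-- monoidal category is then an equation between two composites of unit, seq, para and σ
-- whose wirings agree.
--
-- The functor is the identity on components, hence faithful.  For fullness, the components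
-- of an identity-on-objects symmetric monoidal functor must commute with the action of every
-- diagram.  This property is closed under composition and under exchanging boxes.  A
-- nullary diagram is a permutation, built from σ, para and identities by induction on the
-- number of ports.  A diagram with boxes has, by acyclicity, a box fed by no other box;
-- moved to the end and peeled off, it exhibits the diagram as a diagram with one box less
-- plugged into (P ⨾ (t ⊗ id)) ⨾ □ with P a permutation, and induction on the number of
-- boxes concludes.
module Submission where

open import Axiom.UniquenessOfIdentityProofs using (module Decidable⇒UIP)
open import Data.Bool using (Bool; true; false)
import Data.Bool.Properties as Bool
open import Data.Empty using (⊥; ⊥-elim)
open import Data.Fin using (Fin; zero; suc; toℕ)
open import Data.Fin.Properties using (_≟_; pigeonhole; suc-injective)
open import Data.List using (List; []; _∷_; _++_; length)
open import Data.List.Properties using (++-assoc; ++-identityʳ)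
open import Data.List.Relation.Unary.All using (All; []; _∷_)
import Data.List.Relation.Unary.All as All
open import Data.List.Relation.Unary.All.Properties using (++⁺)
open import Data.Nat using (ℕ; zero; suc; _+_)
import Data.Nat.Properties as ℕP
open import Data.Product using (Σ; _×_; _,_; proj₁; proj₂)
open import Data.Sum using (_⊎_; inj₁; inj₂; [_,_])
import Data.Sum as Sum
open import Data.Sum.Properties using (inj₁-injective; inj₂-injective; swap-involutive)
open import Relation.Binary.Construct.Closure.Transitive using (TransClosure) renaming ([_] to ⟦_⟧; _∷_ to _◂_; _++_ to _+++_)
open import Relation.Binary.PropositionalEquality hiding ([_])
open import Relation.Binary.PropositionalEquality.Properties using (subst-subst-sym; subst-sym-subst)
open import Relation.Nullary using (¬_; yes; no; does)
open import Relation.Nullary.Decidable using (dec-true)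

open import Defs

module _ {A : Set} where

  Index : List A → Set
  Index xs = Fin (length xs)

  length-++-∷ : ∀ (xs : List A) x ys → length (xs ++ x ∷ ys) ≡ suc (length (xs ++ ys))
  length-++-∷ []       x ys = refl
  length-++-∷ (z ∷ xs) x ys = cong suc (length-++-∷ xs x ys)

  subst-suc : ∀ {xs ys : List A} x (e : xs ≡ ys) (i : Index xs) →
              subst Index (cong (x ∷_) e) (suc i) ≡ suc (subst Index e i)
  subst-suc x refl i = refl

  subst-sym-zero : ∀ {xs ys : List A} x (e : xs ≡ ys) → subst Index (sym (cong (x ∷_) e)) zero ≡ zero
  subst-sym-zero x refl = refl

  subst-sym-suc : ∀ {xs ys : List A} x (e : xs ≡ ys) (i : Index ys) →
                  subst Index (sym (cong (x ∷_) e)) (suc i) ≡ suc (subst Index (sym e) i)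
  subst-sym-suc x refl i = refl

true≢false : true ≡ false → ⊥
true≢false ()

isInj₁ : ∀ {A B : Set} → A ⊎ B → Bool
isInj₁ (inj₁ _) = true
isInj₁ (inj₂ _) = false

searchFin : ∀ n (P : Fin n → Bool) → (∀ i → P i ≡ false) ⊎ Σ (Fin n) (λ i → P i ≡ true)
searchFin zero P = inj₁ (λ ())
searchFin (suc n) P with P zero in e
... | true = inj₂ (zero , e)
... | false with searchFin n (λ i → P (suc i))
...   | inj₂ (i , e') = inj₂ (suc i , e')
...   | inj₁ h = inj₁ (λ { zero → e ; (suc i) → h i })

does-≟⇒≡ : ∀ {n} {i j : Fin n} → does (i ≟ j) ≡ true → i ≡ j
does-≟⇒≡ {i = i} {j} e with i ≟ j
... | yes p = p
does-≟⇒≡ () | no _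

does-≟-injective : ∀ {m n} (f : Fin m → Fin n) → (∀ x y → f x ≡ f y → x ≡ y) → ∀ x y → does (f x ≟ f y) ≡ does (x ≟ y)
does-≟-injective f inj x y with f x ≟ f y | x ≟ y
... | yes p | yes q = refl
... | yes p | no q = ⊥-elim (q (inj x y p))
... | no p | yes refl = ⊥-elim (p refl)
... | no p | no q = refl

module _ (τ : Set) where

  open WiringDiagrams τ

  fromWiring : ∀ {ts v} (f : Src ts v → Tgt ts v) (g : Tgt ts v → Src ts v)
       → (∀ x → g (f x) ≡ x) → (∀ y → f (g y) ≡ y)
       → (∀ x → tgtTy ts v (f x) ≡ srcTy ts v x)
       → (∀ i → ¬ TransClosure (StepOf ts v (λ x → x) f) i i) → WD ts v
  fromWiring {ts} {v} f g gf fg ty pr = record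
    { ω = Src ts v ; wty = srcTy ts v
    ; src = record { to = λ x → x ; from = λ x → x ; from-to = λ _ → refl
                   ; to-from = λ _ → refl ; typed = λ _ → refl }
    ; tgt = record { to = f ; from = g ; from-to = gf ; to-from = fg ; typed = ty }
    ; progress = pr }

  wiring⁻¹ : ∀ {ts v} → WD ts v → Tgt ts v → Src ts v
  wiring⁻¹ Φ y = TBij.to (src Φ) (TBij.from (tgt Φ) y)

  wiring⁻¹-wiring : ∀ {ts v} (Φ : WD ts v) x → wiring⁻¹ Φ (wiring Φ x) ≡ x
  wiring⁻¹-wiring Φ x = trans (cong (TBij.to (src Φ)) (TBij.from-to (tgt Φ) _)) (TBij.to-from (src Φ) x)

  wiring-wiring⁻¹ : ∀ {ts v} (Φ : WD ts v) y → wiring Φ (wiring⁻¹ Φ y) ≡ y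
  wiring-wiring⁻¹ Φ y = trans (cong (TBij.to (tgt Φ)) (TBij.from-to (src Φ) _)) (TBij.to-from (tgt Φ) y)

  wiring-typed : ∀ {ts v} (Φ : WD ts v) x → tgtTy ts v (wiring Φ x) ≡ srcTy ts v x
  wiring-typed {ts} {v} Φ x = trans (TBij.typed (tgt Φ) _)
                   (trans (sym (TBij.typed (src Φ) _)) (cong (srcTy ts v) (TBij.to-from (src Φ) x)))

  ≗wiring⇒≈W : ∀ {ts v} (Φ Φ' : WD ts v) → (∀ x → wiring Φ x ≡ wiring Φ' x) → Φ ≈W Φ'
  ≗wiring⇒≈W {ts} {v} Φ Φ' e = θ , (λ w → TBij.to-from (src Φ') _) , eq2
    where
      θ : TBij (wty Φ) (wty Φ')
      θ = record
        { to = λ w → TBij.from (src Φ') (TBij.to (src Φ) w)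
        ; from = λ w → TBij.from (src Φ) (TBij.to (src Φ') w)
        ; from-to = λ w → trans (cong (TBij.from (src Φ)) (TBij.to-from (src Φ') _)) (TBij.from-to (src Φ) w)
        ; to-from = λ w → trans (cong (TBij.from (src Φ')) (TBij.to-from (src Φ) _)) (TBij.from-to (src Φ') w)
        ; typed = λ w → trans (sym (TBij.typed (src Φ') _))
                        (trans (cong (srcTy ts v) (TBij.to-from (src Φ') _)) (TBij.typed (src Φ) w)) }
      eq2 : ∀ w → TBij.to (tgt Φ') (TBij.to θ w) ≡ TBij.to (tgt Φ) w
      eq2 w = trans (sym (e (TBij.to (src Φ) w))) (cong (TBij.to (tgt Φ)) (TBij.from-to (src Φ) w))

  act-≗wiring : (H : Algebra) → ∀ {ts v} (Φ Φ' : WD ts v) → (∀ x → wiring Φ x ≡ wiring Φ' x) →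
         ∀ xs → act H Φ xs ≡ act H Φ' xs
  act-≗wiring H Φ Φ' e = act-resp H (≗wiring⇒≈W Φ Φ' e)

  Step : ∀ {ts v} → WD ts v → Fin (length ts) → Fin (length ts) → Set
  Step {ts} {v} Φ = StepOf ts v (TBij.to (src Φ)) (TBij.to (tgt Φ))

  wireStep : ∀ {ts v} (Φ : WD ts v) x p q → x ≡ inj₂ p → wiring Φ x ≡ inj₁ q → ∀ {i j} →
             boxOf proj₂ ts p ≡ i → boxOf proj₁ ts q ≡ j → Step Φ i j
  wireStep Φ x p q e1 e2 b1 b2 = TBij.from (src Φ) x , p , q , trans (TBij.to-from (src Φ) x) e1 , e2 , b1 , b2

  splitPorts : ∀ f xs ys → Ports f (xs ++ ys) → Ports f xs ⊎ Ports f ys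
  splitPorts f []       ys z        = inj₂ z
  splitPorts f (x ∷ xs) ys (inj₁ p) = inj₁ (inj₁ p)
  splitPorts f (x ∷ xs) ys (inj₂ z) = Sum.map inj₂ (λ q → q) (splitPorts f xs ys z)

  joinPorts : ∀ f xs ys → Ports f xs ⊎ Ports f ys → Ports f (xs ++ ys)
  joinPorts f xs ys = [ pL f xs ys , pR f xs ys ]

  splitPorts-pL : ∀ f xs ys p → splitPorts f xs ys (pL f xs ys p) ≡ inj₁ p
  splitPorts-pL f (x ∷ xs) ys (inj₁ p) = refl
  splitPorts-pL f (x ∷ xs) ys (inj₂ p) rewrite splitPorts-pL f xs ys p = refl

  splitPorts-pR : ∀ f xs ys q → splitPorts f xs ys (pR f xs ys q) ≡ inj₂ q
  splitPorts-pR f []       ys q = refl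
  splitPorts-pR f (x ∷ xs) ys q rewrite splitPorts-pR f xs ys q = refl

  joinPorts-splitPorts : ∀ f xs ys z → joinPorts f xs ys (splitPorts f xs ys z) ≡ z
  joinPorts-splitPorts f []       ys z        = refl
  joinPorts-splitPorts f (x ∷ xs) ys (inj₁ p) = refl
  joinPorts-splitPorts f (x ∷ xs) ys (inj₂ z) with splitPorts f xs ys z | joinPorts-splitPorts f xs ys z
  ... | inj₁ a | e = cong inj₂ e
  ... | inj₂ b | e = cong inj₂ e

  portsTy-pL : ∀ f xs ys p → portsTy f (xs ++ ys) (pL f xs ys p) ≡ portsTy f xs p
  portsTy-pL f (x ∷ xs) ys (inj₁ p) = refl
  portsTy-pL f (x ∷ xs) ys (inj₂ p) = portsTy-pL f xs ys p

  portsTy-pR : ∀ f xs ys q → portsTy f (xs ++ ys) (pR f xs ys q) ≡ portsTy f ys q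
  portsTy-pR f []       ys q = refl
  portsTy-pR f (x ∷ xs) ys q = portsTy-pR f xs ys q

  boxL : ∀ (xs ys : List Box) → Fin (length xs) → Fin (length (xs ++ ys))
  boxL (x ∷ xs) ys zero    = zero
  boxL (x ∷ xs) ys (suc i) = suc (boxL xs ys i)

  boxR : ∀ (xs ys : List Box) → Fin (length ys) → Fin (length (xs ++ ys))
  boxR []       ys j = j
  boxR (x ∷ xs) ys j = suc (boxR xs ys j)

  splitBoxes : ∀ (xs ys : List Box) → Fin (length (xs ++ ys)) → Fin (length xs) ⊎ Fin (length ys)
  splitBoxes []       ys j       = inj₂ j
  splitBoxes (x ∷ xs) ys zero    = inj₁ zero
  splitBoxes (x ∷ xs) ys (suc j) = Sum.map suc (λ q → q) (splitBoxes xs ys j)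

  splitBoxes-boxL : ∀ xs ys i → splitBoxes xs ys (boxL xs ys i) ≡ inj₁ i
  splitBoxes-boxL (x ∷ xs) ys zero = refl
  splitBoxes-boxL (x ∷ xs) ys (suc i) rewrite splitBoxes-boxL xs ys i = refl

  splitBoxes-boxR : ∀ xs ys j → splitBoxes xs ys (boxR xs ys j) ≡ inj₂ j
  splitBoxes-boxR []       ys j = refl
  splitBoxes-boxR (x ∷ xs) ys j rewrite splitBoxes-boxR xs ys j = refl

  boxOf-pL : ∀ f xs ys p → boxOf f (xs ++ ys) (pL f xs ys p) ≡ boxL xs ys (boxOf f xs p)
  boxOf-pL f (x ∷ xs) ys (inj₁ p) = refl
  boxOf-pL f (x ∷ xs) ys (inj₂ p) = cong suc (boxOf-pL f xs ys p)

  boxOf-pR : ∀ f xs ys q → boxOf f (xs ++ ys) (pR f xs ys q) ≡ boxR xs ys (boxOf f ys q)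
  boxOf-pR f []       ys q = refl
  boxOf-pR f (x ∷ xs) ys q = cong suc (boxOf-pR f xs ys q)

  boxL-injective : ∀ xs ys {i j} → boxL xs ys i ≡ boxL xs ys j → i ≡ j
  boxL-injective xs ys {i} {j} e = inj₁-injective (trans (sym (splitBoxes-boxL xs ys i)) (trans (cong (splitBoxes xs ys) e) (splitBoxes-boxL xs ys j)))

  boxR-injective : ∀ xs ys {i j} → boxR xs ys i ≡ boxR xs ys j → i ≡ j
  boxR-injective xs ys {i} {j} e = inj₂-injective (trans (sym (splitBoxes-boxR xs ys i)) (trans (cong (splitBoxes xs ys) e) (splitBoxes-boxR xs ys j)))

  -- The composite is defined by its wiring: a wire is followed through Φ and, whenever it
  -- enters the slot t, through Ψ.  It never passes through t twice, because a Φ-wire from an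
  -- output of t to an input of t would be a cycle of Φ.
  module Composite (pre ss post : List Box) (t v : Box) (Φ : WD (pre ++ t ∷ post) v) (Ψ : WD ss t) where
    open Comp pre ss post t v

    SΦ TΦ SΧ TΧ : Set
    SΦ = Src (pre ++ t ∷ post) v
    TΦ = Tgt (pre ++ t ∷ post) v
    SΧ = Src (pre ++ ss ++ post) v
    TΧ = Tgt (pre ++ ss ++ post) v

    vSΦh : Ports proj₂ pre ⊎ Ports proj₂ (t ∷ post) → U₋ ⊎ Port (proj₂ t)
    vSΦh (inj₁ p)          = inj₁ (inj₂ (inj₁ p))
    vSΦh (inj₂ (inj₁ q))   = inj₂ q
    vSΦh (inj₂ (inj₂ r))   = inj₁ (inj₂ (inj₂ r))

    vSΦ : SΦ → U₋ ⊎ Port (proj₂ t)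
    vSΦ (inj₁ a) = inj₁ (inj₁ a)
    vSΦ (inj₂ z) = vSΦh (splitPorts proj₂ pre (t ∷ post) z)

    uΦtoΦ : U₋ ⊎ Port (proj₂ t) → SΦ
    uΦtoΦ = [ uΦ , toΦ ]

    vSΦ-uΦ : ∀ u → vSΦ (uΦ u) ≡ inj₁ u
    vSΦ-uΦ (inj₁ a) = refl
    vSΦ-uΦ (inj₂ (inj₁ p)) rewrite splitPorts-pL proj₂ pre (t ∷ post) p = refl
    vSΦ-uΦ (inj₂ (inj₂ r)) rewrite splitPorts-pR proj₂ pre (t ∷ post) (inj₂ r) = refl

    vSΦ-toΦ : ∀ q → vSΦ (toΦ q) ≡ inj₂ q
    vSΦ-toΦ q rewrite splitPorts-pR proj₂ pre (t ∷ post) (inj₁ q) = refl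

    vSΦ-inv : ∀ x → uΦtoΦ (vSΦ x) ≡ x
    vSΦ-inv (inj₁ a) = refl
    vSΦ-inv (inj₂ z) with splitPorts proj₂ pre (t ∷ post) z | joinPorts-splitPorts proj₂ pre (t ∷ post) z
    ... | inj₁ p | e = cong inj₂ e
    ... | inj₂ (inj₁ q) | e = cong inj₂ e
    ... | inj₂ (inj₂ r) | e = cong inj₂ e

    vTΦh : Ports proj₁ pre ⊎ Ports proj₁ (t ∷ post) → Port (proj₁ t) ⊎ U₊
    vTΦh (inj₁ p)          = inj₂ (inj₁ (inj₁ p))
    vTΦh (inj₂ (inj₁ q))   = inj₁ q
    vTΦh (inj₂ (inj₂ r))   = inj₂ (inj₁ (inj₂ r))

    vTΦ : TΦ → Port (proj₁ t) ⊎ U₊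
    vTΦ (inj₁ z) = vTΦh (splitPorts proj₁ pre (t ∷ post) z)
    vTΦ (inj₂ b) = inj₂ (inj₂ b)

    tiwΦ : Port (proj₁ t) ⊎ U₊ → TΦ
    tiwΦ = [ tiΦ , wΦ ]

    vTΦ-tiΦ : ∀ p → vTΦ (tiΦ p) ≡ inj₁ p
    vTΦ-tiΦ p rewrite splitPorts-pR proj₁ pre (t ∷ post) (inj₁ p) = refl

    vTΦ-wΦ : ∀ w → vTΦ (wΦ w) ≡ inj₂ w
    vTΦ-wΦ (inj₁ (inj₁ p)) rewrite splitPorts-pL proj₁ pre (t ∷ post) p = refl
    vTΦ-wΦ (inj₁ (inj₂ r)) rewrite splitPorts-pR proj₁ pre (t ∷ post) (inj₂ r) = refl
    vTΦ-wΦ (inj₂ b) = refl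

    vTΦ-inv : ∀ y → tiwΦ (vTΦ y) ≡ y
    vTΦ-inv (inj₂ b) = refl
    vTΦ-inv (inj₁ z) with splitPorts proj₁ pre (t ∷ post) z | joinPorts-splitPorts proj₁ pre (t ∷ post) z
    ... | inj₁ p | e = cong inj₁ e
    ... | inj₂ (inj₁ q) | e = cong inj₁ e
    ... | inj₂ (inj₂ r) | e = cong inj₁ e

    vSΧh2 : Ports proj₂ ss ⊎ Ports proj₂ post → U₋ ⊎ OutP ss
    vSΧh2 (inj₁ r) = inj₂ r
    vSΧh2 (inj₂ c) = inj₁ (inj₂ (inj₂ c))

    vSΧh : Ports proj₂ pre ⊎ Ports proj₂ (ss ++ post) → U₋ ⊎ OutP ss
    vSΧh (inj₁ p) = inj₁ (inj₂ (inj₁ p))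
    vSΧh (inj₂ z) = vSΧh2 (splitPorts proj₂ ss post z)

    vSΧ : SΧ → U₋ ⊎ OutP ss
    vSΧ (inj₁ a) = inj₁ (inj₁ a)
    vSΧ (inj₂ z) = vSΧh (splitPorts proj₂ pre (ss ++ post) z)

    urΧ : U₋ ⊎ OutP ss → SΧ
    urΧ = [ uΧ , rΧ ]

    vSΧ-uΧ : ∀ u → vSΧ (uΧ u) ≡ inj₁ u
    vSΧ-uΧ (inj₁ a) = refl
    vSΧ-uΧ (inj₂ (inj₁ p)) rewrite splitPorts-pL proj₂ pre (ss ++ post) p = refl
    vSΧ-uΧ (inj₂ (inj₂ r)) rewrite splitPorts-pR proj₂ pre (ss ++ post) (pR proj₂ ss post r)
                                 | splitPorts-pR proj₂ ss post r = refl

    vSΧ-rΧ : ∀ r → vSΧ (rΧ r) ≡ inj₂ r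
    vSΧ-rΧ r rewrite splitPorts-pR proj₂ pre (ss ++ post) (pL proj₂ ss post r)
                   | splitPorts-pL proj₂ ss post r = refl

    vSΧ-inv : ∀ x → urΧ (vSΧ x) ≡ x
    vSΧ-inv (inj₁ a) = refl
    vSΧ-inv (inj₂ z) with splitPorts proj₂ pre (ss ++ post) z | joinPorts-splitPorts proj₂ pre (ss ++ post) z
    ... | inj₁ p | e = cong inj₂ e
    ... | inj₂ z' | e with splitPorts proj₂ ss post z' | joinPorts-splitPorts proj₂ ss post z'
    ...   | inj₁ r | e' = cong inj₂ (trans (cong (pR proj₂ pre (ss ++ post)) e') e)
    ...   | inj₂ c | e' = cong inj₂ (trans (cong (pR proj₂ pre (ss ++ post)) e') e)

    vTΧh2 : Ports proj₁ ss ⊎ Ports proj₁ post → InP ss ⊎ U₊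
    vTΧh2 (inj₁ s) = inj₁ s
    vTΧh2 (inj₂ c) = inj₂ (inj₁ (inj₂ c))

    vTΧh : Ports proj₁ pre ⊎ Ports proj₁ (ss ++ post) → InP ss ⊎ U₊
    vTΧh (inj₁ p) = inj₂ (inj₁ (inj₁ p))
    vTΧh (inj₂ z) = vTΧh2 (splitPorts proj₁ ss post z)

    vTΧ : TΧ → InP ss ⊎ U₊
    vTΧ (inj₁ z) = vTΧh (splitPorts proj₁ pre (ss ++ post) z)
    vTΧ (inj₂ b) = inj₂ (inj₂ b)

    swΧ : InP ss ⊎ U₊ → TΧ
    swΧ = [ sΧ , wΧ ]

    vTΧ-sΧ : ∀ s → vTΧ (sΧ s) ≡ inj₁ s
    vTΧ-sΧ s rewrite splitPorts-pR proj₁ pre (ss ++ post) (pL proj₁ ss post s)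
                   | splitPorts-pL proj₁ ss post s = refl

    vTΧ-wΧ : ∀ w → vTΧ (wΧ w) ≡ inj₂ w
    vTΧ-wΧ (inj₁ (inj₁ p)) rewrite splitPorts-pL proj₁ pre (ss ++ post) p = refl
    vTΧ-wΧ (inj₁ (inj₂ r)) rewrite splitPorts-pR proj₁ pre (ss ++ post) (pR proj₁ ss post r)
                                 | splitPorts-pR proj₁ ss post r = refl
    vTΧ-wΧ (inj₂ b) = refl

    vTΧ-inv : ∀ y → swΧ (vTΧ y) ≡ y
    vTΧ-inv (inj₂ b) = refl
    vTΧ-inv (inj₁ z) with splitPorts proj₁ pre (ss ++ post) z | joinPorts-splitPorts proj₁ pre (ss ++ post) z
    ... | inj₁ p | e = cong inj₁ e
    ... | inj₂ z' | e with splitPorts proj₁ ss post z' | joinPorts-splitPorts proj₁ ss post z'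
    ...   | inj₁ r | e' = cong inj₁ (trans (cong (pR proj₁ pre (ss ++ post)) e') e)
    ...   | inj₂ c | e' = cong inj₁ (trans (cong (pR proj₁ pre (ss ++ post)) e') e)

    slot : Fin (length (pre ++ t ∷ post))
    slot = boxR pre (t ∷ post) zero

    no-wire-from-box-to-itself : ∀ q p → wiring Φ (toΦ q) ≡ tiΦ p → ⊥
    no-wire-from-box-to-itself q p e =
      progress Φ slot ⟦ wireStep Φ (toΦ q) _ _ refl e (boxOf-pR proj₂ pre (t ∷ post) (inj₁ q))
                                                        (boxOf-pR proj₁ pre (t ∷ post) (inj₁ p)) ⟧

    outH : ∀ q (z : Port (proj₁ t) ⊎ U₊) → wiring Φ (toΦ q) ≡ tiwΦ z → Σ U₊ λ w → wiring Φ (toΦ q) ≡ wΦ w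
    outH q (inj₁ p) e = ⊥-elim (no-wire-from-box-to-itself q p e)
    outH q (inj₂ w) e = w , e

    outP : ∀ q → Σ U₊ λ w → wiring Φ (toΦ q) ≡ wΦ w
    outP q = outH q (vTΦ (wiring Φ (toΦ q))) (sym (vTΦ-inv _))

    out : Port (proj₂ t) → U₊
    out q = proj₁ (outP q)

    outSpec : ∀ q → wiring Φ (toΦ q) ≡ wΦ (out q)
    outSpec q = proj₂ (outP q)

    innH : ∀ p (z : U₋ ⊎ Port (proj₂ t)) → wiring⁻¹ Φ (tiΦ p) ≡ uΦtoΦ z → Σ U₋ λ u → wiring⁻¹ Φ (tiΦ p) ≡ uΦ u
    innH p (inj₁ u) e = u , e
    innH p (inj₂ q) e = ⊥-elim (no-wire-from-box-to-itself q p (trans (cong (wiring Φ) (sym e)) (wiring-wiring⁻¹ Φ _)))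

    innP : ∀ p → Σ U₋ λ u → wiring⁻¹ Φ (tiΦ p) ≡ uΦ u
    innP p = innH p (vSΦ (wiring⁻¹ Φ (tiΦ p))) (sym (vSΦ-inv _))

    inn : Port (proj₁ t) → U₋
    inn p = proj₁ (innP p)

    innSpec : ∀ p → wiring⁻¹ Φ (tiΦ p) ≡ uΦ (inn p)
    innSpec p = proj₂ (innP p)

    fΨ' : Tgt ss t → TΧ
    fΨ' (inj₁ s) = sΧ s
    fΨ' (inj₂ q) = wΧ (out q)

    fΨ : Src ss t → TΧ
    fΨ z = fΨ' (wiring Ψ z)

    fΦ' : Port (proj₁ t) ⊎ U₊ → TΧ
    fΦ' (inj₁ p) = fΨ (inj₁ p)
    fΦ' (inj₂ w) = wΧ w

    fΦ : U₋ → TΧ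
    fΦ u = fΦ' (vTΦ (wiring Φ (uΦ u)))

    fol' : U₋ ⊎ OutP ss → TΧ
    fol' (inj₁ u) = fΦ u
    fol' (inj₂ r) = fΨ (inj₂ r)

    follow : SΧ → TΧ
    follow x = fol' (vSΧ x)

    bΨ' : Src ss t → SΧ
    bΨ' (inj₁ p) = uΧ (inn p)
    bΨ' (inj₂ r) = rΧ r

    bΨ : Tgt ss t → SΧ
    bΨ y = bΨ' (wiring⁻¹ Ψ y)

    bΦ' : U₋ ⊎ Port (proj₂ t) → SΧ
    bΦ' (inj₁ u) = uΧ u
    bΦ' (inj₂ q) = bΨ (inj₂ q)

    bΦ : U₊ → SΧ
    bΦ w = bΦ' (vSΦ (wiring⁻¹ Φ (wΦ w)))

    bk' : InP ss ⊎ U₊ → SΧ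
    bk' (inj₁ s) = bΨ (inj₁ s)
    bk' (inj₂ w) = bΦ w

    back : TΧ → SΧ
    back y = bk' (vTΧ y)

    back-sΧ : ∀ s → back (sΧ s) ≡ bΨ (inj₁ s)
    back-sΧ s = cong bk' (vTΧ-sΧ s)

    back-wΧ : ∀ w → back (wΧ w) ≡ bΦ w
    back-wΧ w = cong bk' (vTΧ-wΧ w)

    back-fΨ' : ∀ y → back (fΨ' y) ≡ bΨ y
    back-fΨ' (inj₁ s) = back-sΧ s
    back-fΨ' (inj₂ q) = begin
        back (wΧ (out q))                       ≡⟨ back-wΧ (out q) ⟩
        bΦ' (vSΦ (wiring⁻¹ Φ (wΦ (out q))))         ≡⟨ cong (λ z → bΦ' (vSΦ (wiring⁻¹ Φ z))) (sym (outSpec q)) ⟩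
        bΦ' (vSΦ (wiring⁻¹ Φ (wiring Φ (toΦ q))))   ≡⟨ cong (λ z → bΦ' (vSΦ z)) (wiring⁻¹-wiring Φ (toΦ q)) ⟩
        bΦ' (vSΦ (toΦ q))                       ≡⟨ cong bΦ' (vSΦ-toΦ q) ⟩
        bΨ (inj₂ q) ∎
      where open ≡-Reasoning

    back-fΨ : ∀ z → back (fΨ z) ≡ bΨ' z
    back-fΨ z = trans (back-fΨ' (wiring Ψ z)) (cong bΨ' (wiring⁻¹-wiring Ψ z))

    back-fΦ' : ∀ z → back (fΦ' z) ≡ bΦ' (vSΦ (wiring⁻¹ Φ (tiwΦ z)))
    back-fΦ' (inj₁ p) = trans (back-fΨ (inj₁ p)) (sym (cong bΦ' (trans (cong vSΦ (innSpec p)) (vSΦ-uΦ (inn p)))))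
    back-fΦ' (inj₂ w) = back-wΧ w

    back-fΦ : ∀ u → back (fΦ u) ≡ uΧ u
    back-fΦ u = trans (back-fΦ' (vTΦ (wiring Φ (uΦ u))))
             (cong bΦ' (trans (cong (λ z → vSΦ (wiring⁻¹ Φ z)) (vTΦ-inv _))
                        (trans (cong vSΦ (wiring⁻¹-wiring Φ (uΦ u))) (vSΦ-uΦ u))))

    back-follow : ∀ x → back (follow x) ≡ x
    back-follow x = trans (h (vSΧ x)) (vSΧ-inv x)
      where
        h : ∀ z → back (fol' z) ≡ urΧ z
        h (inj₁ u) = back-fΦ u
        h (inj₂ r) = back-fΨ (inj₂ r)

    follow-uΧ : ∀ u → follow (uΧ u) ≡ fΦ u
    follow-uΧ u = cong fol' (vSΧ-uΧ u)

    follow-rΧ : ∀ r → follow (rΧ r) ≡ fΨ (inj₂ r)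
    follow-rΧ r = cong fol' (vSΧ-rΧ r)

    follow-bΨ' : ∀ z → follow (bΨ' z) ≡ fΨ z
    follow-bΨ' (inj₂ r) = follow-rΧ r
    follow-bΨ' (inj₁ p) = trans (follow-uΧ (inn p))
      (cong fΦ' (trans (cong (λ z → vTΦ (wiring Φ z)) (sym (innSpec p)))
                 (trans (cong vTΦ (wiring-wiring⁻¹ Φ (tiΦ p))) (vTΦ-tiΦ p))))

    follow-bΨ : ∀ y → follow (bΨ y) ≡ fΨ' y
    follow-bΨ y = trans (follow-bΨ' (wiring⁻¹ Ψ y)) (cong fΨ' (wiring-wiring⁻¹ Ψ y))

    follow-bΦ' : ∀ z → follow (bΦ' z) ≡ fΦ' (vTΦ (wiring Φ (uΦtoΦ z)))
    follow-bΦ' (inj₁ u) = follow-uΧ u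
    follow-bΦ' (inj₂ q) = trans (follow-bΨ (inj₂ q)) (sym (cong fΦ' (trans (cong vTΦ (outSpec q)) (vTΦ-wΦ (out q)))))

    follow-bΦ : ∀ w → follow (bΦ w) ≡ wΧ w
    follow-bΦ w = trans (follow-bΦ' (vSΦ (wiring⁻¹ Φ (wΦ w))))
      (cong fΦ' (trans (cong (λ z → vTΦ (wiring Φ z)) (vSΦ-inv _))
                 (trans (cong vTΦ (wiring-wiring⁻¹ Φ (wΦ w))) (vTΦ-wΦ w))))

    follow-back : ∀ y → follow (back y) ≡ y
    follow-back y = trans (h (vTΧ y)) (vTΧ-inv y)
      where
        h : ∀ z → follow (bk' z) ≡ swΧ z
        h (inj₁ s) = follow-bΨ (inj₁ s)
        h (inj₂ w) = follow-bΦ w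

    srcTy-uΧ : ∀ u → srcTy (pre ++ ss ++ post) v (uΧ u) ≡ srcTy (pre ++ t ∷ post) v (uΦ u)
    srcTy-uΧ (inj₁ a) = refl
    srcTy-uΧ (inj₂ (inj₁ p)) = trans (portsTy-pL proj₂ pre (ss ++ post) p) (sym (portsTy-pL proj₂ pre (t ∷ post) p))
    srcTy-uΧ (inj₂ (inj₂ r)) = trans (portsTy-pR proj₂ pre (ss ++ post) _) (trans (portsTy-pR proj₂ ss post r) (sym (portsTy-pR proj₂ pre (t ∷ post) (inj₂ r))))

    srcTy-rΧ : ∀ r → srcTy (pre ++ ss ++ post) v (rΧ r) ≡ portsTy proj₂ ss r
    srcTy-rΧ r = trans (portsTy-pR proj₂ pre (ss ++ post) _) (portsTy-pL proj₂ ss post r)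

    tgtTy-wΧ : ∀ w → tgtTy (pre ++ ss ++ post) v (wΧ w) ≡ tgtTy (pre ++ t ∷ post) v (wΦ w)
    tgtTy-wΧ (inj₂ b) = refl
    tgtTy-wΧ (inj₁ (inj₁ p)) = trans (portsTy-pL proj₁ pre (ss ++ post) p) (sym (portsTy-pL proj₁ pre (t ∷ post) p))
    tgtTy-wΧ (inj₁ (inj₂ r)) = trans (portsTy-pR proj₁ pre (ss ++ post) _) (trans (portsTy-pR proj₁ ss post r) (sym (portsTy-pR proj₁ pre (t ∷ post) (inj₂ r))))

    tgtTy-sΧ : ∀ s → tgtTy (pre ++ ss ++ post) v (sΧ s) ≡ portsTy proj₁ ss s
    tgtTy-sΧ s = trans (portsTy-pR proj₁ pre (ss ++ post) _) (portsTy-pL proj₁ ss post s)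

    tgtTy-tiΦ : ∀ p → tgtTy (pre ++ t ∷ post) v (tiΦ p) ≡ ty (proj₁ t) p
    tgtTy-tiΦ p = portsTy-pR proj₁ pre (t ∷ post) (inj₁ p)

    srcTy-toΦ : ∀ q → srcTy (pre ++ t ∷ post) v (toΦ q) ≡ ty (proj₂ t) q
    srcTy-toΦ q = portsTy-pR proj₂ pre (t ∷ post) (inj₁ q)

    tgtTy-fΨ' : ∀ y → tgtTy (pre ++ ss ++ post) v (fΨ' y) ≡ tgtTy ss t y
    tgtTy-fΨ' (inj₁ s) = tgtTy-sΧ s
    tgtTy-fΨ' (inj₂ q) = trans (tgtTy-wΧ (out q)) (trans (cong (tgtTy (pre ++ t ∷ post) v) (sym (outSpec q)))
                     (trans (wiring-typed Φ (toΦ q)) (srcTy-toΦ q)))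

    tgtTy-fΨ : ∀ z → tgtTy (pre ++ ss ++ post) v (fΨ z) ≡ srcTy ss t z
    tgtTy-fΨ z = trans (tgtTy-fΨ' (wiring Ψ z)) (wiring-typed Ψ z)

    tgtTy-fΦ' : ∀ z → tgtTy (pre ++ ss ++ post) v (fΦ' z) ≡ tgtTy (pre ++ t ∷ post) v (tiwΦ z)
    tgtTy-fΦ' (inj₁ p) = trans (tgtTy-fΨ (inj₁ p)) (sym (tgtTy-tiΦ p))
    tgtTy-fΦ' (inj₂ w) = tgtTy-wΧ w

    tgtTy-fΦ : ∀ u → tgtTy (pre ++ ss ++ post) v (fΦ u) ≡ srcTy (pre ++ ss ++ post) v (uΧ u)
    tgtTy-fΦ u = trans (tgtTy-fΦ' (vTΦ (wiring Φ (uΦ u)))) (trans (cong (tgtTy (pre ++ t ∷ post) v) (vTΦ-inv (wiring Φ (uΦ u))))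
             (trans (wiring-typed Φ (uΦ u)) (sym (srcTy-uΧ u))))

    follow-ty : ∀ x → tgtTy (pre ++ ss ++ post) v (follow x) ≡ srcTy (pre ++ ss ++ post) v x
    follow-ty x = trans (h (vSΧ x)) (cong (srcTy (pre ++ ss ++ post) v) (vSΧ-inv x))
      where
        h : ∀ z → tgtTy (pre ++ ss ++ post) v (fol' z) ≡ srcTy (pre ++ ss ++ post) v (urΧ z)
        h (inj₁ u) = tgtTy-fΦ u
        h (inj₂ r) = trans (tgtTy-fΨ (inj₂ r)) (sym (srcTy-rΧ r))

    collapseBoxh₂ : Fin (length ss) ⊎ Fin (length post) → Fin (length (pre ++ t ∷ post))
    collapseBoxh₂ (inj₁ _) = slot
    collapseBoxh₂ (inj₂ c) = boxR pre (t ∷ post) (suc c)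

    collapseBoxh : Fin (length pre) ⊎ Fin (length (ss ++ post)) → Fin (length (pre ++ t ∷ post))
    collapseBoxh (inj₁ a) = boxL pre (t ∷ post) a
    collapseBoxh (inj₂ b) = collapseBoxh₂ (splitBoxes ss post b)

    collapseBox : Fin (length (pre ++ ss ++ post)) → Fin (length (pre ++ t ∷ post))
    collapseBox i = collapseBoxh (splitBoxes pre (ss ++ post) i)

    innerBox : Fin (length ss) → Fin (length (pre ++ ss ++ post))
    innerBox i = boxR pre (ss ++ post) (boxL ss post i)

    collapseBox-innerBox : ∀ i → collapseBox (innerBox i) ≡ slot
    collapseBox-innerBox i rewrite splitBoxes-boxR pre (ss ++ post) (boxL ss post i) | splitBoxes-boxL ss post i = refl

    innerBox-injective : ∀ {i j} → innerBox i ≡ innerBox j → i ≡ j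
    innerBox-injective e = boxL-injective ss post (boxR-injective pre (ss ++ post) e)

    oΧ : Ports proj₂ pre ⊎ Ports proj₂ post → OutP (pre ++ ss ++ post)
    oΧ (inj₁ p) = pL proj₂ pre (ss ++ post) p
    oΧ (inj₂ c) = pR proj₂ pre (ss ++ post) (pR proj₂ ss post c)

    oΦ : Ports proj₂ pre ⊎ Ports proj₂ post → OutP (pre ++ t ∷ post)
    oΦ (inj₁ p) = pL proj₂ pre (t ∷ post) p
    oΦ (inj₂ c) = pR proj₂ pre (t ∷ post) (inj₂ c)

    iΧ : Ports proj₁ pre ⊎ Ports proj₁ post → InP (pre ++ ss ++ post)
    iΧ (inj₁ p) = pL proj₁ pre (ss ++ post) p
    iΧ (inj₂ c) = pR proj₁ pre (ss ++ post) (pR proj₁ ss post c)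

    iΦ : Ports proj₁ pre ⊎ Ports proj₁ post → InP (pre ++ t ∷ post)
    iΦ (inj₁ p) = pL proj₁ pre (t ∷ post) p
    iΦ (inj₂ c) = pR proj₁ pre (t ∷ post) (inj₂ c)

    uΧ-o : ∀ o → uΧ (inj₂ o) ≡ inj₂ (oΧ o)
    uΧ-o (inj₁ p) = refl
    uΧ-o (inj₂ c) = refl

    uΦ-o : ∀ o → uΦ (inj₂ o) ≡ inj₂ (oΦ o)
    uΦ-o (inj₁ p) = refl
    uΦ-o (inj₂ c) = refl

    wΦ-i : ∀ i → wΦ (inj₁ i) ≡ inj₁ (iΦ i)
    wΦ-i (inj₁ p) = refl
    wΦ-i (inj₂ c) = refl

    collapseBox-outer-out : ∀ o → collapseBox (boxOf proj₂ (pre ++ ss ++ post) (oΧ o)) ≡ boxOf proj₂ (pre ++ t ∷ post) (oΦ o)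
    collapseBox-outer-out (inj₁ p) rewrite boxOf-pL proj₂ pre (ss ++ post) p | boxOf-pL proj₂ pre (t ∷ post) p
                        | splitBoxes-boxL pre (ss ++ post) (boxOf proj₂ pre p) = refl
    collapseBox-outer-out (inj₂ c) rewrite boxOf-pR proj₂ pre (ss ++ post) (pR proj₂ ss post c)
                        | boxOf-pR proj₂ pre (t ∷ post) (inj₂ c)
                        | boxOf-pR proj₂ ss post c
                        | splitBoxes-boxR pre (ss ++ post) (boxR ss post (boxOf proj₂ post c))
                        | splitBoxes-boxR ss post (boxOf proj₂ post c) = refl

    collapseBox-outer-in : ∀ i → collapseBox (boxOf proj₁ (pre ++ ss ++ post) (iΧ i)) ≡ boxOf proj₁ (pre ++ t ∷ post) (iΦ i)
    collapseBox-outer-in (inj₁ p) rewrite boxOf-pL proj₁ pre (ss ++ post) p | boxOf-pL proj₁ pre (t ∷ post) p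
                        | splitBoxes-boxL pre (ss ++ post) (boxOf proj₁ pre p) = refl
    collapseBox-outer-in (inj₂ c) rewrite boxOf-pR proj₁ pre (ss ++ post) (pR proj₁ ss post c)
                        | boxOf-pR proj₁ pre (t ∷ post) (inj₂ c)
                        | boxOf-pR proj₁ ss post c
                        | splitBoxes-boxR pre (ss ++ post) (boxR ss post (boxOf proj₁ post c))
                        | splitBoxes-boxR ss post (boxOf proj₁ post c) = refl

    boxOf-r : ∀ r → boxOf proj₂ (pre ++ ss ++ post) (pR proj₂ pre (ss ++ post) (pL proj₂ ss post r)) ≡ innerBox (boxOf proj₂ ss r)
    boxOf-r r rewrite boxOf-pR proj₂ pre (ss ++ post) (pL proj₂ ss post r) | boxOf-pL proj₂ ss post r = refl

    boxOf-s : ∀ s → boxOf proj₁ (pre ++ ss ++ post) (pR proj₁ pre (ss ++ post) (pL proj₁ ss post s)) ≡ innerBox (boxOf proj₁ ss s)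
    boxOf-s s rewrite boxOf-pR proj₁ pre (ss ++ post) (pL proj₁ ss post s) | boxOf-pL proj₁ ss post s = refl

    boxOf-ti : ∀ p → boxOf proj₁ (pre ++ t ∷ post) (pR proj₁ pre (t ∷ post) (inj₁ p)) ≡ slot
    boxOf-ti p = boxOf-pR proj₁ pre (t ∷ post) (inj₁ p)

    boxOf-to : ∀ q → boxOf proj₂ (pre ++ t ∷ post) (pR proj₂ pre (t ∷ post) (inj₁ q)) ≡ slot
    boxOf-to q = boxOf-pR proj₂ pre (t ∷ post) (inj₁ q)

    StepΧ : Fin (length (pre ++ ss ++ post)) → Fin (length (pre ++ ss ++ post)) → Set
    StepΧ = StepOf (pre ++ ss ++ post) v (λ x → x) follow

    -- A path of the composite either stays among the boxes of Ψ or, collapsing those boxes to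
    -- the slot, projects to a path of Φ; so a cycle would give a cycle of Ψ or of Φ.
    data ProjectedPath (i j : Fin (length (pre ++ ss ++ post))) : Set where
      insideΨ : ∀ i' j' → i ≡ innerBox i' → j ≡ innerBox j' → TransClosure (Step Ψ) i' j' → ProjectedPath i j
      alongΦ : TransClosure (Step Φ) (collapseBox i) (collapseBox j) → ProjectedPath i j

    wΧ-inner : ∀ w q → wΧ w ≡ inj₁ q → Σ _ λ i → (w ≡ inj₁ i) × (q ≡ iΧ i)
    wΧ-inner (inj₁ (inj₁ p)) q refl = inj₁ p , refl , refl
    wΧ-inner (inj₁ (inj₂ c)) q refl = inj₂ c , refl , refl
    wΧ-inner (inj₂ b) q ()

    project-via-Ψ : ∀ {i} (p' : Port (proj₁ t)) q → TransClosure (Step Φ) (collapseBox i) slot →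
           fΨ (inj₁ p') ≡ inj₁ q → ProjectedPath i (boxOf proj₁ (pre ++ ss ++ post) q)
    project-via-Ψ {i} p' q st ef with wiring Ψ (inj₁ p')
    ... | inj₁ s rewrite sym (inj₁-injective ef) | boxOf-s s = alongΦ (subst (TransClosure (Step Φ) (collapseBox i)) (sym (collapseBox-innerBox _)) st)
    ... | inj₂ q' with wΧ-inner (out q') q ef
    ...   | i' , e1 , refl = alongΦ (st +++ ⟦ wireStep Φ (toΦ q') _ _ refl (trans (outSpec q') (trans (cong wΦ e1) (wΦ-i i'))) (boxOf-to q') (sym (collapseBox-outer-in i')) ⟧)

    project-from-outer' : ∀ o q (z : Port (proj₁ t) ⊎ U₊) → wiring Φ (inj₂ (oΦ o)) ≡ tiwΦ z → fΦ' z ≡ inj₁ q →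
            ProjectedPath (boxOf proj₂ (pre ++ ss ++ post) (oΧ o)) (boxOf proj₁ (pre ++ ss ++ post) q)
    project-from-outer' o q (inj₁ p') ew ef = project-via-Ψ p' q ⟦ wireStep Φ (inj₂ (oΦ o)) _ _ refl ew (sym (collapseBox-outer-out o)) (boxOf-ti p') ⟧ ef
    project-from-outer' o q (inj₂ w) ew ef with wΧ-inner w q ef
    ... | i , refl , refl = alongΦ ⟦ wireStep Φ (inj₂ (oΦ o)) _ _ refl (trans ew (wΦ-i i)) (sym (collapseBox-outer-out o)) (sym (collapseBox-outer-in i)) ⟧

    project-from-outer : ∀ o q → follow (inj₂ (oΧ o)) ≡ inj₁ q →
           ProjectedPath (boxOf proj₂ (pre ++ ss ++ post) (oΧ o)) (boxOf proj₁ (pre ++ ss ++ post) q)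
    project-from-outer o q ef = project-from-outer' o q (vTΦ (wiring Φ (inj₂ (oΦ o)))) (sym (vTΦ-inv _))
      (trans (cong fΦ' (cong vTΦ (cong (wiring Φ) (sym (uΦ-o o)))))
        (trans (sym (follow-uΧ (inj₂ o))) (trans (cong follow (uΧ-o o)) ef)))

    project-from-inner : ∀ r q → follow (rΧ r) ≡ inj₁ q →
           ProjectedPath (innerBox (boxOf proj₂ ss r)) (boxOf proj₁ (pre ++ ss ++ post) q)
    project-from-inner r q ef with wiring Ψ (inj₂ r) in ew | trans (sym (follow-rΧ r)) ef
    ... | inj₁ s | ef' rewrite sym (inj₁-injective ef') | boxOf-s s =
          insideΨ _ _ refl refl ⟦ wireStep Ψ (inj₂ r) r s refl ew refl refl ⟧
    ... | inj₂ q' | ef' with wΧ-inner (out q') q ef'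
    ...   | i' , e1 , refl = alongΦ (subst (λ k → TransClosure (Step Φ) k _) (sym (collapseBox-innerBox _))
             ⟦ wireStep Φ (toΦ q') _ _ refl (trans (outSpec q') (trans (cong wΦ e1) (wΦ-i i'))) (boxOf-to q') (sym (collapseBox-outer-in i')) ⟧)

    project-step-from : ∀ p q → follow (inj₂ p) ≡ inj₁ q →
                ProjectedPath (boxOf proj₂ (pre ++ ss ++ post) p) (boxOf proj₁ (pre ++ ss ++ post) q)
    project-step-from p q = subst (λ p → follow (inj₂ p) ≡ inj₁ q → ProjectedPath (boxOf proj₂ (pre ++ ss ++ post) p) (boxOf proj₁ (pre ++ ss ++ post) q))
                      (joinPorts-splitPorts proj₂ pre (ss ++ post) p) (h (splitPorts proj₂ pre (ss ++ post) p))
      where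
        P : OutP (pre ++ ss ++ post) → Set
        P p = follow (inj₂ p) ≡ inj₁ q → ProjectedPath (boxOf proj₂ (pre ++ ss ++ post) p) (boxOf proj₁ (pre ++ ss ++ post) q)
        h2 : ∀ z → P (pR proj₂ pre (ss ++ post) (joinPorts proj₂ ss post z))
        h2 (inj₁ r) ef = subst (λ k → ProjectedPath k _) (sym (boxOf-r r)) (project-from-inner r q ef)
        h2 (inj₂ c) = project-from-outer (inj₂ c) q
        h : ∀ z → P (joinPorts proj₂ pre (ss ++ post) z)
        h (inj₁ a) = project-from-outer (inj₁ a) q
        h (inj₂ z) = subst (λ z → P (pR proj₂ pre (ss ++ post) z)) (joinPorts-splitPorts proj₂ ss post z) (h2 (splitPorts proj₂ ss post z))

    project-step : ∀ {i j} → StepΧ i j → ProjectedPath i j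
    project-step (x , p , q , refl , ef , refl , refl) = project-step-from p q ef

    project-++ : ∀ {i j k} → ProjectedPath i j → ProjectedPath j k → ProjectedPath i k
    project-++ (insideΨ i' j' ei ej p) (insideΨ j'' k' ej' ek p') =
      insideΨ i' k' ei ek (p +++ subst (λ z → TransClosure (Step Ψ) z k') (innerBox-injective (trans (sym ej') ej)) p')
    project-++ {i} {j} {k} (insideΨ i' j' ei ej p) (alongΦ q) =
      alongΦ (subst (λ z → TransClosure (Step Φ) z (collapseBox k))
                    (trans (collapseBox-innerBox j') (trans (sym (collapseBox-innerBox i')) (cong collapseBox (sym ei))))
                    (subst (λ z → TransClosure (Step Φ) (collapseBox z) (collapseBox k)) ej q))
    project-++ {i} {j} {k} (alongΦ q) (insideΨ j' k' ej ek p) =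
      alongΦ (subst (λ z → TransClosure (Step Φ) (collapseBox i) z)
                    (trans (cong collapseBox ej) (trans (collapseBox-innerBox j')
                      (trans (sym (collapseBox-innerBox k')) (cong collapseBox (sym ek))))) q)
    project-++ (alongΦ q) (alongΦ q') = alongΦ (q +++ q')

    project-path : ∀ {i j} → TransClosure StepΧ i j → ProjectedPath i j
    project-path ⟦ s ⟧ = project-step s
    project-path (s ◂ r) = project-++ (project-step s) (project-path r)

    composite-acyclic : ∀ i → ¬ TransClosure StepΧ i i
    composite-acyclic i c with project-path c
    ... | insideΨ i' j' e1 e2 p = progress Ψ j' (subst (λ z → TransClosure (Step Ψ) z j') (innerBox-injective (trans (sym e1) e2)) p)
    ... | alongΦ q = progress Φ (collapseBox i) q

    composite : WD (pre ++ ss ++ post) v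
    composite = fromWiring follow back back-follow follow-back follow-ty composite-acyclic

    composite-fused : ∀ x → Fused Φ Ψ x (follow x)
    composite-fused x = subst (λ z → Fused Φ Ψ z (follow z)) (vSΧ-inv x) (h (vSΧ x))
      where
        hΨ : ∀ r (y : Tgt ss t) → wiring Ψ (inj₂ r) ≡ y → Fused Φ Ψ (rΧ r) (fΨ' y)
        hΨ r (inj₁ s) e = fiii r s e
        hΨ r (inj₂ q) e = fiv r q (out q) e (outSpec q)
        hΦΨ : ∀ u p → wiring Φ (uΦ u) ≡ tiΦ p → (y : Tgt ss t) → wiring Ψ (inj₁ p) ≡ y → Fused Φ Ψ (uΧ u) (fΨ' y)
        hΦΨ u p e (inj₁ s) e' = fi u p s e e'
        hΦΨ u p e (inj₂ q) e' = fii' u p q (out q) e e' (outSpec q)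
        hΦ : ∀ u z → wiring Φ (uΦ u) ≡ tiwΦ z → Fused Φ Ψ (uΧ u) (fΦ' z)
        hΦ u (inj₁ p) e = hΦΨ u p e _ refl
        hΦ u (inj₂ w) e = fii u w e
        h : ∀ z → Fused Φ Ψ (urΧ z) (follow (urΧ z))
        h (inj₁ u) = subst (Fused Φ Ψ (uΧ u)) (sym (follow-uΧ u)) (hΦ u (vTΦ (wiring Φ (uΦ u))) (sym (vTΦ-inv (wiring Φ (uΦ u)))))
        h (inj₂ r) = subst (Fused Φ Ψ (rΧ r)) (sym (follow-rΧ r)) (hΨ r _ refl)

  compose : ∀ pre {ss post t v} → WD (pre ++ t ∷ post) v → WD ss t → WD (pre ++ ss ++ post) v
  compose pre {ss} {post} {t} {v} = Composite.composite pre ss post t v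

  act-composite : (H : Algebra) → ∀ pre ss post {t v} (Φ : WD (pre ++ t ∷ post) v) (Ψ : WD ss t) →
              ∀ xs ys zs → act H (compose pre Φ Ψ) (++⁺ xs (++⁺ ys zs)) ≡ act H Φ (++⁺ xs (act H Ψ ys ∷ zs))
  act-composite H pre ss post {t} {v} Φ Ψ = act-comp H pre ss post Φ Ψ _ (Composite.composite-fused pre ss post t v Φ Ψ)

  module CompositeWiring (pre ss post : List Box) (t v : Box) (Φ : WD (pre ++ t ∷ post) v) (Ψ : WD ss t) where
    open Comp pre ss post t v
    open Composite pre ss post t v Φ Ψ

    out-eq : ∀ q w → wiring Φ (toΦ q) ≡ wΦ w → out q ≡ w
    out-eq q w e = inj₂-injective (trans (sym (vTΦ-wΦ (out q))) (trans (cong vTΦ (trans (sym (outSpec q)) e)) (vTΦ-wΦ w)))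

    composite-ii : ∀ u w → wiring Φ (uΦ u) ≡ wΦ w → wiring composite (uΧ u) ≡ wΧ w
    composite-ii u w e = trans (follow-uΧ u) (cong fΦ' (trans (cong vTΦ e) (vTΦ-wΦ w)))

    composite-enters-inner : ∀ u p → wiring Φ (uΦ u) ≡ tiΦ p → wiring composite (uΧ u) ≡ fΨ' (wiring Ψ (inj₁ p))
    composite-enters-inner u p e = trans (follow-uΧ u) (cong fΦ' (trans (cong vTΦ e) (vTΦ-tiΦ p)))

    composite-i : ∀ u p s → wiring Φ (uΦ u) ≡ tiΦ p → wiring Ψ (inj₁ p) ≡ inj₁ s → wiring composite (uΧ u) ≡ sΧ s
    composite-i u p s e e' = trans (composite-enters-inner u p e) (cong fΨ' e')

    composite-ii-chain : ∀ u p q w → wiring Φ (uΦ u) ≡ tiΦ p → wiring Ψ (inj₁ p) ≡ inj₂ q → wiring Φ (toΦ q) ≡ wΦ w →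
         wiring composite (uΧ u) ≡ wΧ w
    composite-ii-chain u p q w e e' e'' = trans (composite-enters-inner u p e) (trans (cong fΨ' e') (cong wΧ (out-eq q w e'')))

    composite-iii : ∀ r s → wiring Ψ (inj₂ r) ≡ inj₁ s → wiring composite (rΧ r) ≡ sΧ s
    composite-iii r s e = trans (follow-rΧ r) (cong fΨ' e)

    composite-iv : ∀ r q w → wiring Ψ (inj₂ r) ≡ inj₂ q → wiring Φ (toΦ q) ≡ wΦ w → wiring composite (rΧ r) ≡ wΧ w
    composite-iv r q w e e' = trans (follow-rΧ r) (trans (cong fΨ' e) (cong wΧ (out-eq q w e')))

  subst-++-identityʳ⁻-inl : ∀ A (a : Port A) → subst Port (sym (++-identityʳ A)) a ≡ inl A [] a
  subst-++-identityʳ⁻-inl (x ∷ A) zero = subst-sym-zero x (++-identityʳ A)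
  subst-++-identityʳ⁻-inl (x ∷ A) (suc a) = trans (subst-sym-suc x (++-identityʳ A) a) (cong suc (subst-++-identityʳ⁻-inl A a))

  subst-++-identityʳ-inl : ∀ A (a : Port A) → subst Port (++-identityʳ A) (inl A [] a) ≡ a
  subst-++-identityʳ-inl A a = trans (cong (subst Port (++-identityʳ A)) (sym (subst-++-identityʳ⁻-inl A a))) (subst-subst-sym (++-identityʳ A))

  subst-++-assoc⁻-inl : ∀ A B C (a : Port A) → subst Port (sym (++-assoc A B C)) (inl A (B ++ C) a) ≡ inl (A ++ B) C (inl A B a)
  subst-++-assoc⁻-inl (x ∷ A) B C zero = subst-sym-zero x (++-assoc A B C)
  subst-++-assoc⁻-inl (x ∷ A) B C (suc a) = trans (subst-sym-suc x (++-assoc A B C) _) (cong suc (subst-++-assoc⁻-inl A B C a))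

  subst-++-assoc⁻-inr-inl : ∀ A B C (b : Port B) → subst Port (sym (++-assoc A B C)) (inr A (B ++ C) (inl B C b)) ≡ inl (A ++ B) C (inr A B b)
  subst-++-assoc⁻-inr-inl [] B C b = refl
  subst-++-assoc⁻-inr-inl (x ∷ A) B C b = trans (subst-sym-suc x (++-assoc A B C) _) (cong suc (subst-++-assoc⁻-inr-inl A B C b))

  subst-++-assoc⁻-inr-inr : ∀ A B C (c : Port C) → subst Port (sym (++-assoc A B C)) (inr A (B ++ C) (inr B C c)) ≡ inr (A ++ B) C c
  subst-++-assoc⁻-inr-inr [] B C c = refl
  subst-++-assoc⁻-inr-inr (x ∷ A) B C c = trans (subst-sym-suc x (++-assoc A B C) _) (cong suc (subst-++-assoc⁻-inr-inr A B C c))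

  subst-sym⇒subst : ∀ {X Y : TSet} (e : X ≡ Y) {p : Port Y} {q : Port X} → subst Port (sym e) p ≡ q → subst Port e q ≡ p
  subst-sym⇒subst e {p} eq = trans (cong (subst Port e) (sym eq)) (subst-subst-sym e)

  subst-++-assoc-inl-inl : ∀ A B C (a : Port A) → subst Port (++-assoc A B C) (inl (A ++ B) C (inl A B a)) ≡ inl A (B ++ C) a
  subst-++-assoc-inl-inl A B C a = subst-sym⇒subst (++-assoc A B C) (subst-++-assoc⁻-inl A B C a)
  subst-++-assoc-inl-inr : ∀ A B C (b : Port B) → subst Port (++-assoc A B C) (inl (A ++ B) C (inr A B b)) ≡ inr A (B ++ C) (inl B C b)
  subst-++-assoc-inl-inr A B C b = subst-sym⇒subst (++-assoc A B C) (subst-++-assoc⁻-inr-inl A B C b)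
  subst-++-assoc-inr : ∀ A B C (c : Port C) → subst Port (++-assoc A B C) (inr (A ++ B) C c) ≡ inr A (B ++ C) (inr B C c)
  subst-++-assoc-inr A B C c = subst-sym⇒subst (++-assoc A B C) (subst-++-assoc⁻-inr-inr A B C c)

  subst-sym-sym : ∀ {X Y : TSet} (e : X ≡ Y) (p : Port X) → subst Port (sym (sym e)) p ≡ subst Port e p
  subst-sym-sym refl p = refl

  ty-subst : ∀ {X Y : TSet} (e : X ≡ Y) (p : Port X) → ty Y (subst Port e p) ≡ ty X p
  ty-subst refl p = refl

  -- Turns the transports along ++-assoc and ++-identityʳ in the strictness laws into actions
  -- of H (subst₂-act-castW).
  castW : ∀ {A B A' B'} → A ≡ A' → B ≡ B' → WD ((A , B) ∷ []) (A' , B')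
  castW {A} {B} {A'} {B'} e1 e2 = fromWiring f g gf fg tyf pr
    where
      f : Src ((A , B) ∷ []) (A' , B') → Tgt ((A , B) ∷ []) (A' , B')
      f (inj₁ a) = inj₁ (inj₁ (subst Port (sym e1) a))
      f (inj₂ (inj₁ b)) = inj₂ (subst Port e2 b)
      g : Tgt ((A , B) ∷ []) (A' , B') → Src ((A , B) ∷ []) (A' , B')
      g (inj₁ (inj₁ a)) = inj₁ (subst Port e1 a)
      g (inj₂ b) = inj₂ (inj₁ (subst Port (sym e2) b))
      gf : ∀ x → g (f x) ≡ x
      gf (inj₁ a) = cong inj₁ (subst-subst-sym e1)
      gf (inj₂ (inj₁ b)) = cong (λ z → inj₂ (inj₁ z)) (subst-sym-subst e2)
      fg : ∀ y → f (g y) ≡ y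
      fg (inj₁ (inj₁ a)) = cong (λ z → inj₁ (inj₁ z)) (subst-sym-subst e1)
      fg (inj₂ b) = cong inj₂ (subst-subst-sym e2)
      tyf : ∀ x → tgtTy ((A , B) ∷ []) (A' , B') (f x) ≡ srcTy ((A , B) ∷ []) (A' , B') x
      tyf (inj₁ a) = ty-subst (sym e1) a
      tyf (inj₂ (inj₁ b)) = ty-subst e2 b
      nope : ∀ p q → f (inj₂ p) ≡ inj₁ q → ⊥
      nope (inj₁ b) q ()
      pr : ∀ i → ¬ TransClosure (StepOf ((A , B) ∷ []) (A' , B') (λ x → x) f) i i
      pr i ⟦ (x , p , q , refl , e , _) ⟧ = nope p q e
      pr i ((x , p , q , refl , e , _) ◂ _) = nope p q e

  subst₂-act-castW : (H : Algebra) → ∀ {A B A' B'} (e1 : A ≡ A') (e2 : B ≡ B') (x : HomOf H A B) →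
              subst₂ (HomOf H) e1 e2 x ≡ act H (castW e1 e2) (x ∷ [])
  subst₂-act-castW H {A} {B} refl refl x = sym (trans (act-≗wiring H (castW refl refl) (idW (A , B)) w (x ∷ [])) (act-id H _ x))
    where
      w : ∀ x → wiring (castW {A} {B} refl refl) x ≡ wiring (idW (A , B)) x
      w (inj₁ a) = refl
      w (inj₂ (inj₁ b)) = refl

  subst-as-subst₂ : ∀ {P : TSet → TSet → Set} {X Y Z} (e : X ≡ Y) (x : P X Z) → subst (λ W → P W Z) e x ≡ subst₂ P e refl x
  subst-as-subst₂ refl x = refl

  ty-split : ∀ A B (y : Port (A ++ B)) → ty (A ++ B) y ≡ Sum.[ ty A , ty B ]′ (split A B y)
  ty-split A B y = trans (cong (ty (A ++ B)) (sym (join-split A B y))) (join-ty A B (split A B y))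

  ty-swap : ∀ A B (s : Port A ⊎ Port B) → Sum.[ ty B , ty A ]′ (Sum.swap s) ≡ Sum.[ ty A , ty B ]′ s
  ty-swap A B (inj₁ a) = refl
  ty-swap A B (inj₂ b) = refl

  symW : ∀ A B → WD [] (A ++ B , B ++ A)
  symW A B = fromWiring f g gf fg tyf (λ ())
    where
      f : Src [] (A ++ B , B ++ A) → Tgt [] (A ++ B , B ++ A)
      f (inj₁ y) = inj₂ (join B A (Sum.swap (split A B y)))
      g : Tgt [] (A ++ B , B ++ A) → Src [] (A ++ B , B ++ A)
      g (inj₂ z) = inj₁ (join A B (Sum.swap (split B A z)))
      gf : ∀ x → g (f x) ≡ x
      gf (inj₁ y) = cong inj₁ (trans (cong (λ s → join A B (Sum.swap s)) (split-join B A (Sum.swap (split A B y))))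
                      (trans (cong (join A B) (swap-involutive (split A B y))) (join-split A B y)))
      fg : ∀ y → f (g y) ≡ y
      fg (inj₂ z) = cong inj₂ (trans (cong (λ s → join B A (Sum.swap s)) (split-join A B (Sum.swap (split B A z))))
                      (trans (cong (join B A) (swap-involutive (split B A z))) (join-split B A z)))
      tyf : ∀ x → tgtTy [] (A ++ B , B ++ A) (f x) ≡ srcTy [] (A ++ B , B ++ A) x
      tyf (inj₁ y) = trans (join-ty B A (Sum.swap (split A B y))) (trans (ty-swap A B (split A B y)) (sym (ty-split A B y)))

  module SMCLaws (H : Algebra) where
    σH : ∀ A B → HomOf H (A ++ B) (B ++ A)
    σH A B = act H (symW A B) []

    ⨾-idˡ' : ∀ {A B} (f : HomOf H A B) → seqOf H (idOf H A) f ≡ f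
    ⨾-idˡ' {A} {B} f = trans (sym (act-composite H [] [] ((A , B) ∷ []) (seqW A A B) (unitW A) [] [] (f ∷ [])))
       (trans (act-≗wiring H _ (idW (A , B)) (λ { (inj₁ a) → refl ; (inj₂ (inj₁ b)) → refl ; (inj₂ (inj₂ ())) }) (f ∷ [])) (act-id H _ f))

    ⨾-idʳ' : ∀ {A B} (f : HomOf H A B) → seqOf H f (idOf H B) ≡ f
    ⨾-idʳ' {A} {B} f = trans (sym (act-composite H ((A , B) ∷ []) [] [] (seqW A B B) (unitW B) (f ∷ []) [] []))
       (trans (act-≗wiring H _ (idW (A , B)) (λ { (inj₁ a) → refl ; (inj₂ (inj₁ b)) → refl ; (inj₂ (inj₂ ())) }) (f ∷ [])) (act-id H _ f))

    ⨾-assoc' : ∀ {A B C D} (f : HomOf H A B) (g : HomOf H B C) (h : HomOf H C D) →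
               seqOf H (seqOf H f g) h ≡ seqOf H f (seqOf H g h)
    ⨾-assoc' {A} {B} {C} {D} f g h =
      trans (sym (act-composite H [] ((A , B) ∷ (B , C) ∷ []) ((C , D) ∷ []) (seqW A C D) (seqW A B C) [] (f ∷ g ∷ []) (h ∷ [])))
      (trans (act-≗wiring H _ _ (λ { (inj₁ a) → refl ; (inj₂ (inj₁ b)) → refl ; (inj₂ (inj₂ (inj₁ c))) → refl
                                   ; (inj₂ (inj₂ (inj₂ (inj₁ d)))) → refl ; (inj₂ (inj₂ (inj₂ (inj₂ ())))) })
                                (f ∷ g ∷ h ∷ []))
        (act-composite H ((A , B) ∷ []) ((B , C) ∷ (C , D) ∷ []) [] (seqW A B D) (seqW B C D) (f ∷ []) (g ∷ h ∷ []) []))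

    ⊗-unitˡ' : ∀ {A B} (f : HomOf H A B) → paraOf H (idOf H []) f ≡ f
    ⊗-unitˡ' {A} {B} f = trans (sym (act-composite H [] [] ((A , B) ∷ []) (paraW [] [] A B) (unitW []) [] [] (f ∷ [])))
       (trans (act-≗wiring H _ (idW (A , B)) (λ { (inj₁ a) → refl ; (inj₂ (inj₁ b)) → refl ; (inj₂ (inj₂ ())) }) (f ∷ [])) (act-id H _ f))

    ⊗-id' : ∀ A B → paraOf H (idOf H A) (idOf H B) ≡ idOf H (A ++ B)
    ⊗-id' A B = trans (sym (act-composite H [] [] ((B , B) ∷ []) (paraW A A B B) (unitW A) [] [] (idOf H B ∷ [])))
       (trans (sym (act-composite H [] [] [] C1 (unitW B) [] [] []))
         (act-≗wiring H _ (unitW (A ++ B)) w []))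
      where
        C1 : WD ((B , B) ∷ []) (A ++ B , A ++ B)
        C1 = compose [] (paraW A A B B) (unitW A)
        w : ∀ x → wiring (compose [] C1 (unitW B)) x ≡ wiring (unitW (A ++ B)) x
        w (inj₁ y) with split A B y | join-split A B y
        ... | inj₁ a | refl = refl
        ... | inj₂ b | refl = refl

    σ-inv' : ∀ A B → seqOf H (σH A B) (σH B A) ≡ idOf H (A ++ B)
    σ-inv' A B = trans (sym (act-composite H [] [] ((B ++ A , A ++ B) ∷ []) (seqW (A ++ B) (B ++ A) (A ++ B)) (symW A B) [] [] (σH B A ∷ [])))
       (trans (sym (act-composite H [] [] [] C1 (symW B A) [] [] []))
         (act-≗wiring H _ (unitW (A ++ B)) w []))
      where
        C1 : WD ((B ++ A , A ++ B) ∷ []) (A ++ B , A ++ B)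
        C1 = compose [] (seqW (A ++ B) (B ++ A) (A ++ B)) (symW A B)
        w : ∀ x → wiring (compose [] C1 (symW B A)) x ≡ wiring (unitW (A ++ B)) x
        w (inj₁ y) with split A B y | join-split A B y
        ... | inj₁ a | refl rewrite split-join B A (inj₂ a) = refl
        ... | inj₂ b | refl rewrite split-join B A (inj₁ b) = refl

    σ-natural' : ∀ {A B A' B'} (f : HomOf H A B) (g : HomOf H A' B') →
                 seqOf H (paraOf H f g) (σH B B') ≡ seqOf H (σH A A') (paraOf H g f)
    σ-natural' {A} {B} {A'} {B'} f g =
      trans (sym (act-composite H [] ((A , B) ∷ (A' , B') ∷ []) ((B ++ B' , B' ++ B) ∷ []) (seqW (A ++ A') (B ++ B') (B' ++ B)) (paraW A B A' B') [] (f ∷ g ∷ []) (σH B B' ∷ [])))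
      (trans (sym (act-composite H ((A , B) ∷ (A' , B') ∷ []) [] [] L1 (symW B B') (f ∷ g ∷ []) [] []))
      (trans (sym (act-swap H [] (A , B) (A' , B') [] L2 R2 sw [] f g []))
      (trans (act-composite H [] ((A' , B') ∷ (A , B) ∷ []) [] R1 (paraW A' B' A B) [] (g ∷ f ∷ []) [])
        (act-composite H [] [] ((A' ++ A , B' ++ B) ∷ []) (seqW (A ++ A') (A' ++ A) (B' ++ B)) (symW A A') [] [] (paraOf H g f ∷ [])))))
      where
        L1 : WD ((A , B) ∷ (A' , B') ∷ (B ++ B' , B' ++ B) ∷ []) (A ++ A' , B' ++ B)
        L1 = compose [] (seqW (A ++ A') (B ++ B') (B' ++ B)) (paraW A B A' B')
        L2 : WD ((A , B) ∷ (A' , B') ∷ []) (A ++ A' , B' ++ B)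
        L2 = compose ((A , B) ∷ (A' , B') ∷ []) L1 (symW B B')
        R1 : WD ((A' ++ A , B' ++ B) ∷ []) (A ++ A' , B' ++ B)
        R1 = compose [] (seqW (A ++ A') (A' ++ A) (B' ++ B)) (symW A A')
        R2 : WD ((A' , B') ∷ (A , B) ∷ []) (A ++ A' , B' ++ B)
        R2 = compose [] R1 (paraW A' B' A B)
        sw : IsSwapped [] (A , B) (A' , B') [] L2 R2
        sw (inj₁ y) with split A A' y | join-split A A' y
        ... | inj₁ a | refl rewrite split-join A' A (inj₂ a) = refl
        ... | inj₂ b | refl rewrite split-join A' A (inj₁ b) = refl
        sw (inj₂ (inj₁ b)) rewrite split-join B B' (inj₁ b) = refl
        sw (inj₂ (inj₂ (inj₁ b))) rewrite split-join B B' (inj₂ b) = refl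
        sw (inj₂ (inj₂ (inj₂ ())))

    ⊗-⨾' : ∀ {A B C A' B' C'} (f : HomOf H A B) (g : HomOf H B C) (f' : HomOf H A' B') (g' : HomOf H B' C') →
           paraOf H (seqOf H f g) (seqOf H f' g') ≡ seqOf H (paraOf H f f') (paraOf H g g')
    ⊗-⨾' {A} {B} {C} {A'} {B'} {C'} f g f' g' =
      trans (sym (act-composite H [] ((A , B) ∷ (B , C) ∷ []) ((A' , C') ∷ []) (paraW A C A' C') (seqW A B C) [] (f ∷ g ∷ []) (seqOf H f' g' ∷ [])))
      (trans (sym (act-composite H ((A , B) ∷ (B , C) ∷ []) ((A' , B') ∷ (B' , C') ∷ []) [] L1 (seqW A' B' C') (f ∷ g ∷ []) (f' ∷ g' ∷ []) []))
      (trans (sym (act-swap H ((A , B) ∷ []) (B , C) (A' , B') ((B' , C') ∷ []) L2 R2 sw (f ∷ []) g f' (g' ∷ [])))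
      (trans (act-composite H ((A , B) ∷ (A' , B') ∷ []) ((B , C) ∷ (B' , C') ∷ []) [] R1 (paraW B C B' C') (f ∷ f' ∷ []) (g ∷ g' ∷ []) [])
        (act-composite H [] ((A , B) ∷ (A' , B') ∷ []) ((B ++ B' , C ++ C') ∷ []) (seqW (A ++ A') (B ++ B') (C ++ C')) (paraW A B A' B') [] (f ∷ f' ∷ []) (paraOf H g g' ∷ [])))))
      where
        L1 : WD ((A , B) ∷ (B , C) ∷ (A' , C') ∷ []) (A ++ A' , C ++ C')
        L1 = compose [] (paraW A C A' C') (seqW A B C)
        L2 : WD ((A , B) ∷ (B , C) ∷ (A' , B') ∷ (B' , C') ∷ []) (A ++ A' , C ++ C')
        L2 = compose ((A , B) ∷ (B , C) ∷ []) L1 (seqW A' B' C')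
        R1 : WD ((A , B) ∷ (A' , B') ∷ (B ++ B' , C ++ C') ∷ []) (A ++ A' , C ++ C')
        R1 = compose [] (seqW (A ++ A') (B ++ B') (C ++ C')) (paraW A B A' B')
        R2 : WD ((A , B) ∷ (A' , B') ∷ (B , C) ∷ (B' , C') ∷ []) (A ++ A' , C ++ C')
        R2 = compose ((A , B) ∷ (A' , B') ∷ []) R1 (paraW B C B' C')
        sw : IsSwapped ((A , B) ∷ []) (B , C) (A' , B') ((B' , C') ∷ []) L2 R2
        sw (inj₁ y) with split A A' y | join-split A A' y
        ... | inj₁ a | refl = refl
        ... | inj₂ b | refl = refl
        sw (inj₂ (inj₁ b)) rewrite split-join B B' (inj₁ b) = refl
        sw (inj₂ (inj₂ (inj₁ c))) = refl
        sw (inj₂ (inj₂ (inj₂ (inj₁ b)))) rewrite split-join B B' (inj₂ b) = refl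
        sw (inj₂ (inj₂ (inj₂ (inj₂ (inj₁ c))))) = refl
        sw (inj₂ (inj₂ (inj₂ (inj₂ (inj₂ ())))))

  module StrictnessLaws (H : Algebra) where
    open SMCLaws H

    ⊗-unitʳ' : ∀ {A B} (f : HomOf H A B) →
               subst₂ (HomOf H) (++-identityʳ A) (++-identityʳ B) (paraOf H f (idOf H [])) ≡ f
    ⊗-unitʳ' {A} {B} f =
      trans (subst₂-act-castW H (++-identityʳ A) (++-identityʳ B) _)
      (trans (sym (act-composite H [] ((A , B) ∷ ([] , []) ∷ []) [] (castW (++-identityʳ A) (++-identityʳ B)) (paraW A B [] []) [] (f ∷ idOf H [] ∷ []) []))
      (trans (sym (act-composite H ((A , B) ∷ []) [] [] C1 (unitW []) (f ∷ []) [] []))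
      (trans (act-≗wiring H _ (idW (A , B)) w (f ∷ [])) (act-id H _ f))))
      where
        C1 : WD ((A , B) ∷ ([] , []) ∷ []) (A , B)
        C1 = compose [] (castW (++-identityʳ A) (++-identityʳ B)) (paraW A B [] [])
        w : ∀ x → wiring (compose ((A , B) ∷ []) C1 (unitW [])) x ≡ wiring (idW (A , B)) x
        w (inj₁ a) rewrite subst-++-identityʳ⁻-inl A a | split-join A [] (inj₁ a) = refl
        w (inj₂ (inj₁ b)) rewrite subst-++-identityʳ-inl B b = refl
        w (inj₂ (inj₂ ()))

    ⊗-assoc' : ∀ {A B A' B' A'' B''} (f : HomOf H A B) (g : HomOf H A' B') (h : HomOf H A'' B'') →
               subst₂ (HomOf H) (++-assoc A A' A'') (++-assoc B B' B'') (paraOf H (paraOf H f g) h) ≡ paraOf H f (paraOf H g h)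
    ⊗-assoc' {A} {B} {A'} {B'} {A''} {B''} f g h =
      trans (subst₂-act-castW H (++-assoc A A' A'') (++-assoc B B' B'') _)
      (trans (sym (act-composite H [] ((A ++ A' , B ++ B') ∷ (A'' , B'') ∷ []) [] (castW (++-assoc A A' A'') (++-assoc B B' B'')) (paraW (A ++ A') (B ++ B') A'' B'') [] (paraOf H f g ∷ h ∷ []) []))
      (trans (sym (act-composite H [] ((A , B) ∷ (A' , B') ∷ []) ((A'' , B'') ∷ []) C1 (paraW A B A' B') [] (f ∷ g ∷ []) (h ∷ [])))
      (trans (act-≗wiring H _ _ w (f ∷ g ∷ h ∷ []))
        (act-composite H ((A , B) ∷ []) ((A' , B') ∷ (A'' , B'') ∷ []) [] (paraW A B (A' ++ A'') (B' ++ B'')) (paraW A' B' A'' B'') (f ∷ []) (g ∷ h ∷ []) []))))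
      where
        C1 : WD ((A ++ A' , B ++ B') ∷ (A'' , B'') ∷ []) (A ++ (A' ++ A'') , B ++ (B' ++ B''))
        C1 = compose [] (castW (++-assoc A A' A'') (++-assoc B B' B'')) (paraW (A ++ A') (B ++ B') A'' B'')
        w : ∀ x → wiring (compose [] C1 (paraW A B A' B')) x
                ≡ wiring (compose ((A , B) ∷ []) (paraW A B (A' ++ A'') (B' ++ B'')) (paraW A' B' A'' B'')) x
        w (inj₁ y) with split A (A' ++ A'') y | join-split A (A' ++ A'') y
        ... | inj₁ a | refl rewrite subst-++-assoc⁻-inl A A' A'' a | split-join (A ++ A') A'' (inj₁ (inl A A' a)) | split-join A A' (inj₁ a) = refl
        ... | inj₂ z | refl with split A' A'' z | join-split A' A'' z
        ...   | inj₁ a | refl rewrite subst-++-assoc⁻-inr-inl A A' A'' a | split-join (A ++ A') A'' (inj₁ (inr A A' a)) | split-join A A' (inj₂ a) = refl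
        ...   | inj₂ a | refl rewrite subst-++-assoc⁻-inr-inr A A' A'' a | split-join (A ++ A') A'' (inj₂ a) = refl
        w (inj₂ (inj₁ b)) rewrite subst-++-assoc-inl-inl B B' B'' b = refl
        w (inj₂ (inj₂ (inj₁ b))) rewrite subst-++-assoc-inl-inr B B' B'' b = refl
        w (inj₂ (inj₂ (inj₂ (inj₁ b)))) rewrite subst-++-assoc-inr B B' B'' b = refl
        w (inj₂ (inj₂ (inj₂ (inj₂ ()))))

  module HexagonDiagrams (A B C : TSet) where
    P Q R : TSet
    P = (A ++ B) ++ C
    Q = (B ++ A) ++ C
    R = B ++ (C ++ A)
    V : Box
    V = (A ++ (B ++ C) , (B ++ C) ++ A)
    e1 : P ≡ A ++ (B ++ C)
    e1 = ++-assoc A B C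
    e2 : R ≡ (B ++ C) ++ A
    e2 = sym (++-assoc B C A)
    e3 : B ++ (A ++ C) ≡ Q
    e3 = sym (++-assoc B A C)

    Xa : WD ((C , C) ∷ []) (P , Q)
    Xa = compose [] (paraW (A ++ B) (B ++ A) C C) (symW A B)
    Xd : WD [] (P , Q)
    Xd = compose [] Xa (unitW C)
    Ya : WD ((B , B) ∷ (A ++ C , C ++ A) ∷ []) (Q , R)
    Ya = compose [] (castW e3 refl) (paraW B B (A ++ C) (C ++ A))
    Yb : WD ((A ++ C , C ++ A) ∷ []) (Q , R)
    Yb = compose [] Ya (unitW B)
    Yd : WD [] (Q , R)
    Yd = compose [] Yb (symW A C)

    -- Only how Xd and Yd wire the outer ports matters; recording just that keeps these large
    -- diagrams from being unfolded in HexagonComposite, as do its opaque definitions.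
    record XSpec (X : WD [] (P , Q)) : Set where
      field
        xa : ∀ a → TBij.to (tgt X) (TBij.from (src X) (inj₁ (inl (A ++ B) C (inl A B a)))) ≡ inj₂ (inl (B ++ A) C (inr B A a))
        xb : ∀ b → TBij.to (tgt X) (TBij.from (src X) (inj₁ (inl (A ++ B) C (inr A B b)))) ≡ inj₂ (inl (B ++ A) C (inl B A b))
        xc : ∀ c → TBij.to (tgt X) (TBij.from (src X) (inj₁ (inr (A ++ B) C c))) ≡ inj₂ (inr (B ++ A) C c)

    record YSpec (Y : WD [] (Q , R)) : Set where
      field
        ya : ∀ a → TBij.to (tgt Y) (TBij.from (src Y) (inj₁ (inl (B ++ A) C (inr B A a)))) ≡ inj₂ (inr B (C ++ A) (inr C A a))
        yb : ∀ b → TBij.to (tgt Y) (TBij.from (src Y) (inj₁ (inl (B ++ A) C (inl B A b)))) ≡ inj₂ (inl B (C ++ A) b)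
        yc : ∀ c → TBij.to (tgt Y) (TBij.from (src Y) (inj₁ (inr (B ++ A) C c))) ≡ inj₂ (inr B (C ++ A) (inl C A c))

    xspec : XSpec Xd
    xspec = record { xa = λ a → h₁ a ; xb = λ b → h₂ b ; xc = λ c → h₃ c }
      where
        h₁ : ∀ a → wiring Xd (inj₁ (inl (A ++ B) C (inl A B a))) ≡ inj₂ (inl (B ++ A) C (inr B A a))
        h₁ a rewrite split-join (A ++ B) C (inj₁ (inl A B a)) | split-join A B (inj₁ a) = refl
        h₂ : ∀ b → wiring Xd (inj₁ (inl (A ++ B) C (inr A B b))) ≡ inj₂ (inl (B ++ A) C (inl B A b))
        h₂ b rewrite split-join (A ++ B) C (inj₁ (inr A B b)) | split-join A B (inj₂ b) = refl
        h₃ : ∀ c → wiring Xd (inj₁ (inr (A ++ B) C c)) ≡ inj₂ (inr (B ++ A) C c)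
        h₃ c rewrite split-join (A ++ B) C (inj₂ c) = refl

    module WYa = CompositeWiring [] ((B , B) ∷ (A ++ C , C ++ A) ∷ []) [] (B ++ (A ++ C) , R) (Q , R) (castW e3 refl) (paraW B B (A ++ C) (C ++ A))
    module WYb = CompositeWiring [] [] ((A ++ C , C ++ A) ∷ []) (B , B) (Q , R) Ya (unitW B)
    module WYd = CompositeWiring [] [] [] (A ++ C , C ++ A) (Q , R) Yb (symW A C)

    paraW-split : ∀ (y : Port (B ++ (A ++ C))) s → split B (A ++ C) y ≡ s →
         wiring (paraW B B (A ++ C) (C ++ A)) (inj₁ y) ≡ Sum.[ (λ b → inj₁ (inj₁ b)) , (λ z → inj₁ (inj₂ (inj₁ z))) ]′ s
    paraW-split y s e rewrite e with s
    ... | inj₁ b = refl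
    ... | inj₂ z = refl

    Ya-b : ∀ b → wiring Ya (inj₁ (inl (B ++ A) C (inl B A b))) ≡ inj₁ (inj₁ b)
    Ya-b b = WYa.composite-i (inj₁ _) _ (inj₁ b) refl
      (trans (cong (λ z → wiring (paraW B B (A ++ C) (C ++ A)) (inj₁ z)) (trans (subst-sym-sym (++-assoc B A C) _) (subst-++-assoc-inl-inl B A C b)))
             (paraW-split _ _ (split-join B (A ++ C) (inj₁ b))))
    Ya-a : ∀ a → wiring Ya (inj₁ (inl (B ++ A) C (inr B A a))) ≡ inj₁ (inj₂ (inj₁ (inl A C a)))
    Ya-a a = WYa.composite-i (inj₁ _) _ (inj₂ (inj₁ (inl A C a))) refl
      (trans (cong (λ z → wiring (paraW B B (A ++ C) (C ++ A)) (inj₁ z)) (trans (subst-sym-sym (++-assoc B A C) _) (subst-++-assoc-inl-inr B A C a)))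
             (paraW-split _ _ (split-join B (A ++ C) (inj₂ (inl A C a)))))
    Ya-c : ∀ c → wiring Ya (inj₁ (inr (B ++ A) C c)) ≡ inj₁ (inj₂ (inj₁ (inr A C c)))
    Ya-c c = WYa.composite-i (inj₁ _) _ (inj₂ (inj₁ (inr A C c))) refl
      (trans (cong (λ z → wiring (paraW B B (A ++ C) (C ++ A)) (inj₁ z)) (trans (subst-sym-sym (++-assoc B A C) _) (subst-++-assoc-inr B A C c)))
             (paraW-split _ _ (split-join B (A ++ C) (inj₂ (inr A C c)))))
    Ya-o1 : ∀ b → wiring Ya (inj₂ (inj₁ b)) ≡ inj₂ (inl B (C ++ A) b)
    Ya-o1 b = WYa.composite-iv (inj₁ b) (inl B (C ++ A) b) (inj₂ (inl B (C ++ A) b)) refl refl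
    Ya-o2 : ∀ z → wiring Ya (inj₂ (inj₂ (inj₁ z))) ≡ inj₂ (inr B (C ++ A) z)
    Ya-o2 z = WYa.composite-iv (inj₂ (inj₁ z)) (inr B (C ++ A) z) (inj₂ (inr B (C ++ A) z)) refl refl

    Yb-b : ∀ b → wiring Yb (inj₁ (inl (B ++ A) C (inl B A b))) ≡ inj₂ (inl B (C ++ A) b)
    Yb-b b = WYb.composite-ii-chain (inj₁ _) b b (inj₂ (inl B (C ++ A) b)) (Ya-b b) refl (Ya-o1 b)
    Yb-a : ∀ a → wiring Yb (inj₁ (inl (B ++ A) C (inr B A a))) ≡ inj₁ (inj₁ (inl A C a))
    Yb-a a = WYb.composite-ii (inj₁ _) (inj₁ (inj₂ (inj₁ (inl A C a)))) (Ya-a a)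
    Yb-c : ∀ c → wiring Yb (inj₁ (inr (B ++ A) C c)) ≡ inj₁ (inj₁ (inr A C c))
    Yb-c c = WYb.composite-ii (inj₁ _) (inj₁ (inj₂ (inj₁ (inr A C c)))) (Ya-c c)
    Yb-o : ∀ z → wiring Yb (inj₂ (inj₁ z)) ≡ inj₂ (inr B (C ++ A) z)
    Yb-o z = WYb.composite-ii (inj₂ (inj₂ (inj₁ z))) (inj₂ (inr B (C ++ A) z)) (Ya-o2 z)

    symW-split : ∀ (y : Port (A ++ C)) s → split A C y ≡ s →
          wiring (symW A C) (inj₁ y) ≡ inj₂ (join C A (Sum.swap s))
    symW-split y s e = cong (λ z → inj₂ (join C A (Sum.swap z))) e

    yspec : YSpec Yd
    yspec = record { ya = λ a → WYd.composite-ii-chain (inj₁ _) (inl A C a) (inr C A a) (inj₂ _) (Yb-a a) (symW-split _ _ (split-join A C (inj₁ a))) (Yb-o (inr C A a))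
                   ; yb = λ b → WYd.composite-ii (inj₁ _) (inj₂ _) (Yb-b b)
                   ; yc = λ c → WYd.composite-ii-chain (inj₁ _) (inr A C c) (inl C A c) (inj₂ _) (Yb-c c) (symW-split _ _ (split-join A C (inj₂ c))) (Yb-o (inl C A c)) }

    module HexagonComposite (X : WD [] (P , Q)) (Y : WD [] (Q , R)) (xs : XSpec X) (ys : YSpec Y) where
      open XSpec xs
      open YSpec ys
      opaque
        T1 : WD ((Q , R) ∷ []) (P , R)
        T1 = compose [] (seqW P Q R) X
      opaque
        unfolding T1
        T1-def : T1 ≡ compose [] (seqW P Q R) X
        T1-def = refl
        T1-in : ∀ p q → wiring X (inj₁ p) ≡ inj₂ q → wiring T1 (inj₁ p) ≡ inj₁ (inj₁ q)
        T1-in p q e = CompositeWiring.composite-ii-chain [] [] ((Q , R) ∷ []) (P , Q) (P , R) (seqW P Q R) X (inj₁ p) p q (inj₁ (inj₂ (inj₁ q))) refl e refl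
        T1-out : ∀ r → wiring T1 (inj₂ (inj₁ r)) ≡ inj₂ r
        T1-out r = CompositeWiring.composite-ii [] [] ((Q , R) ∷ []) (P , Q) (P , R) (seqW P Q R) X (inj₂ (inj₂ (inj₁ r))) (inj₂ r) refl
      opaque
        T2 : WD [] (P , R)
        T2 = compose [] T1 Y
      opaque
        unfolding T2
        T2-def : T2 ≡ compose [] T1 Y
        T2-def = refl
        T2-in : ∀ p q r → wiring X (inj₁ p) ≡ inj₂ q → wiring Y (inj₁ q) ≡ inj₂ r → wiring T2 (inj₁ p) ≡ inj₂ r
        T2-in p q r e e' = CompositeWiring.composite-ii-chain [] [] [] (Q , R) (P , R) T1 Y (inj₁ p) q r (inj₂ r) (T1-in p q e) e' (T1-out r)
      opaque
        T3 : WD [] V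
        T3 = compose [] (castW e1 e2) T2
      opaque
        unfolding T3
        T3-def : T3 ≡ compose [] (castW e1 e2) T2
        T3-def = refl
        T3-in : ∀ y q r → wiring X (inj₁ (subst Port (sym e1) y)) ≡ inj₂ q → wiring Y (inj₁ q) ≡ inj₂ r →
                wiring T3 (inj₁ y) ≡ inj₂ (subst Port e2 r)
        T3-in y q r e e' = CompositeWiring.composite-ii-chain [] [] [] (P , R) V (castW e1 e2) T2 (inj₁ y) (subst Port (sym e1) y) r (inj₂ (subst Port e2 r)) refl (T2-in _ q r e e') refl

      symW-join : ∀ s → wiring (symW A (B ++ C)) (inj₁ (join A (B ++ C) s)) ≡ inj₂ (join (B ++ C) A (Sum.swap s))
      symW-join s = cong (λ z → inj₂ (join (B ++ C) A (Sum.swap z))) (split-join A (B ++ C) s)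

      hexagon-wiring-inr : ∀ s → wiring T3 (inj₁ (inr A (B ++ C) (join B C s))) ≡ wiring (symW A (B ++ C)) (inj₁ (inr A (B ++ C) (join B C s)))
      hexagon-wiring-inr (inj₁ b) = trans (T3-in _ _ _ (trans (cong (λ z → wiring X (inj₁ z)) (subst-++-assoc⁻-inr-inl A B C b)) (xb b)) (yb b))
                      (trans (cong inj₂ (subst-++-assoc⁻-inl B C A b)) (sym (symW-join (inj₂ (inl B C b)))))
      hexagon-wiring-inr (inj₂ c) = trans (T3-in _ _ _ (trans (cong (λ z → wiring X (inj₁ z)) (subst-++-assoc⁻-inr-inr A B C c)) (xc c)) (yc c))
                      (trans (cong inj₂ (subst-++-assoc⁻-inr-inl B C A c)) (sym (symW-join (inj₂ (inr B C c)))))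

      hexagon-wiring-join : ∀ s → wiring T3 (inj₁ (join A (B ++ C) s)) ≡ wiring (symW A (B ++ C)) (inj₁ (join A (B ++ C) s))
      hexagon-wiring-join (inj₁ a) = trans (T3-in _ _ _ (trans (cong (λ z → wiring X (inj₁ z)) (subst-++-assoc⁻-inl A B C a)) (xa a)) (ya a))
                      (trans (cong inj₂ (subst-++-assoc⁻-inr-inr B C A a)) (sym (symW-join (inj₁ a))))
      hexagon-wiring-join (inj₂ z) = subst (λ z → wiring T3 (inj₁ (inr A (B ++ C) z)) ≡ wiring (symW A (B ++ C)) (inj₁ (inr A (B ++ C) z)))
                      (join-split B C z) (hexagon-wiring-inr (split B C z))

      hexagon-wiring : ∀ x → wiring T3 x ≡ wiring (symW A (B ++ C)) x
      hexagon-wiring (inj₁ y) = subst (λ y → wiring T3 (inj₁ y) ≡ wiring (symW A (B ++ C)) (inj₁ y)) (join-split A (B ++ C) y)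
                         (hexagon-wiring-join (split A (B ++ C) y))

  module HexagonLaw (H : Algebra) where
    open SMCLaws H

    σ-hexagon' : ∀ A B C →
      σH A (B ++ C) ≡
      subst₂ (HomOf H) (++-assoc A B C) (sym (++-assoc B C A))
        (seqOf H (paraOf H (σH A B) (idOf H C))
          (subst (λ X → HomOf H X (B ++ (C ++ A))) (sym (++-assoc B A C)) (paraOf H (idOf H B) (σH A C))))
    σ-hexagon' A B C = sym (begin
        subst₂ (HomOf H) e1 e2 (seqOf H X Y)
          ≡⟨ cong (λ z → subst₂ (HomOf H) e1 e2 (seqOf H X z)) (trans (subst-as-subst₂ {P = HomOf H} e3 Y') (subst₂-act-castW H e3 refl Y')) ⟩
        subst₂ (HomOf H) e1 e2 (seqOf H X Yc)
          ≡⟨ cong (λ z → subst₂ (HomOf H) e1 e2 (seqOf H z Yc)) Xeq ⟩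
        subst₂ (HomOf H) e1 e2 (seqOf H (act H Xd []) Yc)
          ≡⟨ cong (λ z → subst₂ (HomOf H) e1 e2 (seqOf H (act H Xd []) z)) Yeq ⟩
        subst₂ (HomOf H) e1 e2 (seqOf H (act H Xd []) (act H Yd []))
          ≡⟨ subst₂-act-castW H e1 e2 _ ⟩
        act H (castW e1 e2) (seqOf H (act H Xd []) (act H Yd []) ∷ [])
          ≡⟨ cong (λ z → act H (castW e1 e2) (z ∷ [])) (sym (trans (cong (λ Z → act H Z (act H Yd [] ∷ [])) T1-def) (act-composite H [] [] ((Q , R) ∷ []) (seqW P Q R) Xd [] [] (act H Yd [] ∷ [])))) ⟩
        act H (castW e1 e2) (act H T1 (act H Yd [] ∷ []) ∷ [])
          ≡⟨ cong (λ z → act H (castW e1 e2) (z ∷ [])) (sym (trans (cong (λ Z → act H Z []) T2-def) (act-composite H [] [] [] T1 Yd [] [] []))) ⟩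
        act H (castW e1 e2) (act H T2 [] ∷ [])
          ≡⟨ sym (trans (cong (λ Z → act H Z []) T3-def) (act-composite H [] [] [] (castW e1 e2) T2 [] [] [])) ⟩
        act H T3 []
          ≡⟨ act-≗wiring H T3 (symW A (B ++ C)) hexagon-wiring [] ⟩
        σH A (B ++ C) ∎)
      where
        open ≡-Reasoning
        open HexagonDiagrams A B C
        open HexagonComposite Xd Yd xspec yspec
        X : HomOf H P Q
        X = paraOf H (σH A B) (idOf H C)
        Y' : HomOf H (B ++ (A ++ C)) R
        Y' = paraOf H (idOf H B) (σH A C)
        Y Yc : HomOf H Q R
        Y = subst (λ X → HomOf H X (B ++ (C ++ A))) e3 Y'
        Yc = act H (castW e3 refl) (Y' ∷ [])
        Xeq : X ≡ act H Xd []
        Xeq = trans (sym (act-composite H [] [] ((C , C) ∷ []) (paraW (A ++ B) (B ++ A) C C) (symW A B) [] [] (idOf H C ∷ [])))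
                    (sym (act-composite H [] [] [] Xa (unitW C) [] [] []))
        Yeq : Yc ≡ act H Yd []
        Yeq = trans (sym (act-composite H [] ((B , B) ∷ (A ++ C , C ++ A) ∷ []) [] (castW e3 refl) (paraW B B (A ++ C) (C ++ A)) [] (idOf H B ∷ σH A C ∷ []) []))
              (trans (sym (act-composite H [] [] ((A ++ C , C ++ A) ∷ []) Ya (unitW B) [] [] (σH A C ∷ [])))
                     (sym (act-composite H [] [] [] Yb (symW A C) [] [] [])))

  data SplitV {P : Box → Set} (xs ys : List Box) : All P (xs ++ ys) → Set where
    sv : (a : All P xs) (b : All P ys) → SplitV xs ys (++⁺ a b)

  splitV : ∀ {P : Box → Set} xs ys (p : All P (xs ++ ys)) → SplitV xs ys p
  splitV []       ys p = sv [] p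
  splitV (x ∷ xs) ys (px ∷ p) with splitV xs ys p
  ... | sv a b = sv (px ∷ a) b

  map-++⁺ : ∀ {P Q : Box → Set} (g : ∀ {t} → P t → Q t) {xs ys} (a : All P xs) (b : All P ys) →
            All.map g (++⁺ a b) ≡ ++⁺ (All.map g a) (All.map g b)
  map-++⁺ g []       b = refl
  map-++⁺ g (x ∷ a) b = cong (g x ∷_) (map-++⁺ g a b)

  swapP-involutive : ∀ f pre a b post z → swapP f pre b a post (swapP f pre a b post z) ≡ z
  swapP-involutive f []        a b post (inj₁ p)        = refl
  swapP-involutive f []        a b post (inj₂ (inj₁ q)) = refl
  swapP-involutive f []        a b post (inj₂ (inj₂ r)) = refl
  swapP-involutive f (c ∷ pre) a b post (inj₁ p)        = refl
  swapP-involutive f (c ∷ pre) a b post (inj₂ r)        = cong inj₂ (swapP-involutive f pre a b post r)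

  swapP-ty : ∀ f pre a b post z → portsTy f (pre ++ b ∷ a ∷ post) (swapP f pre a b post z) ≡ portsTy f (pre ++ a ∷ b ∷ post) z
  swapP-ty f []        a b post (inj₁ p)        = refl
  swapP-ty f []        a b post (inj₂ (inj₁ q)) = refl
  swapP-ty f []        a b post (inj₂ (inj₂ r)) = refl
  swapP-ty f (c ∷ pre) a b post (inj₁ p)        = refl
  swapP-ty f (c ∷ pre) a b post (inj₂ r)        = swapP-ty f pre a b post r

  transposeBox : ∀ pre (a b : Box) post → Fin (length (pre ++ a ∷ b ∷ post)) → Fin (length (pre ++ b ∷ a ∷ post))
  transposeBox []        a b post zero          = suc zero
  transposeBox []        a b post (suc zero)    = zero
  transposeBox []        a b post (suc (suc i)) = suc (suc i)
  transposeBox (c ∷ pre) a b post zero          = zero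
  transposeBox (c ∷ pre) a b post (suc i)       = suc (transposeBox pre a b post i)

  transposeBox-involutive : ∀ pre a b post i → transposeBox pre b a post (transposeBox pre a b post i) ≡ i
  transposeBox-involutive []        a b post zero          = refl
  transposeBox-involutive []        a b post (suc zero)    = refl
  transposeBox-involutive []        a b post (suc (suc i)) = refl
  transposeBox-involutive (c ∷ pre) a b post zero          = refl
  transposeBox-involutive (c ∷ pre) a b post (suc i)       = cong suc (transposeBox-involutive pre a b post i)

  transposeBox-injective : ∀ pre a b post x y → transposeBox pre a b post x ≡ transposeBox pre a b post y → x ≡ y
  transposeBox-injective pre a b post x y e =
    trans (sym (transposeBox-involutive pre a b post x))
          (trans (cong (transposeBox pre b a post) e) (transposeBox-involutive pre a b post y))

  boxOf-swapP : ∀ f pre a b post z → boxOf f (pre ++ b ∷ a ∷ post) (swapP f pre a b post z) ≡ transposeBox pre a b post (boxOf f (pre ++ a ∷ b ∷ post) z)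
  boxOf-swapP f []        a b post (inj₁ p)        = refl
  boxOf-swapP f []        a b post (inj₂ (inj₁ q)) = refl
  boxOf-swapP f []        a b post (inj₂ (inj₂ r)) = refl
  boxOf-swapP f (c ∷ pre) a b post (inj₁ p)        = refl
  boxOf-swapP f (c ∷ pre) a b post (inj₂ r)        = cong suc (boxOf-swapP f pre a b post r)

  module SwapBoxes (pre : List Box) (a b : Box) (post : List Box) {v : Box} (Φ : WD (pre ++ a ∷ b ∷ post) v) where
    L L' : List Box
    L  = pre ++ a ∷ b ∷ post
    L' = pre ++ b ∷ a ∷ post

    sS : Src L v → Src L' v
    sS = Sum.map (λ y → y) (swapP proj₂ pre a b post)
    sS' : Src L' v → Src L v
    sS' = Sum.map (λ y → y) (swapP proj₂ pre b a post)
    sT : Tgt L v → Tgt L' v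
    sT = Sum.map (swapP proj₁ pre a b post) (λ y → y)
    sT' : Tgt L' v → Tgt L v
    sT' = Sum.map (swapP proj₁ pre b a post) (λ y → y)

    sS'sS : ∀ x → sS' (sS x) ≡ x
    sS'sS (inj₁ x) = refl
    sS'sS (inj₂ z) = cong inj₂ (swapP-involutive proj₂ pre a b post z)
    sSsS' : ∀ x → sS (sS' x) ≡ x
    sSsS' (inj₁ x) = refl
    sSsS' (inj₂ z) = cong inj₂ (swapP-involutive proj₂ pre b a post z)
    sT'sT : ∀ x → sT' (sT x) ≡ x
    sT'sT (inj₂ x) = refl
    sT'sT (inj₁ z) = cong inj₁ (swapP-involutive proj₁ pre a b post z)
    sTsT' : ∀ x → sT (sT' x) ≡ x
    sTsT' (inj₂ x) = refl
    sTsT' (inj₁ z) = cong inj₁ (swapP-involutive proj₁ pre b a post z)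

    fS : Src L' v → Tgt L' v
    fS y = sT (wiring Φ (sS' y))
    gS : Tgt L' v → Src L' v
    gS z = sS (wiring⁻¹ Φ (sT' z))

    gf : ∀ y → gS (fS y) ≡ y
    gf y = trans (cong (λ w → sS (wiring⁻¹ Φ w)) (sT'sT _)) (trans (cong sS (wiring⁻¹-wiring Φ _)) (sSsS' y))
    fg : ∀ z → fS (gS z) ≡ z
    fg z = trans (cong (λ w → sT (wiring Φ w)) (sS'sS _)) (trans (cong sT (wiring-wiring⁻¹ Φ _)) (sTsT' z))

    tyT : ∀ w → tgtTy L' v (sT w) ≡ tgtTy L v w
    tyT (inj₁ z) = swapP-ty proj₁ pre a b post z
    tyT (inj₂ z) = refl
    tyS : ∀ y → srcTy L v (sS' y) ≡ srcTy L' v y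
    tyS (inj₁ z) = refl
    tyS (inj₂ z) = swapP-ty proj₂ pre b a post z

    tyf : ∀ y → tgtTy L' v (fS y) ≡ srcTy L' v y
    tyf y = trans (tyT (wiring Φ (sS' y))) (trans (wiring-typed Φ (sS' y)) (tyS y))

    stepMap : ∀ {i j} → StepOf L' v (λ x → x) fS i j → Step Φ (transposeBox pre b a post i) (transposeBox pre b a post j)
    stepMap (x , p , q , refl , ef , refl , refl) with wiring Φ (inj₂ (swapP proj₂ pre b a post p)) in ew
    stepMap (x , p , q , refl , refl , refl , refl) | inj₁ q0 =
      wireStep Φ _ _ q0 refl ew (boxOf-swapP proj₂ pre b a post p)
        (trans (sym (transposeBox-involutive pre a b post _)) (cong (transposeBox pre b a post) (sym (boxOf-swapP proj₁ pre a b post q0))))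
    stepMap (x , p , q , refl , () , refl , refl) | inj₂ _

    pathMap : ∀ {i j} → TransClosure (StepOf L' v (λ x → x) fS) i j → TransClosure (Step Φ) (transposeBox pre b a post i) (transposeBox pre b a post j)
    pathMap ⟦ s ⟧ = ⟦ stepMap s ⟧
    pathMap (s ◂ r) = stepMap s ◂ pathMap r

    swapDiagram : WD L' v
    swapDiagram = fromWiring fS gS gf fg tyf (λ i c → progress Φ _ (pathMap c))

    swapDiagram-isSwapped : IsSwapped pre a b post Φ swapDiagram
    swapDiagram-isSwapped x = cong (λ w → sT (wiring Φ w)) (sS'sS x)

  module Naturality (H K : Algebra) (g : ∀ {t} → obj H t → obj K t) where
    Natural : ∀ {ts v} → WD ts v → Set
    Natural Φ = ∀ xs → g (act H Φ xs) ≡ act K Φ (All.map g xs)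

    natural-≗wiring : ∀ {ts v} (Φ Φ' : WD ts v) → (∀ x → wiring Φ x ≡ wiring Φ' x) → Natural Φ → Natural Φ'
    natural-≗wiring Φ Φ' e n xs = trans (cong g (sym (act-≗wiring H Φ Φ' e xs))) (trans (n xs) (act-≗wiring K Φ Φ' e _))

    natural-composite : ∀ pre ss post {t v} (Φ : WD (pre ++ t ∷ post) v) (Ψ : WD ss t) → Natural Φ → Natural Ψ →
             Natural (compose pre Φ Ψ)
    natural-composite pre ss post Φ Ψ nΦ nΨ xs with splitV pre (ss ++ post) xs
    ... | sv a bc with splitV ss post bc
    ...   | sv b c = begin
        g (act H _ (++⁺ a (++⁺ b c)))                 ≡⟨ cong g (act-composite H pre ss post Φ Ψ a b c) ⟩
        g (act H Φ (++⁺ a (act H Ψ b ∷ c)))           ≡⟨ nΦ _ ⟩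
        act K Φ (All.map g (++⁺ a (act H Ψ b ∷ c)))   ≡⟨ cong (act K Φ) (map-++⁺ g a (act H Ψ b ∷ c)) ⟩
        act K Φ (++⁺ (All.map g a) (g (act H Ψ b) ∷ All.map g c)) ≡⟨ cong (λ z → act K Φ (++⁺ (All.map g a) (z ∷ All.map g c))) (nΨ b) ⟩
        act K Φ (++⁺ (All.map g a) (act K Ψ (All.map g b) ∷ All.map g c)) ≡⟨ sym (act-composite K pre ss post Φ Ψ _ _ _) ⟩
        act K _ (++⁺ (All.map g a) (++⁺ (All.map g b) (All.map g c))) ≡⟨ cong (act K _) (sym (trans (map-++⁺ g a (++⁺ b c)) (cong (++⁺ (All.map g a)) (map-++⁺ g b c)))) ⟩
        act K _ (All.map g (++⁺ a (++⁺ b c))) ∎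
      where open ≡-Reasoning

    natural-swap : ∀ pre a b post {v} (Φ : WD (pre ++ a ∷ b ∷ post) v) (Φ' : WD (pre ++ b ∷ a ∷ post) v) →
             IsSwapped pre a b post Φ Φ' → Natural Φ → Natural Φ'
    natural-swap pre a b post Φ Φ' sw n xs with splitV pre (b ∷ a ∷ post) xs
    ... | sv p (y ∷ x ∷ zs) = begin
        g (act H Φ' (++⁺ p (y ∷ x ∷ zs)))    ≡⟨ cong g (act-swap H pre a b post Φ Φ' sw p x y zs) ⟩
        g (act H Φ (++⁺ p (x ∷ y ∷ zs)))     ≡⟨ n _ ⟩
        act K Φ (All.map g (++⁺ p (x ∷ y ∷ zs))) ≡⟨ cong (act K Φ) (map-++⁺ g p _) ⟩
        act K Φ (++⁺ (All.map g p) (g x ∷ g y ∷ All.map g zs)) ≡⟨ sym (act-swap K pre a b post Φ Φ' sw _ _ _ _) ⟩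
        act K Φ' (++⁺ (All.map g p) (g y ∷ g x ∷ All.map g zs)) ≡⟨ cong (act K Φ') (sym (map-++⁺ g p _)) ⟩
        act K Φ' (All.map g (++⁺ p (y ∷ x ∷ zs))) ∎
      where open ≡-Reasoning

    natural-unswap : ∀ pre a b post {v} (Φ : WD (pre ++ a ∷ b ∷ post) v) (Φ' : WD (pre ++ b ∷ a ∷ post) v) →
               IsSwapped pre a b post Φ Φ' → Natural Φ' → Natural Φ
    natural-unswap pre a b post Φ Φ' sw n xs with splitV pre (a ∷ b ∷ post) xs
    ... | sv p (x ∷ y ∷ zs) = begin
        g (act H Φ (++⁺ p (x ∷ y ∷ zs)))    ≡⟨ cong g (sym (act-swap H pre a b post Φ Φ' sw p x y zs)) ⟩
        g (act H Φ' (++⁺ p (y ∷ x ∷ zs)))     ≡⟨ n _ ⟩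
        act K Φ' (All.map g (++⁺ p (y ∷ x ∷ zs))) ≡⟨ cong (act K Φ') (map-++⁺ g p _) ⟩
        act K Φ' (++⁺ (All.map g p) (g y ∷ g x ∷ All.map g zs)) ≡⟨ act-swap K pre a b post Φ Φ' sw _ _ _ _ ⟩
        act K Φ (++⁺ (All.map g p) (g x ∷ g y ∷ All.map g zs)) ≡⟨ cong (act K Φ) (sym (map-++⁺ g p _)) ⟩
        act K Φ (All.map g (++⁺ p (x ∷ y ∷ zs))) ∎
      where open ≡-Reasoning

    natural-cast : ∀ {X Y v} (e : X ≡ Y) (Φ : WD X v) → Natural (subst (λ l → WD l v) e Φ) → Natural Φ
    natural-cast refl Φ n = n

  record MovesToFront (X1 : TSet) (x : τ) (X2 : TSet) (M : WD [] (X1 ++ x ∷ X2 , x ∷ X1 ++ X2)) : Set where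
    field
      moves-x : wiring M (inj₁ (inr X1 (x ∷ X2) zero)) ≡ inj₂ zero
      shifts-left : ∀ i → wiring M (inj₁ (inl X1 (x ∷ X2) i)) ≡ inj₂ (suc (inl X1 X2 i))
      shifts-right : ∀ j → wiring M (inj₁ (inr X1 (x ∷ X2) (suc j))) ≡ inj₂ (suc (inr X1 X2 j))

  module MoveToFrontStep (z : τ) (X1 : TSet) (x : τ) (X2 : TSet) (M : WD [] (X1 ++ x ∷ X2 , x ∷ X1 ++ X2)) where
    A' B' C : TSet
    A' = X1 ++ x ∷ X2
    B' = x ∷ X1 ++ X2
    C  = X1 ++ X2
    Pa : WD ((A' , B') ∷ []) (z ∷ A' , z ∷ B')
    Pa = compose [] (paraW (z ∷ []) (z ∷ []) A' B') (unitW (z ∷ []))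
    Pb : WD [] (z ∷ A' , z ∷ B')
    Pb = compose [] Pa M
    Sa : WD ((C , C) ∷ []) (z ∷ x ∷ C , x ∷ z ∷ C)
    Sa = compose [] (paraW (z ∷ x ∷ []) (x ∷ z ∷ []) C C) (symW (z ∷ []) (x ∷ []))
    Sb : WD [] (z ∷ x ∷ C , x ∷ z ∷ C)
    Sb = compose [] Sa (unitW C)
    T1 : WD ((z ∷ x ∷ C , x ∷ z ∷ C) ∷ []) (z ∷ A' , x ∷ z ∷ C)
    T1 = compose [] (seqW (z ∷ A') (z ∷ x ∷ C) (x ∷ z ∷ C)) Pb
    step : WD [] ((z ∷ X1) ++ x ∷ X2 , x ∷ (z ∷ X1) ++ X2)
    step = compose [] T1 Sb

    Pb-0 : wiring Pb (inj₁ zero) ≡ inj₂ zero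
    Pb-0 = CompositeWiring.composite-ii [] [] [] (A' , B') (z ∷ A' , z ∷ B') Pa M (inj₁ zero) (inj₂ zero) refl

    Pb-s : ∀ p q → wiring M (inj₁ p) ≡ inj₂ q → wiring Pb (inj₁ (suc p)) ≡ inj₂ (suc q)
    Pb-s p q e = CompositeWiring.composite-ii-chain [] [] [] (A' , B') (z ∷ A' , z ∷ B') Pa M (inj₁ (suc p)) p q (inj₂ (suc q)) refl e refl

    T1-in : ∀ a b → wiring Pb (inj₁ a) ≡ inj₂ b → wiring T1 (inj₁ a) ≡ inj₁ (inj₁ b)
    T1-in a b e = CompositeWiring.composite-ii-chain [] [] ((z ∷ x ∷ C , x ∷ z ∷ C) ∷ []) (z ∷ A' , z ∷ x ∷ C) (z ∷ A' , x ∷ z ∷ C)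
                    (seqW (z ∷ A') (z ∷ x ∷ C) (x ∷ z ∷ C)) Pb (inj₁ a) a b (inj₁ (inj₂ (inj₁ b))) refl e refl

    step-in : ∀ a b c → wiring Pb (inj₁ a) ≡ inj₂ b → wiring Sb (inj₁ b) ≡ inj₂ c → wiring step (inj₁ a) ≡ inj₂ c
    step-in a b c e e' = CompositeWiring.composite-ii-chain [] [] [] (z ∷ x ∷ C , x ∷ z ∷ C) (z ∷ A' , x ∷ z ∷ C) T1 Sb (inj₁ a) b c (inj₂ c) (T1-in a b e) e' refl

    stepSpec : MovesToFront X1 x X2 M → MovesToFront (z ∷ X1) x X2 step
    stepSpec s = record { moves-x = p0 ; shifts-left = p1 ; shifts-right = p2 }
      where
        open MovesToFront s
        p0 : wiring step (inj₁ (inr (z ∷ X1) (x ∷ X2) zero)) ≡ inj₂ zero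
        p0 = step-in (suc (inr X1 (x ∷ X2) zero)) (suc zero) zero (Pb-s (inr X1 (x ∷ X2) zero) zero moves-x) refl
        p1 : ∀ i → wiring step (inj₁ (inl (z ∷ X1) (x ∷ X2) i)) ≡ inj₂ (suc (inl (z ∷ X1) X2 i))
        p1 zero = step-in zero zero (suc zero) Pb-0 refl
        p1 (suc i) = step-in (suc (inl X1 (x ∷ X2) i)) (suc (suc (inl X1 X2 i))) (suc (suc (inl X1 X2 i))) (Pb-s (inl X1 (x ∷ X2) i) (suc (inl X1 X2 i)) (shifts-left i)) refl
        p2 : ∀ j → wiring step (inj₁ (inr (z ∷ X1) (x ∷ X2) (suc j))) ≡ inj₂ (suc (inr (z ∷ X1) X2 j))
        p2 j = step-in (suc (inr X1 (x ∷ X2) (suc j))) (suc (suc (inr X1 X2 j))) (suc (suc (inr X1 X2 j))) (Pb-s (inr X1 (x ∷ X2) (suc j)) (suc (inr X1 X2 j)) (shifts-right j)) refl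

  moveToFront : ∀ X1 x X2 → WD [] (X1 ++ x ∷ X2 , x ∷ X1 ++ X2)
  moveToFront []        x X2 = unitW (x ∷ X2)
  moveToFront (z ∷ X1) x X2 = MoveToFrontStep.step z X1 x X2 (moveToFront X1 x X2)

  moveToFront-moves : ∀ X1 x X2 → MovesToFront X1 x X2 (moveToFront X1 x X2)
  moveToFront-moves []        x X2 = record { moves-x = refl ; shifts-left = λ () ; shifts-right = λ j → refl }
  moveToFront-moves (z ∷ X1) x X2 = MoveToFrontStep.stepSpec z X1 x X2 (moveToFront X1 x X2) (moveToFront-moves X1 x X2)

  module GeneratorNaturality (H K : Algebra) (g : ∀ {t} → obj H t → obj K t)
    (g-id : ∀ A → g (idOf H A) ≡ idOf K A)
    (g-seq : ∀ {A B C} (f : HomOf H A B) (h : HomOf H B C) → g (seqOf H f h) ≡ seqOf K (g f) (g h))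
    (g-para : ∀ {A B A' B'} (f : HomOf H A B) (h : HomOf H A' B') → g (paraOf H f h) ≡ paraOf K (g f) (g h))
    (g-σ : ∀ A B → g (act H (symW A B) []) ≡ act K (symW A B) []) where

    open Naturality H K g public

    natural-unit : ∀ A → Natural (unitW A)
    natural-unit A [] = g-id A

    natural-seq : ∀ A B C → Natural (seqW A B C)
    natural-seq A B C (f ∷ h ∷ []) = g-seq f h

    natural-para : ∀ A B A' B' → Natural (paraW A B A' B')
    natural-para A B A' B' (f ∷ h ∷ []) = g-para f h

    natural-sym : ∀ A B → Natural (symW A B)
    natural-sym A B [] = g-σ A B

    natural-moveToFront : ∀ X1 x X2 → Natural (moveToFront X1 x X2)
    natural-moveToFront []        x X2 = natural-unit (x ∷ X2)
    natural-moveToFront (z ∷ X1) x X2 =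
      natural-composite [] [] [] T1 Sb
        (natural-composite [] [] _ (seqW _ _ _) Pb (natural-seq _ _ _)
          (natural-composite [] [] [] Pa (moveToFront X1 x X2) (natural-composite [] [] _ (paraW _ _ _ _) (unitW _) (natural-para _ _ _ _) (natural-unit _)) (natural-moveToFront X1 x X2)))
        (natural-composite [] [] [] Sa (unitW _) (natural-composite [] [] _ (paraW _ _ _ _) (symW _ _) (natural-para _ _ _ _) (natural-sym _ _)) (natural-unit _))
      where open MoveToFrontStep z X1 x X2 (moveToFront X1 x X2)

  srcPort : ∀ {X Y} → Src [] (X , Y) → Port X
  srcPort (inj₁ p) = p

  srcPort-inj₁ : ∀ {X Y} (s : Src [] (X , Y)) → inj₁ (srcPort {X} {Y} s) ≡ s
  srcPort-inj₁ (inj₁ p) = refl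

  -- If the first output of Π is fed by the port at position |X1|, then Π is
  -- moveToFront X1 x X2 ⨾ (id_x ⊗ Π'), where Π' is Π with that wire removed (S2-eq).
  module DropFirstWire (X1 : TSet) (x : τ) (X2 Y' : TSet) (Π : WD [] (X1 ++ x ∷ X2 , x ∷ Y'))
             (h0 : wiring Π (inj₁ (inr X1 (x ∷ X2) zero)) ≡ inj₂ zero) where
    X : TSet
    X = X1 ++ x ∷ X2
    pos : Port X
    pos = inr X1 (x ∷ X2) zero

    sP : Src [] (X , x ∷ Y') → Port X
    sP = srcPort {X} {x ∷ Y'}
    sPe : ∀ s → inj₁ (sP s) ≡ s
    sPe = srcPort-inj₁ {X} {x ∷ Y'}

    toX : Port (X1 ++ X2) → Port X
    toX c = [ inl X1 (x ∷ X2) , (λ j → inr X1 (x ∷ X2) (suc j)) ] (split X1 X2 c)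

    toX-l : ∀ i → toX (inl X1 X2 i) ≡ inl X1 (x ∷ X2) i
    toX-l i = cong [ inl X1 (x ∷ X2) , (λ j → inr X1 (x ∷ X2) (suc j)) ] (split-join X1 X2 (inj₁ i))

    toX-r : ∀ j → toX (inr X1 X2 j) ≡ inr X1 (x ∷ X2) (suc j)
    toX-r j = cong [ inl X1 (x ∷ X2) , (λ j → inr X1 (x ∷ X2) (suc j)) ] (split-join X1 X2 (inj₂ j))

    toX-ne : ∀ c → toX c ≡ pos → ⊥
    toX-ne c e with split X1 X2 c
    ... | inj₁ i with trans (sym (split-join X1 (x ∷ X2) (inj₁ i))) (cong (split X1 (x ∷ X2)) e)
    ...   | ee rewrite split-join X1 (x ∷ X2) (inj₂ zero) with ee
    ...     | ()
    toX-ne c e | inj₂ j with trans (sym (split-join X1 (x ∷ X2) (inj₂ (suc j)))) (cong (split X1 (x ∷ X2)) e)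
    ...   | ee rewrite split-join X1 (x ∷ X2) (inj₂ zero) with ee
    ...     | ()

    wne : ∀ c → wiring Π (inj₁ (toX c)) ≡ inj₂ zero → ⊥
    wne c e = toX-ne c (inj₁-injective (trans (sym (wiring⁻¹-wiring Π _)) (trans (cong (wiring⁻¹ Π) (trans e (sym h0))) (wiring⁻¹-wiring Π _))))

    predY : (w : Tgt [] (X , x ∷ Y')) → (w ≡ inj₂ zero → ⊥) → Port Y'
    predY (inj₂ zero) ne = ⊥-elim (ne refl)
    predY (inj₂ (suc o)) _ = o

    predY-eq : ∀ (w : Tgt [] (X , x ∷ Y')) ne → _≡_ {A = Tgt [] (X , x ∷ Y')} (inj₂ (suc (predY w ne))) w
    predY-eq (inj₂ zero) ne = ⊥-elim (ne refl)
    predY-eq (inj₂ (suc o)) _ = refl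

    predY-irr : ∀ {w w'} ne ne' → w ≡ w' → predY w ne ≡ predY w' ne'
    predY-irr {inj₂ zero} ne ne' refl = ⊥-elim (ne refl)
    predY-irr {inj₂ (suc o)} ne ne' refl = refl

    fx : (s : Port X1 ⊎ Port (x ∷ X2)) → (s ≡ inj₂ zero → ⊥) → Port (X1 ++ X2)
    fx (inj₁ i) _ = inl X1 X2 i
    fx (inj₂ zero) ne = ⊥-elim (ne refl)
    fx (inj₂ (suc j)) _ = inr X1 X2 j

    fx-irr : ∀ {s s'} ne ne' → s ≡ s' → fx s ne ≡ fx s' ne'
    fx-irr {inj₁ i} ne ne' refl = refl
    fx-irr {inj₂ zero} ne ne' refl = ⊥-elim (ne refl)
    fx-irr {inj₂ (suc j)} ne ne' refl = refl

    fromX : (p : Port X) → (p ≡ pos → ⊥) → Port (X1 ++ X2)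
    fromX p ne = fx (split X1 (x ∷ X2) p) (λ e → ne (trans (sym (join-split X1 (x ∷ X2) p)) (cong (join X1 (x ∷ X2)) e)))

    fromX-irr : ∀ {p p'} ne ne' → p ≡ p' → fromX p ne ≡ fromX p' ne'
    fromX-irr {p} ne ne' refl = fx-irr {split X1 (x ∷ X2) p} {split X1 (x ∷ X2) p} _ _ refl

    toX-fx : ∀ s ne → toX (fx s ne) ≡ join X1 (x ∷ X2) s
    toX-fx (inj₁ i) _ = toX-l i
    toX-fx (inj₂ zero) ne = ⊥-elim (ne refl)
    toX-fx (inj₂ (suc j)) _ = toX-r j

    toX-fromX : ∀ p ne → toX (fromX p ne) ≡ p
    toX-fromX p ne = trans (toX-fx (split X1 (x ∷ X2) p) _) (join-split X1 (x ∷ X2) p)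

    fromX-toX : ∀ c ne → fromX (toX c) ne ≡ c
    fromX-toX c ne with split X1 X2 c | join-split X1 X2 c
    ... | inj₁ i | refl = trans (fx-irr _ (λ ()) (split-join X1 (x ∷ X2) (inj₁ i))) refl
    ... | inj₂ j | refl = trans (fx-irr _ (λ ()) (split-join X1 (x ∷ X2) (inj₂ (suc j)))) refl

    vne : ∀ o → sP (wiring⁻¹ Π (inj₂ (suc o))) ≡ pos → ⊥
    vne o e = abs0 (trans (sym h0) (trans (cong (λ p → wiring Π (inj₁ p)) (sym e))
                    (trans (cong (wiring Π) (sPe (wiring⁻¹ Π (inj₂ (suc o))))) (wiring-wiring⁻¹ Π _))))
      where
        abs0 : ∀ {A : Set} {o : Port Y'} → (inj₂ {A = A} (zero {n = length Y'}) ≡ inj₂ (suc o)) → ⊥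
        abs0 ()

    ty-toX : ∀ c → ty X (toX c) ≡ ty (X1 ++ X2) c
    ty-toX c with split X1 X2 c | join-split X1 X2 c
    ... | inj₁ i | refl = trans (join-ty X1 (x ∷ X2) (inj₁ i)) (sym (join-ty X1 X2 (inj₁ i)))
    ... | inj₂ j | refl = trans (join-ty X1 (x ∷ X2) (inj₂ (suc j))) (sym (join-ty X1 X2 (inj₂ j)))

    wiring' : Src [] (X1 ++ X2 , Y') → Tgt [] (X1 ++ X2 , Y')
    wiring' (inj₁ c) = inj₂ (predY (wiring Π (inj₁ (toX c))) (wne c))

    wiring'⁻¹ : Tgt [] (X1 ++ X2 , Y') → Src [] (X1 ++ X2 , Y')
    wiring'⁻¹ (inj₂ o) = inj₁ (fromX (sP (wiring⁻¹ Π (inj₂ (suc o)))) (vne o))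

    wiring'⁻¹-wiring' : ∀ z → wiring'⁻¹ (wiring' z) ≡ z
    wiring'⁻¹-wiring' (inj₁ c) = cong inj₁ (trans (fromX-irr (vne (predY (wiring Π (inj₁ (toX c))) (wne c))) (toX-ne c)
        (inj₁-injective (trans (sPe _) (trans (cong (wiring⁻¹ Π) (predY-eq _ (wne c))) (wiring⁻¹-wiring Π _)))))
        (fromX-toX c (toX-ne c)))

    wiring'-wiring'⁻¹ : ∀ z → wiring' (wiring'⁻¹ z) ≡ z
    wiring'-wiring'⁻¹ (inj₂ o) = cong inj₂ (predY-irr (wne (fromX (sP (wiring⁻¹ Π (inj₂ (suc o)))) (vne o))) (λ ()) (trans (cong (λ p → wiring Π (inj₁ p)) (toX-fromX _ (vne o)))
                    (trans (cong (wiring Π) (sPe _)) (wiring-wiring⁻¹ Π (inj₂ (suc o))))))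

    wiring'-typed : ∀ z → tgtTy [] (X1 ++ X2 , Y') (wiring' z) ≡ srcTy [] (X1 ++ X2 , Y') z
    wiring'-typed (inj₁ c) = trans (cong (tgtTy [] (X , x ∷ Y')) (predY-eq _ (wne c))) (trans (wiring-typed Π (inj₁ (toX c))) (ty-toX c))

    Π' : WD [] (X1 ++ X2 , Y')
    Π' = fromWiring wiring' wiring'⁻¹ wiring'⁻¹-wiring' wiring'-wiring'⁻¹ wiring'-typed (λ ())

    C : TSet
    C = X1 ++ X2
    Q1 : WD ((C , Y') ∷ []) (x ∷ C , x ∷ Y')
    Q1 = compose [] (paraW (x ∷ []) (x ∷ []) C Y') (unitW (x ∷ []))
    Q2 : WD [] (x ∷ C , x ∷ Y')
    Q2 = compose [] Q1 Π'
    S1 : WD ((x ∷ C , x ∷ Y') ∷ []) (X , x ∷ Y')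
    S1 = compose [] (seqW X (x ∷ C) (x ∷ Y')) (moveToFront X1 x X2)
    S2 : WD [] (X , x ∷ Y')
    S2 = compose [] S1 Q2

    Q2-0 : wiring Q2 (inj₁ zero) ≡ inj₂ zero
    Q2-0 = CompositeWiring.composite-ii [] [] [] (C , Y') (x ∷ C , x ∷ Y') Q1 Π' (inj₁ zero) (inj₂ zero) refl

    Q2-s : ∀ c → wiring Q2 (inj₁ (suc c)) ≡ inj₂ (suc (predY (wiring Π (inj₁ (toX c))) (wne c)))
    Q2-s c = CompositeWiring.composite-ii-chain [] [] [] (C , Y') (x ∷ C , x ∷ Y') Q1 Π' (inj₁ (suc c)) c _ (inj₂ (suc (predY (wiring Π (inj₁ (toX c))) (wne c)))) refl refl refl

    S2-in : ∀ p b w → wiring (moveToFront X1 x X2) (inj₁ p) ≡ inj₂ b → wiring Q2 (inj₁ b) ≡ inj₂ w → wiring S2 (inj₁ p) ≡ inj₂ w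
    S2-in p b w e e' = CompositeWiring.composite-ii-chain [] [] [] (x ∷ C , x ∷ Y') (X , x ∷ Y') S1 Q2 (inj₁ p) b w (inj₂ w)
       (CompositeWiring.composite-ii-chain [] [] ((x ∷ C , x ∷ Y') ∷ []) (X , x ∷ C) (X , x ∷ Y') (seqW X (x ∷ C) (x ∷ Y')) (moveToFront X1 x X2) (inj₁ p) p b (inj₁ (inj₂ (inj₁ b))) refl e refl)
       e' refl

    S2-h : ∀ s → wiring S2 (inj₁ (join X1 (x ∷ X2) s)) ≡ wiring Π (inj₁ (join X1 (x ∷ X2) s))
    S2-h (inj₁ i) = trans (S2-in (inl X1 (x ∷ X2) i) (suc (inl X1 X2 i)) _ (MovesToFront.shifts-left (moveToFront-moves X1 x X2) i) (Q2-s (inl X1 X2 i)))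
                            (trans (predY-eq _ (wne (inl X1 X2 i))) (cong (λ q → wiring Π (inj₁ q)) (toX-l i)))
    S2-h (inj₂ zero) = trans (S2-in (inr X1 (x ∷ X2) zero) zero zero (MovesToFront.moves-x (moveToFront-moves X1 x X2)) Q2-0) (sym h0)
    S2-h (inj₂ (suc j)) = trans (S2-in (inr X1 (x ∷ X2) (suc j)) (suc (inr X1 X2 j)) _ (MovesToFront.shifts-right (moveToFront-moves X1 x X2) j) (Q2-s (inr X1 X2 j)))
                            (trans (predY-eq _ (wne (inr X1 X2 j))) (cong (λ q → wiring Π (inj₁ q)) (toX-r j)))

    S2-eq : ∀ z → wiring S2 z ≡ wiring Π z
    S2-eq (inj₁ p) = subst (λ p → wiring S2 (inj₁ p) ≡ wiring Π (inj₁ p)) (join-split X1 (x ∷ X2) p) (S2-h (split X1 (x ∷ X2) p))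

  splitAtPort : ∀ X (k : Port X) → Σ TSet λ X1 → Σ τ λ x → Σ TSet λ X2 →
         Σ (X1 ++ x ∷ X2 ≡ X) λ e → subst Port e (inr X1 (x ∷ X2) zero) ≡ k
  splitAtPort (z ∷ X) zero = [] , z , X , refl , refl
  splitAtPort (z ∷ X) (suc k) with splitAtPort X k
  ... | X1 , x , X2 , e , ek = z ∷ X1 , x , X2 , cong (z ∷_) e , trans (subst-suc z e _) (cong suc ek)

  wiring-substˡ : ∀ {X0 X Y} (e : X0 ≡ X) (Π : WD [] (X , Y)) k0 →
            wiring (subst (λ Z → WD [] (Z , Y)) (sym e) Π) (inj₁ k0) ≡ wiring Π (inj₁ (subst Port e k0))
  wiring-substˡ refl Π k0 = refl

  wiring-substʳ : ∀ {X Y' y x} (e : y ≡ x) (Π : WD [] (X , y ∷ Y')) z →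
            wiring (subst (λ w → WD [] (X , w ∷ Y')) e Π) z ≡ wiring Π z
  wiring-substʳ refl Π z = refl

  module PermutationNaturality (H K : Algebra) (g : ∀ {t} → obj H t → obj K t)
    (g-id : ∀ A → g (idOf H A) ≡ idOf K A)
    (g-seq : ∀ {A B C} (f : HomOf H A B) (h : HomOf H B C) → g (seqOf H f h) ≡ seqOf K (g f) (g h))
    (g-para : ∀ {A B A' B'} (f : HomOf H A B) (h : HomOf H A' B') → g (paraOf H f h) ≡ paraOf K (g f) (g h))
    (g-σ : ∀ A B → g (act H (symW A B) []) ≡ act K (symW A B) []) where

    open GeneratorNaturality H K g g-id g-seq g-para g-σ

    castX : ∀ {X0 X Y} (e : X0 ≡ X) (Π : WD [] (X , Y)) → Natural (subst (λ Z → WD [] (Z , Y)) (sym e) Π) → Natural Π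
    castX refl Π n = n

    castY : ∀ {X Y' y x} (e : y ≡ x) (Π : WD [] (X , y ∷ Y')) → Natural (subst (λ w → WD [] (X , w ∷ Y')) e Π) → Natural Π
    castY refl Π n = n

    natural-dropFirstWire : ∀ X1 x X2 Y' (Π : WD [] (X1 ++ x ∷ X2 , x ∷ Y')) → wiring Π (inj₁ (inr X1 (x ∷ X2) zero)) ≡ inj₂ zero →
           (∀ (Π' : WD [] (X1 ++ X2 , Y')) → Natural Π') → Natural Π
    natural-dropFirstWire X1 x X2 Y' Π h IH =
      natural-≗wiring S2 Π S2-eq
        (natural-composite [] [] [] S1 Q2
          (natural-composite [] [] _ (seqW _ _ _) (moveToFront X1 x X2) (natural-seq _ _ _) (natural-moveToFront X1 x X2))
          (natural-composite [] [] [] Q1 Π' (natural-composite [] [] _ (paraW _ _ _ _) (unitW _) (natural-para _ _ _ _) (natural-unit _)) (IH Π')))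
      where open DropFirstWire X1 x X2 Y' Π h

    natural-permutation-length : ∀ (n : ℕ) (X Y : TSet) (Π : WD [] (X , Y)) → length X ≡ n → Natural Π
    natural-permutation-length n [] [] Π e = natural-≗wiring (unitW []) Π (λ { (inj₁ ()) ; (inj₂ ()) }) (natural-unit [])
    natural-permutation-length n (x ∷ X) [] Π e with wiring Π (inj₁ zero)
    ... | inj₁ ()
    ... | inj₂ ()
    natural-permutation-length n [] (y ∷ Y') Π e with wiring⁻¹ Π (inj₂ zero)
    ... | inj₁ ()
    ... | inj₂ ()
    natural-permutation-length zero (z ∷ X) (y ∷ Y') Π ()
    natural-permutation-length (suc n) (z ∷ X) (y ∷ Y') Π e with splitAtPort (z ∷ X) (srcPort {z ∷ X} {y ∷ Y'} (wiring⁻¹ Π (inj₂ zero)))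
    ... | X1 , x , X2 , eX , ek = castX eX Π (castY yx Π0 (natural-dropFirstWire X1 x X2 Y' Π1 h1 IH))
      where
        Π0 : WD [] (X1 ++ x ∷ X2 , y ∷ Y')
        Π0 = subst (λ Z → WD [] (Z , y ∷ Y')) (sym eX) Π
        h : wiring Π0 (inj₁ (inr X1 (x ∷ X2) zero)) ≡ inj₂ zero
        h = trans (wiring-substˡ eX Π _) (trans (cong (λ k → wiring Π (inj₁ k)) ek)
              (trans (cong (wiring Π) (srcPort-inj₁ {z ∷ X} {y ∷ Y'} (wiring⁻¹ Π (inj₂ zero)))) (wiring-wiring⁻¹ Π (inj₂ zero))))
        yx : y ≡ x
        yx = trans (sym (cong (tgtTy [] (X1 ++ x ∷ X2 , y ∷ Y')) h)) (trans (wiring-typed Π0 _) (join-ty X1 (x ∷ X2) (inj₂ zero)))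
        Π1 : WD [] (X1 ++ x ∷ X2 , x ∷ Y')
        Π1 = subst (λ w → WD [] (X1 ++ x ∷ X2 , w ∷ Y')) yx Π0
        h1 : wiring Π1 (inj₁ (inr X1 (x ∷ X2) zero)) ≡ inj₂ zero
        h1 = trans (wiring-substʳ yx Π0 _) h
        len : length (X1 ++ X2) ≡ n
        len = ℕP.suc-injective (trans (sym (length-++-∷ X1 x X2)) (trans (cong length eX) e))
        IH : ∀ (Π' : WD [] (X1 ++ X2 , Y')) → Natural Π'
        IH Π' = natural-permutation-length n (X1 ++ X2) Y' Π' len

    natural-permutation : ∀ X Y (Π : WD [] (X , Y)) → Natural Π
    natural-permutation X Y Π = natural-permutation-length (length X) X Y Π refl

  discard : (X : TSet) → (Port X → Bool) → TSet
  discard []      b = []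
  discard (x ∷ X) b with b zero
  ... | true  = discard X (λ i → b (suc i))
  ... | false = x ∷ discard X (λ i → b (suc i))

  discard-emb : ∀ X b → Port (discard X b) → Port X
  discard-emb (x ∷ X) b r with b zero
  ... | true = suc (discard-emb X (λ i → b (suc i)) r)
  discard-emb (x ∷ X) b zero    | false = zero
  discard-emb (x ∷ X) b (suc r) | false = suc (discard-emb X (λ i → b (suc i)) r)

  discard-emb-false : ∀ (X : TSet) (b : Port X → Bool) r → b (discard-emb X b r) ≡ false
  discard-emb-false (x ∷ X) b r with b zero in e
  ... | true = discard-emb-false X (λ i → b (suc i)) r
  discard-emb-false (x ∷ X) b zero    | false = e
  discard-emb-false (x ∷ X) b (suc r) | false = discard-emb-false X (λ i → b (suc i)) r

  discard-index : ∀ X b (a : Port X) → b a ≡ false → Port (discard X b)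
  discard-index (x ∷ X) b zero e with b zero
  discard-index (x ∷ X) b zero () | true
  ... | false = zero
  discard-index (x ∷ X) b (suc a) e with b zero
  ... | true = discard-index X (λ i → b (suc i)) a e
  ... | false = suc (discard-index X (λ i → b (suc i)) a e)

  discard-emb-index : ∀ X b a e → discard-emb X b (discard-index X b a e) ≡ a
  discard-emb-index (x ∷ X) b zero e with b zero
  discard-emb-index (x ∷ X) b zero () | true
  ... | false = refl
  discard-emb-index (x ∷ X) b (suc a) e with b zero
  ... | true = cong suc (discard-emb-index X (λ i → b (suc i)) a e)
  ... | false = cong suc (discard-emb-index X (λ i → b (suc i)) a e)

  discard-emb-injective : ∀ X b {r r'} → discard-emb X b r ≡ discard-emb X b r' → r ≡ r'
  discard-emb-injective (x ∷ X) b {r} {r'} e with b zero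
  ... | true = discard-emb-injective X (λ i → b (suc i)) (suc-injective e)
  discard-emb-injective (x ∷ X) b {zero} {zero} e | false = refl
  discard-emb-injective (x ∷ X) b {zero} {suc r'} () | false
  discard-emb-injective (x ∷ X) b {suc r} {zero} () | false
  discard-emb-injective (x ∷ X) b {suc r} {suc r'} e | false = cong suc (discard-emb-injective X (λ i → b (suc i)) (suc-injective e))

  discard-index-emb : ∀ X b r e → discard-index X b (discard-emb X b r) e ≡ r
  discard-index-emb X b r e = discard-emb-injective X b (discard-emb-index X b (discard-emb X b r) e)

  ty-discard-emb : ∀ X b r → ty X (discard-emb X b r) ≡ ty (discard X b) r
  ty-discard-emb (x ∷ X) b r with b zero
  ... | true = ty-discard-emb X (λ i → b (suc i)) r
  ty-discard-emb (x ∷ X) b zero | false = refl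
  ty-discard-emb (x ∷ X) b (suc r) | false = ty-discard-emb X (λ i → b (suc i)) r

  discard-index-irrelevant : ∀ X b {a a'} (ea : b a ≡ false) (ea' : b a' ≡ false) → a ≡ a' → discard-index X b a ea ≡ discard-index X b a' ea'
  discard-index-irrelevant X b ea ea' refl = cong (discard-index X b _) (Decidable⇒UIP.≡-irrelevant Bool._≟_ ea ea')

  entersBox : ∀ ts v (k : Fin (length ts)) → Tgt ts v → Bool
  entersBox ts v k (inj₁ q) = does (boxOf proj₁ ts q ≟ k)
  entersBox ts v k (inj₂ _) = false

  Minimal : ∀ {ts v} → WD ts v → Fin (length ts) → Set
  Minimal {ts} {v} Φ k = ∀ p → entersBox ts v k (wiring Φ (inj₂ p)) ≡ false

  -- Φ is Φ'' plugged into D = (P ⨾ (t ⊗ id_R)) ⨾ □ (Φc-eq).  As t is minimal, all its inputs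
  -- are fed by outer inputs; the permutation P sends those to t and the remaining outer inputs
  -- R on to Φ'', which is Φ restricted to the other boxes.
  module PeelMinimalBox (rest : List Box) (t v : Box) (Φ : WD (rest ++ t ∷ []) v) (mn : Minimal Φ (boxR rest (t ∷ []) zero)) where
    L : List Box
    L = rest ++ t ∷ []
    kt : Fin (length L)
    kt = boxR rest (t ∷ []) zero
    T₋ T₊ V₋ V₊ : TSet
    T₋ = proj₁ t
    T₊ = proj₂ t
    V₋ = proj₁ v
    V₊ = proj₂ v

    tin : Port T₋ → InP L
    tin q = pR proj₁ rest (t ∷ []) (inj₁ q)
    tout : Port T₊ → OutP L
    tout q = pR proj₂ rest (t ∷ []) (inj₁ q)
    rin : InP rest → InP L
    rin s = pL proj₁ rest (t ∷ []) s
    rout : OutP rest → OutP L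
    rout r = pL proj₂ rest (t ∷ []) r

    TVh : Ports proj₁ rest ⊎ Ports proj₁ (t ∷ []) → Port T₋ ⊎ (InP rest ⊎ Port V₊)
    TVh (inj₁ s) = inj₂ (inj₁ s)
    TVh (inj₂ (inj₁ q)) = inj₁ q

    TV : Tgt L v → Port T₋ ⊎ (InP rest ⊎ Port V₊)
    TV (inj₁ z) = TVh (splitPorts proj₁ rest (t ∷ []) z)
    TV (inj₂ b) = inj₂ (inj₂ b)

    TVinv : Port T₋ ⊎ (InP rest ⊎ Port V₊) → Tgt L v
    TVinv (inj₁ q) = inj₁ (tin q)
    TVinv (inj₂ (inj₁ s)) = inj₁ (rin s)
    TVinv (inj₂ (inj₂ b)) = inj₂ b

    TV-inv : ∀ y → TVinv (TV y) ≡ y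
    TV-inv (inj₂ b) = refl
    TV-inv (inj₁ z) with splitPorts proj₁ rest (t ∷ []) z | joinPorts-splitPorts proj₁ rest (t ∷ []) z
    ... | inj₁ s | e = cong inj₁ e
    ... | inj₂ (inj₁ q) | e = cong inj₁ e

    TV-TVinv : ∀ z → TV (TVinv z) ≡ z
    TV-TVinv (inj₁ q) rewrite splitPorts-pR proj₁ rest (t ∷ []) (inj₁ q) = refl
    TV-TVinv (inj₂ (inj₁ s)) rewrite splitPorts-pL proj₁ rest (t ∷ []) s = refl
    TV-TVinv (inj₂ (inj₂ b)) = refl

    SVh : Ports proj₂ rest ⊎ Ports proj₂ (t ∷ []) → Port V₋ ⊎ (Port T₊ ⊎ OutP rest)
    SVh (inj₁ r) = inj₂ (inj₂ r)
    SVh (inj₂ (inj₁ q)) = inj₂ (inj₁ q)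

    SV : Src L v → Port V₋ ⊎ (Port T₊ ⊎ OutP rest)
    SV (inj₁ a) = inj₁ a
    SV (inj₂ z) = SVh (splitPorts proj₂ rest (t ∷ []) z)

    SVinv : Port V₋ ⊎ (Port T₊ ⊎ OutP rest) → Src L v
    SVinv (inj₁ a) = inj₁ a
    SVinv (inj₂ (inj₁ q)) = inj₂ (tout q)
    SVinv (inj₂ (inj₂ r)) = inj₂ (rout r)

    SV-inv : ∀ x → SVinv (SV x) ≡ x
    SV-inv (inj₁ a) = refl
    SV-inv (inj₂ z) with splitPorts proj₂ rest (t ∷ []) z | joinPorts-splitPorts proj₂ rest (t ∷ []) z
    ... | inj₁ r | e = cong inj₂ e
    ... | inj₂ (inj₁ q) | e = cong inj₂ e

    SV-SVinv : ∀ s → SV (SVinv s) ≡ s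
    SV-SVinv (inj₁ a) = refl
    SV-SVinv (inj₂ (inj₁ q)) rewrite splitPorts-pR proj₂ rest (t ∷ []) (inj₁ q) = refl
    SV-SVinv (inj₂ (inj₂ r)) rewrite splitPorts-pL proj₂ rest (t ∷ []) r = refl

    boxOf-tin : ∀ q → boxOf proj₁ L (tin q) ≡ kt
    boxOf-tin q = boxOf-pR proj₁ rest (t ∷ []) (inj₁ q)
    boxOf-tout : ∀ q → boxOf proj₂ L (tout q) ≡ kt
    boxOf-tout q = boxOf-pR proj₂ rest (t ∷ []) (inj₁ q)

    tout-not-into-t : ∀ q → isInj₁ (TV (wiring Φ (inj₂ (tout q)))) ≡ false
    tout-not-into-t q with TV (wiring Φ (inj₂ (tout q))) in e
    ... | inj₂ _ = refl
    ... | inj₁ q' = ⊥-elim (progress Φ kt ⟦ wireStep Φ (inj₂ (tout q)) (tout q) (tin q')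
            refl (trans (sym (TV-inv _)) (cong TVinv e)) (boxOf-tout q) (boxOf-tin q') ⟧)

    rout-not-into-t : ∀ r → isInj₁ (TV (wiring Φ (inj₂ (rout r)))) ≡ false
    rout-not-into-t r with TV (wiring Φ (inj₂ (rout r))) in e
    ... | inj₂ _ = refl
    ... | inj₁ q' = ⊥-elim (true≢false (trans (sym (trans (cong (entersBox L v kt) (trans (sym (TV-inv (wiring Φ (inj₂ (rout r))))) (cong TVinv e)))
                       (trans (cong (λ k → does (k ≟ kt)) (boxOf-tin q')) (dec-true (kt ≟ kt) refl)))) (mn (rout r))))

    isT : Port V₋ → Bool
    isT a = isInj₁ (TV (wiring Φ (inj₁ a)))

    R : TSet
    R = discard V₋ isT
    M : TSet
    M = T₊ ++ R

    srcTh : ∀ q (s : Port V₋ ⊎ (Port T₊ ⊎ OutP rest)) → SVinv s ≡ wiring⁻¹ Φ (inj₁ (tin q)) → Port V₋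
    srcTh q (inj₁ a) e = a
    srcTh q (inj₂ (inj₁ q')) e = ⊥-elim (true≢false (trans (sym (trans (cong (λ y → isInj₁ (TV y))
            (trans (cong (wiring Φ) e) (wiring-wiring⁻¹ Φ _))) (cong isInj₁ (TV-TVinv (inj₁ q))))) (tout-not-into-t q')))
    srcTh q (inj₂ (inj₂ r)) e = ⊥-elim (true≢false (trans (sym (trans (cong (λ y → isInj₁ (TV y))
            (trans (cong (wiring Φ) e) (wiring-wiring⁻¹ Φ _))) (cong isInj₁ (TV-TVinv (inj₁ q))))) (rout-not-into-t r)))

    srcT : Port T₋ → Port V₋
    srcT q = srcTh q (SV (wiring⁻¹ Φ (inj₁ (tin q)))) (SV-inv _)

    srcT-spec : ∀ q → wiring Φ (inj₁ (srcT q)) ≡ inj₁ (tin q)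
    srcT-spec q = trans (cong (wiring Φ) (h (SV (wiring⁻¹ Φ (inj₁ (tin q)))) (SV-inv _))) (wiring-wiring⁻¹ Φ _)
      where
        h : ∀ s e → inj₁ (srcTh q s e) ≡ wiring⁻¹ Φ (inj₁ (tin q))
        h (inj₁ a) e = e
        h (inj₂ (inj₁ q')) e = ⊥-elim (true≢false (trans (sym (trans (cong (λ y → isInj₁ (TV y))
            (trans (cong (wiring Φ) e) (wiring-wiring⁻¹ Φ _))) (cong isInj₁ (TV-TVinv (inj₁ q))))) (tout-not-into-t q')))
        h (inj₂ (inj₂ r)) e = ⊥-elim (true≢false (trans (sym (trans (cong (λ y → isInj₁ (TV y))
            (trans (cong (wiring Φ) e) (wiring-wiring⁻¹ Φ _))) (cong isInj₁ (TV-TVinv (inj₁ q))))) (rout-not-into-t r)))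

    θh : ∀ a (z : Port T₋ ⊎ (InP rest ⊎ Port V₊)) → TV (wiring Φ (inj₁ a)) ≡ z → Port T₋ ⊎ Port R
    θh a (inj₁ q) e = inj₁ q
    θh a (inj₂ y) e = inj₂ (discard-index V₋ isT a (cong isInj₁ e))

    θ : Port V₋ → Port T₋ ⊎ Port R
    θ a = θh a (TV (wiring Φ (inj₁ a))) refl

    θ⁻ : Port T₋ ⊎ Port R → Port V₋
    θ⁻ = [ srcT , discard-emb V₋ isT ]

    winj : ∀ {a a'} → wiring Φ (inj₁ a) ≡ wiring Φ (inj₁ a') → a ≡ a'
    winj {a} {a'} e = inj₁-injective (trans (sym (wiring⁻¹-wiring Φ (inj₁ a))) (trans (cong (wiring⁻¹ Φ) e) (wiring⁻¹-wiring Φ (inj₁ a'))))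

    θ⁻θ : ∀ a → θ⁻ (θ a) ≡ a
    θ⁻θ a = h (TV (wiring Φ (inj₁ a))) refl
      where
        h : ∀ z e → θ⁻ (θh a z e) ≡ a
        h (inj₁ q) e = winj (trans (srcT-spec q) (trans (sym (cong TVinv e)) (TV-inv _)))
        h (inj₂ y) e = discard-emb-index V₋ isT a _

    θ-q : ∀ a q → TV (wiring Φ (inj₁ a)) ≡ inj₁ q → θ a ≡ inj₁ q
    θ-q a q e = h (TV (wiring Φ (inj₁ a))) refl e
      where
        h : ∀ z (e : TV (wiring Φ (inj₁ a)) ≡ z) → z ≡ inj₁ q → θh a z e ≡ inj₁ q
        h (inj₁ q) e refl = refl

    θ-r : ∀ a (e : isT a ≡ false) → θ a ≡ inj₂ (discard-index V₋ isT a e)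
    θ-r a e = h (TV (wiring Φ (inj₁ a))) refl
      where
        h : ∀ z (e' : TV (wiring Φ (inj₁ a)) ≡ z) → θh a z e' ≡ inj₂ (discard-index V₋ isT a e)
        h (inj₁ q) e' = ⊥-elim (true≢false (trans (sym (cong isInj₁ e')) e))
        h (inj₂ y) e' = cong inj₂ (discard-index-irrelevant V₋ isT _ _ refl)

    θθ⁻ : ∀ z → θ (θ⁻ z) ≡ z
    θθ⁻ (inj₁ q) = θ-q (srcT q) q (trans (cong TV (srcT-spec q)) (TV-TVinv (inj₁ q)))
    θθ⁻ (inj₂ r) = trans (θ-r (discard-emb V₋ isT r) (discard-emb-false V₋ isT r)) (cong inj₂ (discard-index-emb V₋ isT r _))

    θ-ty : ∀ a → Sum.[ ty T₋ , ty R ]′ (θ a) ≡ ty V₋ a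
    θ-ty a = h (TV (wiring Φ (inj₁ a))) refl
      where
        h : ∀ z e → Sum.[ ty T₋ , ty R ]′ (θh a z e) ≡ ty V₋ a
        h (inj₁ q) e = trans (sym (portsTy-pR proj₁ rest (t ∷ []) (inj₁ q)))
                        (trans (cong (tgtTy L v) (trans (sym (cong TVinv e)) (TV-inv (wiring Φ (inj₁ a))))) (wiring-typed Φ (inj₁ a)))
        h (inj₂ y) e = trans (sym (ty-discard-emb V₋ isT (discard-index V₋ isT a (cong isInj₁ e)))) (cong (ty V₋) (discard-emb-index V₋ isT a (cong isInj₁ e)))

    fP : Src [] (V₋ , T₋ ++ R) → Tgt [] (V₋ , T₋ ++ R)
    fP (inj₁ a) = inj₂ (join T₋ R (θ a))
    gP : Tgt [] (V₋ , T₋ ++ R) → Src [] (V₋ , T₋ ++ R)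
    gP (inj₂ y) = inj₁ (θ⁻ (split T₋ R y))

    opaque
      P : WD [] (V₋ , T₋ ++ R)
      P = fromWiring fP gP
        (λ { (inj₁ a) → cong inj₁ (trans (cong θ⁻ (split-join T₋ R (θ a))) (θ⁻θ a)) })
        (λ { (inj₂ y) → cong inj₂ (trans (cong (join T₋ R) (θθ⁻ (split T₋ R y))) (join-split T₋ R y)) })
        (λ { (inj₁ a) → trans (join-ty T₋ R (θ a)) (θ-ty a) })
        (λ ())

    opaque
      unfolding P
      P-w : ∀ a → wiring P (inj₁ a) ≡ inj₂ (join T₋ R (θ a))
      P-w a = refl

    lM : Port T₊ ⊎ Port R → Port V₋ ⊎ (Port T₊ ⊎ OutP rest)
    lM (inj₁ q) = inj₂ (inj₁ q)
    lM (inj₂ r) = inj₁ (discard-emb V₋ isT r)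

    liftS : Src rest (M , V₊) → Port V₋ ⊎ (Port T₊ ⊎ OutP rest)
    liftS (inj₁ m) = lM (split T₊ R m)
    liftS (inj₂ p) = inj₂ (inj₂ p)

    nolM : ∀ z → isInj₁ (TV (wiring Φ (SVinv (lM z)))) ≡ false
    nolM (inj₁ q) = tout-not-into-t q
    nolM (inj₂ r) = discard-emb-false V₋ isT r

    nolift : ∀ x → isInj₁ (TV (wiring Φ (SVinv (liftS x)))) ≡ false
    nolift (inj₁ m) = nolM (split T₊ R m)
    nolift (inj₂ p) = rout-not-into-t p

    strip : (z : Port T₋ ⊎ (InP rest ⊎ Port V₊)) → isInj₁ z ≡ false → InP rest ⊎ Port V₊
    strip (inj₂ y) _ = y

    strip-eq : ∀ z e → inj₂ (strip z e) ≡ z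
    strip-eq (inj₂ y) _ = refl

    strip-irr : ∀ {z z'} e e' → z ≡ z' → strip z e ≡ strip z' e'
    strip-irr {inj₂ y} e e' refl = refl

    unl : (s : Port V₋ ⊎ (Port T₊ ⊎ OutP rest)) → isInj₁ (TV (wiring Φ (SVinv s))) ≡ false → Src rest (M , V₊)
    unl (inj₁ a) e = inj₁ (inr T₊ R (discard-index V₋ isT a e))
    unl (inj₂ (inj₁ q)) _ = inj₁ (inl T₊ R q)
    unl (inj₂ (inj₂ r)) _ = inj₂ r

    unl-irr : ∀ {s s'} e e' → s ≡ s' → unl s e ≡ unl s' e'
    unl-irr {inj₁ a} e e' refl = cong (λ z → inj₁ (inr T₊ R z)) (discard-index-irrelevant V₋ isT e e' refl)
    unl-irr {inj₂ (inj₁ q)} e e' refl = refl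
    unl-irr {inj₂ (inj₂ r)} e e' refl = refl

    unl-liftS : ∀ x e → unl (liftS x) e ≡ x
    unl-liftS (inj₁ m) e with split T₊ R m | join-split T₊ R m
    ... | inj₁ q | refl = refl
    ... | inj₂ r | refl = cong (λ z → inj₁ (inr T₊ R z)) (discard-index-emb V₋ isT r e)
    unl-liftS (inj₂ p) e = refl

    liftS-unl : ∀ s e → liftS (unl s e) ≡ s
    liftS-unl (inj₁ a) e rewrite split-join T₊ R (inj₂ (discard-index V₋ isT a e)) = cong inj₁ (discard-emb-index V₋ isT a e)
    liftS-unl (inj₂ (inj₁ q)) e rewrite split-join T₊ R (inj₁ q) = refl
    liftS-unl (inj₂ (inj₂ r)) e = refl

    wiring'' : Src rest (M , V₊) → Tgt rest (M , V₊)
    wiring'' x = strip (TV (wiring Φ (SVinv (liftS x)))) (nolift x)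

    ebk : ∀ y → isInj₁ (TV (wiring Φ (SVinv (SV (wiring⁻¹ Φ (TVinv (inj₂ y))))))) ≡ false
    ebk y = trans (cong (λ x → isInj₁ (TV (wiring Φ x))) (SV-inv _))
              (trans (cong (λ z → isInj₁ (TV z)) (wiring-wiring⁻¹ Φ _)) (cong isInj₁ (TV-TVinv (inj₂ y))))

    wiring''⁻¹ : Tgt rest (M , V₊) → Src rest (M , V₊)
    wiring''⁻¹ y = unl (SV (wiring⁻¹ Φ (TVinv (inj₂ y)))) (ebk y)

    wiring''⁻¹-wiring'' : ∀ x → wiring''⁻¹ (wiring'' x) ≡ x
    wiring''⁻¹-wiring'' x = trans (unl-irr _ (nolift x) eq) (unl-liftS x (nolift x))
      where
        eq : SV (wiring⁻¹ Φ (TVinv (inj₂ (wiring'' x)))) ≡ liftS x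
        eq = trans (cong (λ z → SV (wiring⁻¹ Φ (TVinv z))) (strip-eq _ (nolift x)))
             (trans (cong (λ z → SV (wiring⁻¹ Φ z)) (TV-inv _))
             (trans (cong SV (wiring⁻¹-wiring Φ _)) (SV-SVinv (liftS x))))

    wiring''-wiring''⁻¹ : ∀ y → wiring'' (wiring''⁻¹ y) ≡ y
    wiring''-wiring''⁻¹ y = strip-irr (nolift (wiring''⁻¹ y)) refl eq
      where
        eq : TV (wiring Φ (SVinv (liftS (wiring''⁻¹ y)))) ≡ inj₂ y
        eq = trans (cong (λ s → TV (wiring Φ (SVinv s))) (liftS-unl _ (ebk y)))
             (trans (cong (λ x → TV (wiring Φ x)) (SV-inv _))
             (trans (cong TV (wiring-wiring⁻¹ Φ _)) (TV-TVinv (inj₂ y))))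

    tyStrip : ∀ z e → tgtTy rest (M , V₊) (strip z e) ≡ tgtTy L v (TVinv z)
    tyStrip (inj₂ (inj₁ s)) e = sym (portsTy-pL proj₁ rest (t ∷ []) s)
    tyStrip (inj₂ (inj₂ b)) e = refl

    tyLift : ∀ x → srcTy L v (SVinv (liftS x)) ≡ srcTy rest (M , V₊) x
    tyLift (inj₁ m) with split T₊ R m | join-split T₊ R m
    ... | inj₁ q | refl = trans (portsTy-pR proj₂ rest (t ∷ []) (inj₁ q)) (sym (join-ty T₊ R (inj₁ q)))
    ... | inj₂ r | refl = trans (ty-discard-emb V₋ isT r) (sym (join-ty T₊ R (inj₂ r)))
    tyLift (inj₂ p) = portsTy-pL proj₂ rest (t ∷ []) p

    wiring''-typed : ∀ x → tgtTy rest (M , V₊) (wiring'' x) ≡ srcTy rest (M , V₊) x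
    wiring''-typed x = trans (tyStrip _ (nolift x)) (trans (cong (tgtTy L v) (TV-inv (wiring Φ (SVinv (liftS x))))) (trans (wiring-typed Φ (SVinv (liftS x))) (tyLift x)))

    step'' : ∀ {i j} → StepOf rest (M , V₊) (λ x → x) wiring'' i j → Step Φ (boxL rest (t ∷ []) i) (boxL rest (t ∷ []) j)
    step'' (x , p , s , refl , e , refl , refl) =
      wireStep Φ (inj₂ (rout p)) (rout p) (rin s) refl
        (trans (sym (TV-inv _)) (cong TVinv (trans (sym (strip-eq _ (nolift (inj₂ p)))) (cong inj₂ e))))
        (boxOf-pL proj₂ rest (t ∷ []) p) (boxOf-pL proj₁ rest (t ∷ []) s)

    path'' : ∀ {i j} → TransClosure (StepOf rest (M , V₊) (λ x → x) wiring'') i j → TransClosure (Step Φ) (boxL rest (t ∷ []) i) (boxL rest (t ∷ []) j)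
    path'' ⟦ s ⟧ = ⟦ step'' s ⟧
    path'' (s ◂ r) = step'' s ◂ path'' r

    opaque
      Φ'' : WD rest (M , V₊)
      Φ'' = fromWiring wiring'' wiring''⁻¹ wiring''⁻¹-wiring'' wiring''-wiring''⁻¹ wiring''-typed (λ i c → progress Φ _ (path'' c))

    opaque
      unfolding Φ''
      Φ''-w : ∀ x → wiring Φ'' x ≡ wiring'' x
      Φ''-w x = refl

    w : Box
    w = (M , V₊)

    opaque
      S1 : WD ((T₋ ++ R , M) ∷ []) (V₋ , M)
      S1 = compose [] (seqW V₋ (T₋ ++ R) M) P
      S3 : WD (t ∷ []) (T₋ ++ R , M)
      S3 = compose (t ∷ []) (paraW T₋ T₊ R R) (unitW R)

    opaque
      unfolding S1 S3
      S1-def : S1 ≡ compose [] (seqW V₋ (T₋ ++ R) M) P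
      S1-def = refl
      S3-def : S3 ≡ compose (t ∷ []) (paraW T₋ T₊ R R) (unitW R)
      S3-def = refl

      S3a : ∀ q → wiring S3 (inj₁ (inl T₋ R q)) ≡ inj₁ (inj₁ q)
      S3a q = CompositeWiring.composite-ii (t ∷ []) [] [] (R , R) (T₋ ++ R , M) (paraW T₋ T₊ R R) (unitW R) (inj₁ (inl T₋ R q)) (inj₁ (inj₁ (inj₁ q))) (e q)
        where e : ∀ q → wiring (paraW T₋ T₊ R R) (inj₁ (inl T₋ R q)) ≡ inj₁ (inj₁ q)
              e q rewrite split-join T₋ R (inj₁ q) = refl
      S3b : ∀ r → wiring S3 (inj₁ (inr T₋ R r)) ≡ inj₂ (inr T₊ R r)
      S3b r = CompositeWiring.composite-ii-chain (t ∷ []) [] [] (R , R) (T₋ ++ R , M) (paraW T₋ T₊ R R) (unitW R) (inj₁ (inr T₋ R r)) r r (inj₂ (inr T₊ R r)) (e r) refl refl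
        where e : ∀ r → wiring (paraW T₋ T₊ R R) (inj₁ (inr T₋ R r)) ≡ inj₁ (inj₂ (inj₁ r))
              e r rewrite split-join T₋ R (inj₂ r) = refl
      S3c : ∀ q → wiring S3 (inj₂ (inj₁ q)) ≡ inj₂ (inl T₊ R q)
      S3c q = CompositeWiring.composite-ii (t ∷ []) [] [] (R , R) (T₋ ++ R , M) (paraW T₋ T₊ R R) (unitW R) (inj₂ (inj₁ (inj₁ q))) (inj₂ (inl T₊ R q)) refl

      S1a : ∀ a → wiring S1 (inj₁ a) ≡ inj₁ (inj₁ (join T₋ R (θ a)))
      S1a a = CompositeWiring.composite-ii-chain [] [] ((T₋ ++ R , M) ∷ []) (V₋ , T₋ ++ R) (V₋ , M) (seqW V₋ (T₋ ++ R) M) P (inj₁ a) a (join T₋ R (θ a)) (inj₁ (inj₂ (inj₁ (join T₋ R (θ a))))) refl (P-w a) refl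
      S1b : ∀ m → wiring S1 (inj₂ (inj₁ m)) ≡ inj₂ m
      S1b m = CompositeWiring.composite-ii [] [] ((T₋ ++ R , M) ∷ []) (V₋ , T₋ ++ R) (V₋ , M) (seqW V₋ (T₋ ++ R) M) P (inj₂ (inj₂ (inj₁ m))) (inj₂ m) refl

    opaque
      S : WD (t ∷ []) (V₋ , M)
      S = compose [] S1 S3

    opaque
      unfolding S
      S-def : S ≡ compose [] S1 S3
      S-def = refl
      Sa-q : ∀ a q → θ a ≡ inj₁ q → wiring S (inj₁ a) ≡ inj₁ (inj₁ q)
      Sa-q a q e = CompositeWiring.composite-i [] (t ∷ []) [] (T₋ ++ R , M) (V₋ , M) S1 S3 (inj₁ a) (join T₋ R (θ a)) (inj₁ q) (S1a a)
                     (trans (cong (λ z → wiring S3 (inj₁ (join T₋ R z))) e) (S3a q))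
      Sa-r : ∀ a r → θ a ≡ inj₂ r → wiring S (inj₁ a) ≡ inj₂ (inr T₊ R r)
      Sa-r a r e = CompositeWiring.composite-ii-chain [] (t ∷ []) [] (T₋ ++ R , M) (V₋ , M) S1 S3 (inj₁ a) (join T₋ R (θ a)) (inr T₊ R r) (inj₂ (inr T₊ R r)) (S1a a)
                     (trans (cong (λ z → wiring S3 (inj₁ (join T₋ R z))) e) (S3b r)) (S1b (inr T₊ R r))
      Sc : ∀ q → wiring S (inj₂ (inj₁ q)) ≡ inj₂ (inl T₊ R q)
      Sc q = CompositeWiring.composite-iv [] (t ∷ []) [] (T₋ ++ R , M) (V₋ , M) S1 S3 (inj₁ q) (inl T₊ R q) (inj₂ (inl T₊ R q)) (S3c q) (S1b (inl T₊ R q))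

    opaque
      D' : WD (t ∷ w ∷ []) v
      D' = compose [] (seqW V₋ M V₊) S

    opaque
      unfolding D'
      D'-def : D' ≡ compose [] (seqW V₋ M V₊) S
      D'-def = refl
      D'a-q : ∀ a q → θ a ≡ inj₁ q → wiring D' (inj₁ a) ≡ inj₁ (inj₁ q)
      D'a-q a q e = CompositeWiring.composite-i [] (t ∷ []) (w ∷ []) (V₋ , M) v (seqW V₋ M V₊) S (inj₁ a) a (inj₁ q) refl (Sa-q a q e)
      D'a-r : ∀ a r → θ a ≡ inj₂ r → wiring D' (inj₁ a) ≡ inj₁ (inj₂ (inj₁ (inr T₊ R r)))
      D'a-r a r e = CompositeWiring.composite-ii-chain [] (t ∷ []) (w ∷ []) (V₋ , M) v (seqW V₋ M V₊) S (inj₁ a) a (inr T₊ R r) (inj₁ (inj₂ (inj₁ (inr T₊ R r)))) refl (Sa-r a r e) refl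
      D'c : ∀ q → wiring D' (inj₂ (inj₁ q)) ≡ inj₁ (inj₂ (inj₁ (inl T₊ R q)))
      D'c q = CompositeWiring.composite-iv [] (t ∷ []) (w ∷ []) (V₋ , M) v (seqW V₋ M V₊) S (inj₁ q) (inl T₊ R q) (inj₁ (inj₂ (inj₁ (inl T₊ R q)))) (Sc q) refl
      D'w : ∀ b → wiring D' (inj₂ (inj₂ (inj₁ b))) ≡ inj₂ b
      D'w b = CompositeWiring.composite-ii [] (t ∷ []) (w ∷ []) (V₋ , M) v (seqW V₋ M V₊) S (inj₂ (inj₂ (inj₁ b))) (inj₂ b) refl

    opaque
      D : WD (w ∷ t ∷ []) v
      D = SwapBoxes.swapDiagram [] t w [] D'

    opaque
      unfolding D
      D-def : D ≡ SwapBoxes.swapDiagram [] t w [] D'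
      D-def = refl
      D-w : ∀ x → wiring D x ≡ SwapBoxes.sT [] t w [] D' (wiring D' (SwapBoxes.sS' [] t w [] D' x))
      D-w x = refl

    Da-q : ∀ a q → θ a ≡ inj₁ q → wiring D (inj₁ a) ≡ inj₁ (inj₂ (inj₁ q))
    Da-q a q e = trans (D-w (inj₁ a)) (cong (SwapBoxes.sT [] t w [] D') (D'a-q a q e))
    Da-r : ∀ a r → θ a ≡ inj₂ r → wiring D (inj₁ a) ≡ inj₁ (inj₁ (inr T₊ R r))
    Da-r a r e = trans (D-w (inj₁ a)) (cong (SwapBoxes.sT [] t w [] D') (D'a-r a r e))
    Dc : ∀ q → wiring D (inj₂ (inj₂ (inj₁ q))) ≡ inj₁ (inj₁ (inl T₊ R q))
    Dc q = trans (D-w _) (cong (SwapBoxes.sT [] t w [] D') (D'c q))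
    Dw : ∀ b → wiring D (inj₂ (inj₁ b)) ≡ inj₂ b
    Dw b = trans (D-w _) (cong (SwapBoxes.sT [] t w [] D') (D'w b))

    opaque
      Φc : WD L v
      Φc = compose [] D Φ''

    Φ''-tout : ∀ q → wiring Φ'' (inj₁ (inl T₊ R q)) ≡ strip (TV (wiring Φ (inj₂ (tout q)))) (tout-not-into-t q)
    Φ''-tout q = trans (Φ''-w _) (strip-irr _ _ (cong (λ z → TV (wiring Φ (SVinv (lM z)))) (split-join T₊ R (inj₁ q))))

    Φ''-emb : ∀ r → wiring Φ'' (inj₁ (inr T₊ R r)) ≡ strip (TV (wiring Φ (inj₁ (discard-emb V₋ isT r)))) (discard-emb-false V₋ isT r)
    Φ''-emb r = trans (Φ''-w _) (strip-irr _ _ (cong (λ z → TV (wiring Φ (SVinv (lM z)))) (split-join T₊ R (inj₂ r))))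

    Φ''-rout : ∀ p → wiring Φ'' (inj₂ p) ≡ strip (TV (wiring Φ (inj₂ (rout p)))) (rout-not-into-t p)
    Φ''-rout p = Φ''-w _

    opaque
      unfolding Φc
      Φc-def : Φc ≡ compose [] D Φ''
      Φc-def = refl

      fin-u : ∀ u m (y : InP rest ⊎ Port V₊) → wiring D (Comp.uΦ [] rest (t ∷ []) w v u) ≡ Comp.tiΦ [] rest (t ∷ []) w v m →
              wiring Φ'' (inj₁ m) ≡ y → wiring Φc (Comp.uΧ [] rest (t ∷ []) w v u) ≡ TVinv (inj₂ y)
      fin-u u m (inj₁ s) eD e = CompositeWiring.composite-i [] rest (t ∷ []) w v D Φ'' u m s eD e
      fin-u u m (inj₂ b) eD e = CompositeWiring.composite-ii-chain [] rest (t ∷ []) w v D Φ'' u m b (inj₂ b) eD e (Dw b)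

      fin-r : ∀ r (y : InP rest ⊎ Port V₊) → wiring Φ'' (inj₂ r) ≡ y → wiring Φc (Comp.rΧ [] rest (t ∷ []) w v r) ≡ TVinv (inj₂ y)
      fin-r r (inj₁ s) e = CompositeWiring.composite-iii [] rest (t ∷ []) w v D Φ'' r s e
      fin-r r (inj₂ b) e = CompositeWiring.composite-iv [] rest (t ∷ []) w v D Φ'' r b (inj₂ b) e (Dw b)

      fin-q : ∀ a q → wiring D (inj₁ a) ≡ inj₁ (inj₂ (inj₁ q)) → wiring Φc (inj₁ a) ≡ inj₁ (tin q)
      fin-q a q e = CompositeWiring.composite-ii [] rest (t ∷ []) w v D Φ'' (inj₁ a) (inj₁ (inj₂ (inj₁ q))) e

    eqS : ∀ s → wiring Φc (SVinv s) ≡ wiring Φ (SVinv s)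
    eqS (inj₁ a) = h (TV (wiring Φ (inj₁ a))) refl
      where
        h : ∀ z → TV (wiring Φ (inj₁ a)) ≡ z → wiring Φc (inj₁ a) ≡ wiring Φ (inj₁ a)
        h (inj₁ q) e = trans (fin-q a q (Da-q a q (θ-q a q e)))
                         (trans (sym (cong TVinv e)) (TV-inv (wiring Φ (inj₁ a))))
        h (inj₂ y) e = trans (fin-u (inj₁ a) (inr T₊ R r) y (Da-r a r (θ-r a ea))
                         (trans (Φ''-emb r) (strip-irr _ refl (trans (cong (λ z → TV (wiring Φ (inj₁ z))) (discard-emb-index V₋ isT a ea)) e))))
                         (trans (sym (cong TVinv e)) (TV-inv (wiring Φ (inj₁ a))))
          where
            ea : isT a ≡ false
            ea = cong isInj₁ e
            r : Port R
            r = discard-index V₋ isT a ea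
    eqS (inj₂ (inj₁ q)) = trans (fin-u (inj₂ (inj₂ (inj₁ q))) (inl T₊ R q) _ (Dc q) (Φ''-tout q))
                            (trans (cong TVinv (strip-eq _ (tout-not-into-t q))) (TV-inv (wiring Φ (inj₂ (tout q)))))
    eqS (inj₂ (inj₂ r)) = trans (fin-r r _ (Φ''-rout r)) (trans (cong TVinv (strip-eq _ (rout-not-into-t r))) (TV-inv (wiring Φ (inj₂ (rout r)))))

    Φc-eq : ∀ x → wiring Φc x ≡ wiring Φ x
    Φc-eq x = subst (λ z → wiring Φc z ≡ wiring Φ z) (SV-inv x) (eqS (SV x))

  searchPorts : ∀ f ts (P : Ports f ts → Bool) → (∀ p → P p ≡ false) ⊎ Σ (Ports f ts) (λ p → P p ≡ true)
  searchPorts f [] P = inj₁ (λ ())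
  searchPorts f (b ∷ bs) P with searchFin _ (λ i → P (inj₁ i))
  ... | inj₂ (i , e) = inj₂ (inj₁ i , e)
  ... | inj₁ h with searchPorts f bs (λ q → P (inj₂ q))
  ...   | inj₂ (q , e) = inj₂ (inj₂ q , e)
  ...   | inj₁ h' = inj₁ (λ { (inj₁ i) → h i ; (inj₂ q) → h' q })

  -- Without a minimal box, following predecessors from k0 visits more than length ts boxes,
  -- so by the pigeonhole principle some box repeats, giving a cycle.
  module MinimalBox {ts v} (Φ : WD ts v) where

    stepFrom : ∀ k p → entersBox ts v k (wiring Φ (inj₂ p)) ≡ true → Step Φ (boxOf proj₂ ts p) k
    stepFrom k p e with wiring Φ (inj₂ p) in ew
    ... | inj₁ q = wireStep Φ (inj₂ p) p q refl ew refl (does-≟⇒≡ e)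

    minOrPred : ∀ k → Minimal Φ k ⊎ Σ (Fin (length ts)) (λ j → Step Φ j k)
    minOrPred k with searchPorts proj₂ ts (λ p → entersBox ts v k (wiring Φ (inj₂ p)))
    ... | inj₁ h = inj₁ h
    ... | inj₂ (p , e) = inj₂ (boxOf proj₂ ts p , stepFrom k p e)

    isMin : Fin (length ts) → Bool
    isMin k = isInj₁ (minOrPred k)

    getMin : ∀ k → isMin k ≡ true → Minimal Φ k
    getMin k e with minOrPred k
    ... | inj₁ m = m

    getPred : ∀ k → isMin k ≡ false → Σ (Fin (length ts)) (λ j → Step Φ j k)
    getPred k e with minOrPred k
    ... | inj₂ s = s

    module Iter (h : ∀ k → isMin k ≡ false) (k0 : Fin (length ts)) where
      it : ℕ → Fin (length ts)
      it zero = k0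
      it (suc m) = proj₁ (getPred (it m) (h (it m)))

      pathIt : ∀ d m → TransClosure (Step Φ) (it (suc (d + m))) (it m)
      pathIt zero m = ⟦ proj₂ (getPred (it m) (h (it m))) ⟧
      pathIt (suc d) m = proj₂ (getPred (it (suc (d + m))) (h _)) ◂ pathIt d m

      cyc : ⊥
      cyc with pigeonhole (ℕP.n<1+n (length ts)) (λ i → it (toℕ i))
      ... | i , j , i<j , e with ℕP.m≤n⇒∃[o]m+o≡n i<j
      ...   | o , eo = progress Φ (it (toℕ i)) (subst (λ z → TransClosure (Step Φ) z (it (toℕ i))) eq (pathIt o (toℕ i)))
        where
          eq : it (suc (o + toℕ i)) ≡ it (toℕ i)
          eq = trans (cong (λ z → it (suc z)) (ℕP.+-comm o (toℕ i))) (trans (cong it eo) (sym e))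

    minimal-exists : Fin (length ts) → Σ (Fin (length ts)) (Minimal Φ)
    minimal-exists k0 with searchFin _ isMin
    ... | inj₂ (k , e) = k , getMin k e
    ... | inj₁ h = ⊥-elim (Iter.cyc h k0)

  splitAtBox : ∀ (ts : List Box) (k : Fin (length ts)) → Σ (List Box) λ pre → Σ Box λ a → Σ (List Box) λ post →
         Σ (pre ++ a ∷ post ≡ ts) λ e → subst Index e (boxR pre (a ∷ post) zero) ≡ k
  splitAtBox (b ∷ bs) zero = [] , b , bs , refl , refl
  splitAtBox (b ∷ bs) (suc k) with splitAtBox bs k
  ... | pre , a , post , e , ek = b ∷ pre , a , post , cong (b ∷_) e , trans (subst-suc b e _) (cong suc ek)

  minimal-subst : ∀ {X Y : List Box} {v} (e : X ≡ Y) (Φ : WD X v) k → Minimal Φ k →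
            Minimal (subst (λ l → WD l v) e Φ) (subst Index e k)
  minimal-subst refl Φ k m = m

  boxR-shift : ∀ (pre : List Box) b a post →
    subst Index (sym (++-assoc pre (b ∷ []) (a ∷ post))) (boxR pre (b ∷ a ∷ post) (suc zero))
    ≡ boxR (pre ++ b ∷ []) (a ∷ post) zero
  boxR-shift [] b a post = refl
  boxR-shift (c ∷ pre) b a post = trans (subst-sym-suc c (++-assoc pre (b ∷ []) (a ∷ post)) _) (cong suc (boxR-shift pre b a post))

  transposeBox-boxR : ∀ pre (a b : Box) post → transposeBox pre a b post (boxR pre (a ∷ b ∷ post) zero) ≡ boxR pre (b ∷ a ∷ post) (suc zero)
  transposeBox-boxR []        a b post = refl
  transposeBox-boxR (c ∷ pre) a b post = cong suc (transposeBox-boxR pre a b post)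

  swap-minimal : ∀ pre a b post {v} (Φ : WD (pre ++ a ∷ b ∷ post) v) → Minimal Φ (boxR pre (a ∷ b ∷ post) zero) →
            Minimal (SwapBoxes.swapDiagram pre a b post Φ) (boxR pre (b ∷ a ∷ post) (suc zero))
  swap-minimal pre a b post {v} Φ mn p with wiring Φ (inj₂ (swapP proj₂ pre b a post p)) in ew
  ... | inj₂ _ = refl
  ... | inj₁ q0 = trans (cong (λ k → does (boxOf proj₁ (pre ++ b ∷ a ∷ post) (swapP proj₁ pre a b post q0) ≟ k)) (sym (transposeBox-boxR pre a b post)))
                   (trans (cong (λ k → does (k ≟ transposeBox pre a b post (boxR pre (a ∷ b ∷ post) zero))) (boxOf-swapP proj₁ pre a b post q0))
                   (trans (does-≟-injective (transposeBox pre a b post) (transposeBox-injective pre a b post) _ _)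
                   (trans (cong (entersBox (pre ++ a ∷ b ∷ post) v (boxR pre (a ∷ b ∷ post) zero)) (sym ew)) (mn (swapP proj₂ pre b a post p)))))

  module Fullness (H K : Algebra) (g : ∀ {t} → obj H t → obj K t)
    (g-id : ∀ A → g (idOf H A) ≡ idOf K A)
    (g-seq : ∀ {A B C} (f : HomOf H A B) (h : HomOf H B C) → g (seqOf H f h) ≡ seqOf K (g f) (g h))
    (g-para : ∀ {A B A' B'} (f : HomOf H A B) (h : HomOf H A' B') → g (paraOf H f h) ≡ paraOf K (g f) (g h))
    (g-σ : ∀ A B → g (act H (symW A B) []) ≡ act K (symW A B) []) where

    open GeneratorNaturality H K g g-id g-seq g-para g-σ
    open PermutationNaturality H K g g-id g-seq g-para g-σ using (natural-permutation)

    natural-peel : ∀ rest t v (Φ : WD (rest ++ t ∷ []) v) (mn : Minimal Φ (boxR rest (t ∷ []) zero)) →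
              (∀ v' (Ψ : WD rest v') → Natural Ψ) → Natural Φ
    natural-peel rest t v Φ mn IH = natural-≗wiring Φc Φ Φc-eq nΦc
      where
        open PeelMinimalBox rest t v Φ mn
        nS1 : Natural S1
        nS1 = subst (λ Z → Natural Z) (sym S1-def) (natural-composite [] [] _ (seqW _ _ _) P (natural-seq _ _ _) (natural-permutation _ _ P))
        nS3 : Natural S3
        nS3 = subst (λ Z → Natural Z) (sym S3-def) (natural-composite (t ∷ []) [] [] (paraW _ _ _ _) (unitW _) (natural-para _ _ _ _) (natural-unit _))
        nS : Natural S
        nS = subst (λ Z → Natural Z) (sym S-def) (natural-composite [] (t ∷ []) [] S1 S3 nS1 nS3)
        nD' : Natural D'
        nD' = subst (λ Z → Natural Z) (sym D'-def) (natural-composite [] (t ∷ []) (w ∷ []) (seqW _ _ _) S (natural-seq _ _ _) nS)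
        nD : Natural D
        nD = subst (λ Z → Natural Z) (sym D-def) (natural-swap [] t w [] D' (SwapBoxes.swapDiagram [] t w [] D') (SwapBoxes.swapDiagram-isSwapped [] t w [] D') nD')
        nΦc : Natural Φc
        nΦc = subst (λ Z → Natural Z) (sym Φc-def) (natural-composite [] rest (t ∷ []) D Φ'' nD (IH _ Φ''))

    natural-moveToEnd : ∀ n pre a post {v} (Φ : WD (pre ++ a ∷ post) v) → Minimal Φ (boxR pre (a ∷ post) zero) →
              length (pre ++ post) ≡ n → (∀ ts' v' (Ψ : WD ts' v') → length ts' ≡ n → Natural Ψ) → Natural Φ
    natural-moveToEnd n pre a [] Φ mn len IH =
      natural-peel pre a _ Φ mn (λ v' Ψ → IH pre v' Ψ (trans (sym (cong length (++-identityʳ pre))) len))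
    natural-moveToEnd n pre a (b ∷ post) {v} Φ mn len IH =
      natural-unswap pre a b post Φ Φ' (SwapBoxes.swapDiagram-isSwapped pre a b post Φ)
        (natural-cast e' Φ' (natural-moveToEnd n (pre ++ b ∷ []) a post (subst (λ l → WD l v) e' Φ')
          (subst (Minimal (subst (λ l → WD l v) e' Φ')) (boxR-shift pre b a post)
            (minimal-subst e' Φ' _ (swap-minimal pre a b post Φ mn)))
          (trans (cong length (++-assoc pre (b ∷ []) post)) len) IH))
      where
        Φ' : WD (pre ++ b ∷ a ∷ post) v
        Φ' = SwapBoxes.swapDiagram pre a b post Φ
        e' : pre ++ b ∷ a ∷ post ≡ (pre ++ b ∷ []) ++ a ∷ post
        e' = sym (++-assoc pre (b ∷ []) (a ∷ post))

    natural-length : ∀ n ts v (Φ : WD ts v) → length ts ≡ n → Natural Φ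
    natural-length n [] v Φ e = natural-permutation (proj₁ v) (proj₂ v) Φ
    natural-length zero (b ∷ bs) v Φ ()
    natural-length (suc n) (b ∷ bs) v Φ e with MinimalBox.minimal-exists Φ zero
    ... | k , mn with splitAtBox (b ∷ bs) k
    ...   | pre , a , post , eL , ek =
      natural-cast (sym eL) Φ (natural-moveToEnd n pre a post Φ0 mn0 len (λ ts' v' Ψ l → natural-length n ts' v' Ψ l))
      where
        Φ0 : WD (pre ++ a ∷ post) v
        Φ0 = subst (λ l → WD l v) (sym eL) Φ
        mn0 : Minimal Φ0 (boxR pre (a ∷ post) zero)
        mn0 = subst (Minimal Φ0) (trans (cong (subst Index (sym eL)) (sym ek)) (subst-sym-subst eL)) (minimal-subst (sym eL) Φ k mn)
        len : length (pre ++ post) ≡ n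
        len = ℕP.suc-injective (trans (sym (length-++-∷ pre a post)) (trans (cong length eL) e))

    natural-all : ∀ {ts v} (Φ : WD ts v) → Natural Φ
    natural-all {ts} {v} Φ = natural-length (length ts) ts v Φ refl

  symmetryOf : (H : Algebra) → ∀ A B → HomOf H (A ++ B) (B ++ A)
  symmetryOf H A B = act H (symW A B) []

  module SMCLawsOf (H : Algebra) where
    open SMCLaws H
    open StrictnessLaws H
    open HexagonLaw H

    smcLaws : IsStrictSMC (HomOf H) (idOf H) (seqOf H) (paraOf H) (symmetryOf H)
    smcLaws = record
      { ⨾-idˡ = ⨾-idˡ'
      ; ⨾-idʳ = ⨾-idʳ'
      ; ⨾-assoc = ⨾-assoc'
      ; ⊗-id = ⊗-id'
      ; ⊗-⨾ = ⊗-⨾'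
      ; ⊗-unitˡ = ⊗-unitˡ'
      ; ⊗-unitʳ = ⊗-unitʳ'
      ; ⊗-assoc = ⊗-assoc'
      ; σ-natural = σ-natural'
      ; σ-inv = σ-inv'
      ; σ-hexagon = σ-hexagon' }

  F₀ : Algebra → StrictSMC
  F₀ H = mkSMC H (symmetryOf H) (SMCLawsOf.smcLaws H)

  F₁ : ∀ {H K} → AlgHom H K → SMFun (F₀ H) (F₀ K)
  F₁ {H} {K} α = record
    { fun = comp α
    ; fun-id = λ A → natural α (unitW A) []
    ; fun-⨾ = λ f g → natural α (seqW _ _ _) (f ∷ g ∷ [])
    ; fun-⊗ = λ f g → natural α (paraW _ _ _ _) (f ∷ g ∷ [])
    ; fun-σ = λ A B → natural α (symW A B) [] }

  fromSMFun : ∀ {H K} (G : SMFun (F₀ H) (F₀ K)) → AlgHom H K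
  fromSMFun {H} {K} G = record
    { comp = λ {t} x → fun G {proj₁ t} {proj₂ t} x
    ; natural = Fullness.natural-all H K (λ {t} x → fun G {proj₁ t} {proj₂ t} x)
                  (fun-id G) (fun-⨾ G) (fun-⊗ G) (fun-σ G) }

  functor : FullyFaithfulFunctor F₀
  functor = record
    { F₁ = F₁
    ; F₁-resp = λ e {A} {B} f → e (A , B) f
    ; F₁-id = λ H f → refl
    ; F₁-∘ = λ α β f → refl
    ; faithful = λ e t x → e {proj₁ t} {proj₂ t} x
    ; full = λ G → fromSMFun G , (λ f → refl) }

theorem5p2 : (τ : Set) → WiringDiagrams.Theorem5p2 τ
theorem5p2 τ = record
  { symmetryOf = symmetryOf τ
  ; smcLaws    = SMCLawsOf.smcLaws τ
  ; functor    = functor τ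
  }
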